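{- Let $S:\mathrm{NW}(\Delta)\to\mathbb K$ be a regular nested word series. Then $\pi(S):\Delta^*\to\mathbb K$ is an algebraic formal power series.
   Context: $\mathbb K$ commutative semiring with $0\ne1$; $\Delta$ finite alphabet; $\varepsilon$ empty word. Nested words: a nesting relation of width $n$ is a binary relation $\nu$ on $[n]$ with $\nu(i,j)\Rightarrow i<j$; $\nu(i,j),\nu(i,j')\Rightarrow j=j'$; $\nu(i,j),\nu(i',j)\Rightarrow i=i'$; $\nu(i,j),\nu(i',j'),i<i'\Rightarrow j<i'$ or $j'<j$. A nested word is $(w,\nu)$, $w=a_1\dots a_n\in\Delta^+$, $\nu$ of width $n$; $(i,j)\in\nu$: $i$ call, $j$ return; others internal. $\pi(w,\nu)=w$ and $(\pi(S),w)=\sum_{nw:\pi(nw)=w}(S,nw)$. WNWA: $\mathcal A=(Q,\iota,(\delta_{call},\delta_{int},\delta_{ret}),\kappa)$, $Q$ finite, $\delta_{call},\delta_{int}:Q\times\Delta\times Q\to\mathbb K$, $\delta_{ret}:Q\times Q\times\Delta\times Q\to\mathbb K$, $\iota,\kappa:Q\to\mathbb K$; a run on $(a_1\dots a_n,\nu)$ is $(q_0..q_n)$ with weight $\prod_j$ of $\delta_{call}(q_{j-1},a_j,q_j)$ ($j$ call), $\delta_{int}(q_{j-1},a_j,q_j)$ ($j$ internal), $\delta_{ret}(q_{j-1},q_{i-1},a_j,q_j)$ ($(i,j)\in\nu$); $(\|\mathcal A\|,nw)=\sum_{q_0,q_n}\iota(q_0)\sum_{\text{runs }q_0\to q_n}\mathrm{weight}\cdot\kappa(q_n)$.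 Regular: $=\|\mathcal A\|$ for some WNWA. Algebraic series: for variables $\mathcal X$ disjoint from $\Delta$, a polynomial is $P:(\Delta\cup\mathcal X)^*\to\mathbb K$ with finite support; an algebraic system is $(P_X)_{X\in\mathcal X}$; a solution is $(S_X)_X$, $S_X:\Delta^*\to\mathbb K$, with $S_X=\sum_{u_1X_1\dots u_kX_ku_{k+1}\in\mathrm{supp}(P_X)}(P_X,u_1X_1\dots u_kX_ku_{k+1})\,u_1S_{X_1}\cdots u_kS_{X_k}u_{k+1}$ (Cauchy product, words as characteristic series). Proper: $(P_X,Y)=(P_X,\varepsilon)=0$ for all $X,Y$; a proper system has a unique quasiregular solution ($(S_X,\varepsilon)=0$ for all $X$). A series is algebraic if it is a component of the quasiregular solution of a proper algebraic system. -}

module Defs where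

open import Level using (Level; _⊔_)
open import Algebra.Bundles using (CommutativeSemiring)
open import Data.Bool.Base using (Bool; true; false; T; _∧_; _∨_; not; if_then_else_)
open import Data.Nat.Base using (ℕ; zero; suc; _<ᵇ_; _≡ᵇ_)
open import Data.Fin.Base using (Fin; toℕ; inject₁) renaming (suc to fsuc; zero to fzero)
open import Data.Fin.Properties using (_≟_)
open import Data.Vec.Base using (Vec; []; _∷_; lookup; head; last; fromList)
open import Data.List.Base using (List; []; _∷_; map; foldr; concatMap; allFin; [_]; length)
import Data.List.Properties as ListP
import Data.Sum.Properties as SumP
open import Data.Sum.Base using (_⊎_; inj₁; inj₂)
open import Data.Product.Base using (Σ; _×_; _,_; ∃)
open import Data.Maybe.Base using (Maybe; just; nothing)
open import Relation.Nullary using (does; ¬_)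

allVecs : ∀ {a} {A : Set a} (n : ℕ) → List A → List (Vec A n)
allVecs zero    xs = [] ∷ []
allVecs (suc n) xs = concatMap (λ x → map (x ∷_) (allVecs n xs)) xs

findᵇ : ∀ {n} → (Fin n → Bool) → Maybe (Fin n)
findᵇ {zero}  p = nothing
findᵇ {suc n} p with p fzero
... | true  = just fzero
... | false with findᵇ {n} (λ i → p (fsuc i))
...   | just i  = just (fsuc i)
...   | nothing = nothing

allᶠ : ∀ {n} → (Fin n → Bool) → Bool
allᶠ {n} p = foldr (λ i b → p i ∧ b) true (allFin n)

infixr 5 _⇒ᵇ_
_⇒ᵇ_ : Bool → Bool → Bool
a ⇒ᵇ b = not a ∨ b

-- Nesting relations of width n (positions [n] = Fin n, 0-based)
-- A binary relation on Fin n, given as a Boolean matrix (each relation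
-- has exactly one representation as such a matrix).

BRel : ℕ → Set
BRel n = Vec (Vec Bool n) n

infix 8 _∋⟨_,_⟩
_∋⟨_,_⟩ : ∀ {n} → BRel n → Fin n → Fin n → Bool
ν ∋⟨ i , j ⟩ = lookup (lookup ν i) j

infix 8 _<ᶠ_ _=ᶠ_
_<ᶠ_ : ∀ {n} → Fin n → Fin n → Bool
i <ᶠ j = toℕ i <ᵇ toℕ j

_=ᶠ_ : ∀ {n} → Fin n → Fin n → Bool
i =ᶠ j = toℕ i ≡ᵇ toℕ j

isNesting : ∀ {n} → BRel n → Bool
isNesting ν =
  allᶠ λ i → allᶠ λ j → allᶠ λ i' → allᶠ λ j' →
    (ν ∋⟨ i , j ⟩ ⇒ᵇ (i <ᶠ j))
    ∧ ((ν ∋⟨ i , j ⟩ ∧ ν ∋⟨ i , j' ⟩) ⇒ᵇ (j =ᶠ j'))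
    ∧ ((ν ∋⟨ i , j ⟩ ∧ ν ∋⟨ i' , j ⟩) ⇒ᵇ (i =ᶠ i'))
    ∧ ((ν ∋⟨ i , j ⟩ ∧ ν ∋⟨ i' , j' ⟩ ∧ (i <ᶠ i')) ⇒ᵇ ((j <ᶠ i') ∨ (j' <ᶠ j)))

allBRel : (n : ℕ) → List (BRel n)
allBRel n = allVecs n (allVecs n (true ∷ false ∷ []))

-- Nested words over the alphabet Δ = Fin k.
-- width = suc n (words are nonempty)

record NW (k : ℕ) : Set where
  constructor nw
  field
    len  : ℕ
    word : Vec (Fin k) (suc len)
    rel  : BRel (suc len)
    ok   : T (isNesting rel)

module Series {c ℓ} (K : CommutativeSemiring c ℓ) where
  open CommutativeSemiring K

  Σᴸ : List Carrier → Carrier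
  Σᴸ = foldr _+_ 0#

  Πᴸ : List Carrier → Carrier
  Πᴸ = foldr _*_ 1#

  guard : (b : Bool) → (T b → Carrier) → Carrier
  guard true  f = f _
  guard false f = 0#

  π : ∀ {k} → (NW k → Carrier) → List (Fin k) → Carrier
  π S []       = 0#
  π S (a ∷ as) =
    Σᴸ (map (λ ν → guard (isNesting ν) (λ p → S (nw (length as) (fromList (a ∷ as)) ν p)))
            (allBRel (suc (length as))))

  record WNWA (k : ℕ) : Set c where
    field
      q     : ℕ
      ι     : Fin q → Carrier
      δcall : Fin q → Fin k → Fin q → Carrier
      δint  : Fin q → Fin k → Fin q → Carrier
      δret  : Fin q → Fin q → Fin k → Fin q → Carrier
      κ     : Fin q → Carrier

  module _ {k} (A : WNWA k) where
    open WNWA A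

    -- weight of the run qs = (q_0 … q_N) on (w, ν) of width N;
    -- 0-based position p reads w[p] moving from qs[p] to qs[p+1];
    -- if (i, p) ∈ ν the return transition uses qs[i] (= q_{i-1} 1-based).
    runWeight : ∀ {N} → Vec (Fin k) N → BRel N → Vec (Fin q) (suc N) → Carrier
    runWeight {N} w ν qs = Πᴸ (map step (allFin N))
      where
      step : Fin N → Carrier
      step p with findᵇ (λ i → ν ∋⟨ i , p ⟩)
      ... | just i  = δret (lookup qs (inject₁ p)) (lookup qs (inject₁ i)) (lookup w p) (lookup qs (fsuc p))
      ... | nothing =
        if allᶠ (λ j → not (ν ∋⟨ p , j ⟩))
        then δint  (lookup qs (inject₁ p)) (lookup w p) (lookup qs (fsuc p))
        else δcall (lookup qs (inject₁ p)) (lookup w p) (lookup qs (fsuc p))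

    ‖_‖ : NW k → Carrier
    ‖_‖ (nw n w ν _) =
      Σᴸ (map (λ qs → ι (head qs) * runWeight w ν qs * κ (last qs))
              (allVecs (suc (suc n)) (allFin q)))

  IsRegular : ∀ {k} → (NW k → Carrier) → Set (c ⊔ ℓ)
  IsRegular {k} S = Σ (WNWA k) λ A → ∀ x → S x ≈ ‖ A ‖ x

  FPS : ℕ → Set c
  FPS k = List (Fin k) → Carrier

  χ : ∀ {k} → List (Fin k) → FPS k
  χ u w = if does (ListP.≡-dec _≟_ u w) then 1# else 0#

  splits : ∀ {a} {A : Set a} → List A → List (List A × List A)
  splits []      = ([] , []) ∷ []
  splits (a ∷ w) = ([] , a ∷ w) ∷ map (λ { (u , v) → (a ∷ u , v) }) (splits w)

  _·_ : ∀ {k} → FPS k → FPS k → FPS k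
  (S · T) w = Σᴸ (map (λ { (u , v) → S u * T v }) (splits w))

  Sym : ℕ → ℕ → Set
  Sym k m = Fin k ⊎ Fin m

  -- a polynomial (finite support) as a finite list of monomials c·u
  Poly : ℕ → ℕ → Set c
  Poly k m = List (Carrier × List (Sym k m))

  coeff : ∀ {k m} → Poly k m → List (Sym k m) → Carrier
  coeff P u = Σᴸ (map (λ { (a , v) → if does (ListP.≡-dec (SumP.≡-dec _≟_ _≟_) v u) then a else 0# }) P)

  evalMono : ∀ {k m} → (Fin m → FPS k) → List (Sym k m) → FPS k
  evalMono S []            = χ []
  evalMono S (inj₁ a ∷ us) = χ [ a ] · evalMono S us
  evalMono S (inj₂ X ∷ us) = S X · evalMono S us

  Proper : ∀ {k m} → (Fin m → Poly k m) → Set ℓ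
  Proper {k} {m} P = ∀ X → (coeff (P X) [] ≈ 0#) × (∀ Y → coeff (P X) [ inj₂ Y ] ≈ 0#)

  IsSolution : ∀ {k m} → (Fin m → Poly k m) → (Fin m → FPS k) → Set ℓ
  IsSolution P S = ∀ X w → S X w ≈ Σᴸ (map (λ { (a , u) → a * evalMono S u w }) (P X))

  Quasiregular : ∀ {k m} → (Fin m → FPS k) → Set ℓ
  Quasiregular S = ∀ X → S X [] ≈ 0#

  -- component of the (unique) quasiregular solution of a proper system
  IsAlgebraic : ∀ {k} → FPS k → Set (c ⊔ ℓ)
  IsAlgebraic {k} T =
    Σ ℕ λ m → Σ (Fin m → Poly k m) λ P → Proper P ×
      Σ (Fin m → FPS k) λ S → IsSolution P S × Quasiregular S ×
        Σ (Fin m) λ X → ∀ w → T w ≈ S X w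

module Submission where

-- Nesting relations of width N correspond bijectively to trees of size N (a word is
-- empty, or an internal position followed by the rest, or a call, a well-nested inner
-- part, the matching return and the rest).  So π(S)(w) = Σ_ν ‖A‖(w,ν) is a sum over
-- trees, and for a fixed tree the sum over runs factorises along it.  With Y⁺_{p,r}(w)
-- the total weight of the runs from p to r over a nonempty word w, summed over all
-- trees, and Ŷ_{p,r} = Y⁺_{p,r} + [p = r]·ε, splitting off the first position gives
--   Y⁺_{p,r} = Σ δint(p,a,s)·a·Ŷ_{s,r} + Σ δcall(p,a,s)·δret(y,p,b,r')·a·Ŷ_{s,y}·b·Ŷ_{r',r},
-- a proper algebraic system, and π(S) = Σ ι(p) κ(r) Y⁺_{p,r} is one more variable Z.

open import Defs
open import Algebra.Bundles using (CommutativeSemiring)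
open import Data.Nat.Base using (ℕ)
open import Relation.Nullary using (¬_)
open import Data.Product.Base using (_,_)
open import Data.Fin.Base using () renaming (zero to fzero)

module FiniteSums {c ℓ} (K : CommutativeSemiring c ℓ) where

  open import Data.Bool.Base using (Bool; true; false; if_then_else_; _∧_)
  import Data.Bool.Properties as BoolP
  open import Data.Nat.Base using (zero; suc) renaming (_+_ to _+ℕ_)
  open import Data.Fin.Base using (Fin) renaming (zero to fzero; suc to fsuc)
  import Data.Fin.Properties as FinP
  open import Data.List.Base using (List; []; _∷_; map; concatMap; allFin; tabulate; _++_)
  open import Data.Vec.Base as V using (Vec; []; _∷_)
  import Data.Vec.Properties as VecP
  import Relation.Binary.PropositionalEquality as P
  open P using (_≡_)
  open import Relation.Nullary using (does)
  open import Relation.Nullary.Decidable using (dec-false)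
  open import Relation.Binary.Definitions using (DecidableEquality)
  open import Function.Base using (_∘_)
  open CommutativeSemiring K
  open Series K
  open import Algebra.Properties.CommutativeSemigroup +-commutativeSemigroup using (interchange)
  open import Relation.Binary.Reasoning.Setoid setoid

  sumL : ∀ {a} {A : Set a} → (A → Carrier) → List A → Carrier
  sumL f xs = Σᴸ (map f xs)

  𝟙 : Bool → Carrier
  𝟙 b = if b then 1# else 0#

  𝟙-∧ : ∀ x y → 𝟙 (x ∧ y) ≈ 𝟙 x * 𝟙 y
  𝟙-∧ true y = sym (*-identityˡ _)
  𝟙-∧ false y = sym (zeroˡ _)

  𝟙-* : ∀ b x → 𝟙 b * x ≈ (if b then x else 0#)
  𝟙-* true x = *-identityˡ x
  𝟙-* false x = zeroˡ x

  sum-cong : ∀ {a} {A : Set a} {f g : A → Carrier} xs → (∀ x → f x ≈ g x) → sumL f xs ≈ sumL g xs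
  sum-cong [] e = refl
  sum-cong (x ∷ xs) e = +-cong (e x) (sum-cong xs e)

  sum-++ : ∀ {a} {A : Set a} (f : A → Carrier) xs ys → sumL f (xs ++ ys) ≈ sumL f xs + sumL f ys
  sum-++ f [] ys = sym (+-identityˡ _)
  sum-++ f (x ∷ xs) ys = trans (+-congˡ (sum-++ f xs ys)) (sym (+-assoc _ _ _))

  sum-+ : ∀ {a} {A : Set a} (f g : A → Carrier) xs → sumL (λ x → f x + g x) xs ≈ sumL f xs + sumL g xs
  sum-+ f g [] = sym (+-identityˡ _)
  sum-+ f g (x ∷ xs) = trans (+-congˡ (sum-+ f g xs)) (interchange _ _ _ _)

  sum-*ˡ : ∀ {a} {A : Set a} (k : Carrier) (f : A → Carrier) xs → sumL (λ x → k * f x) xs ≈ k * sumL f xs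
  sum-*ˡ k f [] = sym (zeroʳ k)
  sum-*ˡ k f (x ∷ xs) = trans (+-congˡ (sum-*ˡ k f xs)) (sym (distribˡ k _ _))

  sum-*ʳ : ∀ {a} {A : Set a} (k : Carrier) (f : A → Carrier) xs → sumL (λ x → f x * k) xs ≈ sumL f xs * k
  sum-*ʳ k f [] = sym (zeroˡ k)
  sum-*ʳ k f (x ∷ xs) = trans (+-congˡ (sum-*ʳ k f xs)) (sym (distribʳ k _ _))

  sum-zero : ∀ {a} {A : Set a} {f : A → Carrier} xs → (∀ x → f x ≈ 0#) → sumL f xs ≈ 0#
  sum-zero [] e = refl
  sum-zero (x ∷ xs) e = trans (+-cong (e x) (sum-zero xs e)) (+-identityˡ _)

  sum-map : ∀ {a b} {A : Set a} {B : Set b} (f : B → Carrier) (g : A → B) xs → sumL f (map g xs) ≡ sumL (f ∘ g) xs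
  sum-map f g [] = P.refl
  sum-map f g (x ∷ xs) = P.cong (f (g x) +_) (sum-map f g xs)

  sum-concatMap : ∀ {a b} {A : Set a} {B : Set b} (f : B → Carrier) (g : A → List B) xs →
    sumL f (concatMap g xs) ≈ sumL (λ x → sumL f (g x)) xs
  sum-concatMap f g [] = refl
  sum-concatMap f g (x ∷ xs) = trans (sum-++ f (g x) (concatMap g xs)) (+-congˡ (sum-concatMap f g xs))

  sum-swap : ∀ {a b} {A : Set a} {B : Set b} (f : A → B → Carrier) xs ys →
    sumL (λ x → sumL (λ y → f x y) ys) xs ≈ sumL (λ y → sumL (λ x → f x y) xs) ys
  sum-swap f [] ys = sym (sum-zero ys (λ _ → refl))
  sum-swap f (x ∷ xs) ys = trans (+-congˡ (sum-swap f xs ys)) (sym (sum-+ (f x) (λ y → sumL (λ x → f x y) xs) ys))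

  sum-if : ∀ {a} {A : Set a} (b : Bool) (f : A → Carrier) xs → sumL (λ x → if b then f x else 0#) xs ≈ (if b then sumL f xs else 0#)
  sum-if true f xs = refl
  sum-if false f xs = sum-zero xs (λ _ → refl)

  sumFin : ∀ n → (Fin n → Carrier) → Carrier
  sumFin n f = sumL f (allFin n)

  sum-tabulate : ∀ n {a} {A : Set a} (h : A → Carrier) (g : Fin n → A) → sumL h (tabulate g) ≡ sumFin n (h ∘ g)
  sum-tabulate zero h g = P.refl
  sum-tabulate (suc n) h g = P.cong (h (g fzero) +_) (P.trans (sum-tabulate n h (g ∘ fsuc)) (P.sym (sum-tabulate n (h ∘ g) fsuc)))

  sumFin-suc : ∀ n (f : Fin (suc n) → Carrier) → sumFin (suc n) f ≡ f fzero + sumFin n (f ∘ fsuc)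
  sumFin-suc n f = P.cong (f fzero +_) (sum-tabulate n f fsuc)

  -- an enumeration L selects: summing g over the x ∈ L equal to x₀ gives g x₀,
  -- i.e. every element occurs in L exactly once
  Selects : ∀ {a} {A : Set a} → DecidableEquality A → List A → Set _
  Selects {A = A} _≟_ L = ∀ (x₀ : A) (g : A → Carrier) → sumL (λ x → if does (x ≟ x₀) then g x else 0#) L ≈ g x₀

  allFin-selects : ∀ n → Selects FinP._≟_ (allFin n)
  allFin-selects (suc n) fzero g = begin
    sumFin (suc n) (λ x → if does (x FinP.≟ fzero) then g x else 0#) ≡⟨ sumFin-suc n _ ⟩
    g fzero + sumFin n (λ x → if does (fsuc x FinP.≟ fzero) then g (fsuc x) else 0#)
      ≈⟨ +-congˡ (sum-zero (allFin n) (λ x → reflexive (P.cong (λ b → if b then g (fsuc x) else 0#) (dec-false (fsuc x FinP.≟ fzero) λ ())))) ⟩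
    g fzero + 0# ≈⟨ +-identityʳ _ ⟩
    g fzero ∎
  allFin-selects (suc n) (fsuc y) g = begin
    sumFin (suc n) (λ x → if does (x FinP.≟ fsuc y) then g x else 0#) ≡⟨ sumFin-suc n _ ⟩
    (if does (fzero FinP.≟ fsuc y) then g fzero else 0#) + sumFin n (λ x → if does (x FinP.≟ y) then g (fsuc x) else 0#)
      ≈⟨ +-cong (reflexive (P.cong (λ b → if b then g fzero else 0#) (dec-false (fzero FinP.≟ fsuc y) λ ()))) (allFin-selects n y (g ∘ fsuc)) ⟩
    0# + g (fsuc y) ≈⟨ +-identityˡ _ ⟩
    g (fsuc y) ∎

  sumFin-𝟙 : ∀ n (x₀ : Fin n) (g : Fin n → Carrier) → sumFin n (λ x → 𝟙 (does (x FinP.≟ x₀)) * g x) ≈ g x₀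
  sumFin-𝟙 n x₀ g = trans (sum-cong (allFin n) (λ x → 𝟙-* _ (g x))) (allFin-selects n x₀ g)

  bits : List Bool
  bits = true ∷ false ∷ []

  bits-selects : Selects BoolP._≟_ bits
  bits-selects true g = trans (+-congˡ (+-identityˡ _)) (+-identityʳ _)
  bits-selects false g = trans (+-identityˡ _) (+-identityʳ _)

  allVecs-suc : ∀ {a} {A : Set a} n (L : List A) (f : Vec A (suc n) → Carrier) →
    sumL f (allVecs (suc n) L) ≈ sumL (λ x → sumL (λ v → f (x ∷ v)) (allVecs n L)) L
  allVecs-suc n L f = trans (sum-concatMap f _ L) (sum-cong L (λ x → reflexive (sum-map f (x ∷_) (allVecs n L))))

  allVecs-selects : ∀ {a} {A : Set a} (_≟_ : DecidableEquality A) (L : List A) → Selects _≟_ L →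
    ∀ n → Selects (VecP.≡-dec _≟_) (allVecs n L)
  allVecs-selects _≟_ L sL zero [] g = +-identityʳ _
  allVecs-selects _≟_ L sL (suc n) (x₀ ∷ v₀) g = begin
    sumL (λ v → if does (VecP.≡-dec _≟_ v (x₀ ∷ v₀)) then g v else 0#) (allVecs (suc n) L) ≈⟨ allVecs-suc n L _ ⟩
    sumL (λ x → sumL (λ v → if does (x ≟ x₀) ∧ does (VecP.≡-dec _≟_ v v₀) then g (x ∷ v) else 0#) (allVecs n L)) L
      ≈⟨ sum-cong L (λ x → trans (sum-cong (allVecs n L) (λ v → reflexive (if-∧ (does (x ≟ x₀)) _ _))) (sum-if (does (x ≟ x₀)) _ (allVecs n L))) ⟩
    sumL (λ x → if does (x ≟ x₀) then sumL (λ v → if does (VecP.≡-dec _≟_ v v₀) then g (x ∷ v) else 0#) (allVecs n L) else 0#) L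
      ≈⟨ sum-cong L (λ x → if-cong (does (x ≟ x₀)) (allVecs-selects _≟_ L sL n v₀ (λ v → g (x ∷ v)))) ⟩
    sumL (λ x → if does (x ≟ x₀) then g (x ∷ v₀) else 0#) L ≈⟨ sL x₀ (λ x → g (x ∷ v₀)) ⟩
    g (x₀ ∷ v₀) ∎
    where
    if-∧ : ∀ (b d : Bool) (x : Carrier) → (if b ∧ d then x else 0#) ≡ (if b then (if d then x else 0#) else 0#)
    if-∧ true d x = P.refl
    if-∧ false d x = P.refl
    if-cong : ∀ b {x y} → x ≈ y → (if b then x else 0#) ≈ (if b then y else 0#)
    if-cong true e = e
    if-cong false e = refl

  allVecs-++ : ∀ {a} {A : Set a} m n (L : List A) (f : Vec A (m +ℕ n) → Carrier) →
    sumL f (allVecs (m +ℕ n) L) ≈ sumL (λ xs → sumL (λ ys → f (xs V.++ ys)) (allVecs n L)) (allVecs m L)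
  allVecs-++ zero n L f = sym (+-identityʳ _)
  allVecs-++ (suc m) n L f = begin
    sumL f (allVecs (suc (m +ℕ n)) L) ≈⟨ allVecs-suc (m +ℕ n) L f ⟩
    sumL (λ x → sumL (λ v → f (x ∷ v)) (allVecs (m +ℕ n) L)) L ≈⟨ sum-cong L (λ x → allVecs-++ m n L (λ v → f (x ∷ v))) ⟩
    sumL (λ x → sumL (λ xs → sumL (λ ys → f (x ∷ (xs V.++ ys))) (allVecs n L)) (allVecs m L)) L ≈⟨ sym (allVecs-suc m L _) ⟩
    sumL (λ xs → sumL (λ ys → f (xs V.++ ys)) (allVecs n L)) (allVecs (suc m) L) ∎

-- Two constructions build all of them: placing two relations side by side
-- (concatRel) and enclosing a relation between a matching call/return pair (enclose).
module NestingRelations where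

  open import Data.Bool.Base using (Bool; true; false; T; if_then_else_; _∧_)
  open import Data.Nat.Base using (ℕ; zero; suc; _+_; _∸_; _<_; _≤_; _<ᵇ_; _≤ᵇ_; _≡ᵇ_; z<s; s<s)
  open import Data.Nat.Properties
  open import Data.Sum.Base using (_⊎_; inj₁; inj₂)
  open import Data.Product.Base using (Σ; _,_)
  open import Data.Empty using (⊥-elim)
  open import Data.Unit.Base using (tt)
  open import Relation.Nullary using (¬_)
  open import Relation.Binary.PropositionalEquality

  Rel : Set
  Rel = ℕ → ℕ → Bool

  T⇒≡ : ∀ {b} → T b → b ≡ true
  T⇒≡ {true} _ = refl

  ¬T⇒≡ : ∀ {b} → ¬ T b → b ≡ false
  ¬T⇒≡ {false} _ = refl
  ¬T⇒≡ {true} h = ⊥-elim (h tt)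

  below-or-above : ∀ a i → (i < a) ⊎ Σ ℕ (λ x → i ≡ a + x)
  below-or-above zero i = inj₂ (i , refl)
  below-or-above (suc a) zero = inj₁ z<s
  below-or-above (suc a) (suc i) with below-or-above a i
  ... | inj₁ p = inj₁ (s<s p)
  ... | inj₂ (x , e) = inj₂ (x , cong suc e)

  <ᵇ-true : ∀ {i a} → i < a → (i <ᵇ a) ≡ true
  <ᵇ-true p = T⇒≡ (<⇒<ᵇ p)

  +-<ᵇ-false : ∀ a x → ((a + x) <ᵇ a) ≡ false
  +-<ᵇ-false a x = ¬T⇒≡ (λ h → <⇒≱ (<ᵇ⇒< (a + x) a h) (m≤m+n a x))

  a+x≮a : ∀ a x → ¬ (a + x < a)
  a+x≮a a x p = <⇒≱ p (m≤m+n a x)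

  record Nesting (R : Rel) (N : ℕ) : Set where
    field
      bnd : ∀ {i j} → T (R i j) → j < N
      lt  : ∀ {i j} → T (R i j) → i < j
      fun : ∀ {i j j'} → T (R i j) → T (R i j') → j ≡ j'
      inj : ∀ {i i' j} → T (R i j) → T (R i' j) → i ≡ i'
      nc  : ∀ {i j i' j'} → T (R i j) → T (R i' j') → i < i' → (j < i') ⊎ (j' < j)

  ∅ : Rel
  ∅ _ _ = false

  ∅-nesting : ∀ N → Nesting ∅ N
  ∅-nesting N = record { bnd = λ () ; lt = λ () ; fun = λ () ; inj = λ () ; nc = λ () }

  concatRel : ℕ → Rel → Rel → Rel
  concatRel a R₁ R₂ i j = if i <ᵇ a then R₁ i j else ((a ≤ᵇ j) ∧ R₂ (i ∸ a) (j ∸ a))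

  concat-left : ∀ a R₁ R₂ {i} j → i < a → concatRel a R₁ R₂ i j ≡ R₁ i j
  concat-left a R₁ R₂ {i} j p rewrite <ᵇ-true p = refl

  concat-right : ∀ a R₁ R₂ x y → concatRel a R₁ R₂ (a + x) (a + y) ≡ R₂ x y
  concat-right a R₁ R₂ x y rewrite +-<ᵇ-false a x | T⇒≡ (≤⇒≤ᵇ (m≤m+n a y)) | m+n∸m≡n a x | m+n∸m≡n a y = refl

  concat-right-left : ∀ a R₁ R₂ x {j} → j < a → concatRel a R₁ R₂ (a + x) j ≡ false
  concat-right-left a R₁ R₂ x {j} p rewrite +-<ᵇ-false a x | ¬T⇒≡ (λ h → <⇒≱ p (≤ᵇ⇒≤ a j h)) = refl

  data ConcatView (a : ℕ) (R₁ R₂ : Rel) (i j : ℕ) : Set where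
    left : i < a → j < a → T (R₁ i j) → ConcatView a R₁ R₂ i j
    right : ∀ x y → i ≡ a + x → j ≡ a + y → T (R₂ x y) → ConcatView a R₁ R₂ i j

  concat-view : ∀ {a R₁ R₂} → (∀ {i j} → T (R₁ i j) → j < a) → ∀ i j → T (concatRel a R₁ R₂ i j) → ConcatView a R₁ R₂ i j
  concat-view {a} {R₁} {R₂} bd i j h with below-or-above a i
  ... | inj₁ p = left p (bd r) r where r = subst T (concat-left a R₁ R₂ j p) h
  ... | inj₂ (x , refl) with below-or-above a j
  ...   | inj₁ q = ⊥-elim (subst T (concat-right-left a R₁ R₂ x q) h)
  ...   | inj₂ (y , refl) = right x y refl refl (subst T (concat-right a R₁ R₂ x y) h)

  module _ {a b : ℕ} {R₁ R₂ : Rel} (V₁ : Nesting R₁ a) (V₂ : Nesting R₂ b) where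
    private
      module V₁ = Nesting V₁
      module V₂ = Nesting V₂
      vw : ∀ i j → T (concatRel a R₁ R₂ i j) → ConcatView a R₁ R₂ i j
      vw = concat-view {a} {R₁} {R₂} V₁.bnd
      B : Rel
      B = concatRel a R₁ R₂

    concat-nesting : Nesting (concatRel a R₁ R₂) (a + b)
    concat-nesting = record { bnd = bnd ; lt = lt' ; fun = fun ; inj = inj ; nc = nc }
      where
      bnd : ∀ {i j} → T (B i j) → j < a + b
      bnd {i} {j} h with vw i j h
      ... | left p q r = <-≤-trans q (m≤m+n a b)
      ... | right x y refl refl r = +-monoʳ-< a (V₂.bnd r)
      lt' : ∀ {i j} → T (B i j) → i < j
      lt' {i} {j} h with vw i j h
      ... | left p q r = V₁.lt r
      ... | right x y refl refl r = +-monoʳ-< a (V₂.lt r)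
      fun : ∀ {i j j'} → T (B i j) → T (B i j') → j ≡ j'
      fun {i} {j} {j'} h h' with vw i j h | vw i j' h'
      ... | left p q r | left p' q' r' = V₁.fun r r'
      ... | left p q r | right x' y' e' f' r' = ⊥-elim (a+x≮a a x' (subst (_< a) e' p))
      ... | right x y refl refl r | left p' q' r' = ⊥-elim (a+x≮a a x p')
      ... | right x y refl refl r | right x' y' e' refl r' with +-cancelˡ-≡ a x x' e'
      ...   | refl = cong (a +_) (V₂.fun r r')
      inj : ∀ {i i' j} → T (B i j) → T (B i' j) → i ≡ i'
      inj {i} {i'} {j} h h' with vw i j h | vw i' j h'
      ... | left p q r | left p' q' r' = V₁.inj r r'
      ... | left p q r | right x' y' e' f' r' = ⊥-elim (a+x≮a a y' (subst (_< a) f' q))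
      ... | right x y refl refl r | left p' q' r' = ⊥-elim (a+x≮a a y q')
      ... | right x y refl refl r | right x' y' refl f' r' with +-cancelˡ-≡ a y y' f'
      ...   | refl = cong (a +_) (V₂.inj r r')
      nc : ∀ {i j i' j'} → T (B i j) → T (B i' j') → i < i' → (j < i') ⊎ (j' < j)
      nc {i} {j} {i'} {j'} h h' l with vw i j h | vw i' j' h'
      ... | left p q r | left p' q' r' = V₁.nc r r' l
      ... | left p q r | right x' y' refl f' r' = inj₁ (<-≤-trans q (m≤m+n a x'))
      ... | right x y refl refl r | left p' q' r' = ⊥-elim (a+x≮a a x (<-trans l p'))
      ... | right x y refl refl r | right x' y' refl refl r' with V₂.nc r r' (+-cancelˡ-< a x x' l)
      ...   | inj₁ z = inj₁ (+-monoʳ-< a z)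
      ...   | inj₂ z = inj₂ (+-monoʳ-< a z)

  enclose : ℕ → Rel → Rel
  enclose n R zero j = j ≡ᵇ suc n
  enclose n R (suc i) zero = false
  enclose n R (suc i) (suc j) = R i j

  data EncloseView (n : ℕ) (R : Rel) : ℕ → ℕ → Set where
    outer : EncloseView n R 0 (suc n)
    inner : ∀ x y → T (R x y) → EncloseView n R (suc x) (suc y)

  enclose-view : ∀ n R i j → T (enclose n R i j) → EncloseView n R i j
  enclose-view n R zero j h with ≡ᵇ⇒≡ j (suc n) h
  ... | refl = outer
  enclose-view n R (suc i) (suc j) h = inner i j h

  enclose-outer : ∀ n R → T (enclose n R 0 (suc n))
  enclose-outer n R = ≡⇒≡ᵇ n n refl

  module _ {n : ℕ} {R : Rel} (V : Nesting R n) where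
    private
      module V = Nesting V
      W : Rel
      W = enclose n R
      vw : ∀ i j → T (enclose n R i j) → EncloseView n R i j
      vw = enclose-view n R

    enclose-nesting : Nesting (enclose n R) (suc (suc n))
    enclose-nesting = record { bnd = λ {i} {j} → bnd {i} {j} ; lt = λ {i} {j} → lt' {i} {j}
                             ; fun = λ {i} {j} {j'} → fun {i} {j} {j'} ; inj = λ {i} {i'} {j} → inj {i} {i'} {j} ; nc = nc }
      where
      bnd : ∀ {i j} → T (W i j) → j < suc (suc n)
      bnd {i} {j} h with vw i j h
      ... | outer = ≤-refl
      ... | inner x y r = s<s (m<n⇒m<1+n (V.bnd r))
      lt' : ∀ {i j} → T (W i j) → i < j
      lt' {i} {j} h with vw i j h
      ... | outer = z<s
      ... | inner x y r = s<s (V.lt r)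
      fun : ∀ {i j j'} → T (W i j) → T (W i j') → j ≡ j'
      fun {i} {j} {j'} h h' with vw i j h | vw i j' h'
      ... | outer | outer = refl
      ... | inner x y r | inner .x y' r' = cong suc (V.fun r r')
      inj : ∀ {i i' j} → T (W i j) → T (W i' j) → i ≡ i'
      inj {i} {i'} {j} h h' with vw i j h | vw i' j h'
      ... | outer | outer = refl
      ... | outer | inner x y r = ⊥-elim (n≮n n (V.bnd r))
      ... | inner x y r | outer = ⊥-elim (n≮n n (V.bnd r))
      ... | inner x y r | inner x' .y r' = cong suc (V.inj r r')
      nc : ∀ {i j i' j'} → T (W i j) → T (W i' j') → i < i' → (j < i') ⊎ (j' < j)
      nc {i} {j} {i'} {j'} h h' l with vw i j h | vw i' j' h'
      ... | outer | outer = ⊥-elim (n≮n 0 l)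
      ... | outer | inner x y r = inj₂ (s<s (V.bnd r))
      ... | inner x y r | inner x' y' r' with V.nc r r' (≤-pred l)
      ...   | inj₁ z = inj₁ (s<s z)
      ...   | inj₂ z = inj₂ (s<s z)

-- A tree of size N describes a well-nested word of length N: nil is
-- empty, int t is an internal position followed by t, and call t u is a call position,
-- the inner part t, the matching return position, and then u.  treeRel t is the
-- nesting relation of width size t that the tree describes, and treeKind t p the
-- role (internal, call, or return matched with i) of position p.
module Trees where

  open import Data.Bool.Base using (T; if_then_else_)
  open import Data.Nat.Base using (ℕ; zero; suc; _+_; _∸_; _<_; _<ᵇ_; s≤s)
  open import Data.Nat.Properties
  open import Data.Sum.Base using (inj₁; inj₂)
  open import Data.Product.Base using (Σ; _×_; _,_)
  open import Data.Empty using (⊥-elim)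
  open import Relation.Nullary using (¬_)
  open import Relation.Binary.PropositionalEquality
  open NestingRelations

  data Tree : Set where
    nil : Tree
    int : Tree → Tree
    call : Tree → Tree → Tree

  size : Tree → ℕ
  size nil = 0
  size (int t) = suc (size t)
  size (call t u) = suc (size t + suc (size u))

  treeRel : Tree → Rel
  treeRel nil = ∅
  treeRel (int t) = concatRel 1 ∅ (treeRel t)
  treeRel (call t u) = concatRel (suc (suc (size t))) (enclose (size t) (treeRel t)) (treeRel u)

  size-call : ∀ a b → suc (suc a) + b ≡ suc (a + suc b)
  size-call a b = cong suc (sym (+-suc a b))

  treeRel-nesting : ∀ t → Nesting (treeRel t) (size t)
  treeRel-nesting nil = ∅-nesting 0
  treeRel-nesting (int t) = concat-nesting (∅-nesting 1) (treeRel-nesting t)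
  treeRel-nesting (call t u) = subst (Nesting (treeRel (call t u))) (size-call (size t) (size u))
    (concat-nesting (enclose-nesting (treeRel-nesting t)) (treeRel-nesting u))

  -- the role of a position; kret i means "return matched with the call at i"
  data Kind : Set where
    kint kcall : Kind
    kret : ℕ → Kind

  shiftKind : ℕ → Kind → Kind
  shiftKind a kint = kint
  shiftKind a kcall = kcall
  shiftKind a (kret i) = kret (a + i)

  concatKind : ℕ → (ℕ → Kind) → (ℕ → Kind) → ℕ → Kind
  concatKind a f g p = if p <ᵇ a then f p else shiftKind a (g (p ∸ a))

  concatKind-left : ∀ a f g {p} → p < a → concatKind a f g p ≡ f p
  concatKind-left a f g q rewrite <ᵇ-true q = refl

  concatKind-right : ∀ a f g x → concatKind a f g (a + x) ≡ shiftKind a (g x)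
  concatKind-right a f g x rewrite +-<ᵇ-false a x | m+n∸m≡n a x = refl

  encloseKind : ℕ → (ℕ → Kind) → ℕ → Kind
  encloseKind n f zero = kcall
  encloseKind n f (suc p) = if p <ᵇ n then shiftKind 1 (f p) else kret 0

  treeKind : Tree → ℕ → Kind
  treeKind nil p = kint
  treeKind (int t) = concatKind 1 (λ _ → kint) (treeKind t)
  treeKind (call t u) = concatKind (suc (suc (size t))) (encloseKind (size t) (treeKind t)) (treeKind u)

  NoReturnAt NoCallAt : Rel → ℕ → Set
  NoReturnAt R p = ∀ i → ¬ T (R i p)
  NoCallAt R p = ∀ j → ¬ T (R p j)

  HasKind : Rel → ℕ → Kind → Set
  HasKind R p (kret i) = T (R i p)
  HasKind R p kcall = NoReturnAt R p × Σ ℕ (λ j → T (R p j))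
  HasKind R p kint = NoReturnAt R p × NoCallAt R p

  module _ {a : ℕ} {R₁ R₂ : Rel} (V₁ : Nesting R₁ a) where
    private
      module V₁ = Nesting V₁
      vw : ∀ i j → T (concatRel a R₁ R₂ i j) → ConcatView a R₁ R₂ i j
      vw = concat-view {a} {R₁} {R₂} V₁.bnd

    noReturn-left : ∀ {p} → p < a → NoReturnAt R₁ p → NoReturnAt (concatRel a R₁ R₂) p
    noReturn-left {p} pa ni i h with vw i p h
    ... | left _ _ r = ni i r
    ... | right x y e refl r = a+x≮a a y pa

    noCall-left : ∀ {p} → p < a → NoCallAt R₁ p → NoCallAt (concatRel a R₁ R₂) p
    noCall-left {p} pa nj j h with vw p j h
    ... | left _ _ r = nj j r
    ... | right x y refl f r = a+x≮a a x pa

    noReturn-right : ∀ {p} → NoReturnAt R₂ p → NoReturnAt (concatRel a R₁ R₂) (a + p)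
    noReturn-right {p} ni i h with vw i (a + p) h
    ... | left _ q _ = a+x≮a a p q
    ... | right x y e f r with +-cancelˡ-≡ a p y f
    ...   | refl = ni x r

    noCall-right : ∀ {p} → NoCallAt R₂ p → NoCallAt (concatRel a R₁ R₂) (a + p)
    noCall-right {p} nj j h with vw (a + p) j h
    ... | left q _ _ = a+x≮a a p q
    ... | right x y e f r with +-cancelˡ-≡ a p x e
    ...   | refl = nj y r

    hasKind-concat-left : ∀ {p} k → p < a → HasKind R₁ p k → HasKind (concatRel a R₁ R₂) p k
    hasKind-concat-left {p} (kret i) pa h = subst T (sym (concat-left a R₁ R₂ p (<-trans (V₁.lt h) pa))) h
    hasKind-concat-left {p} kcall pa (ni , j , r) = noReturn-left pa ni , j , subst T (sym (concat-left a R₁ R₂ j pa)) r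
    hasKind-concat-left {p} kint pa (ni , nj) = noReturn-left pa ni , noCall-left pa nj

    hasKind-concat-right : ∀ {p} k → HasKind R₂ p k → HasKind (concatRel a R₁ R₂) (a + p) (shiftKind a k)
    hasKind-concat-right {p} (kret i) h = subst T (sym (concat-right a R₁ R₂ i p)) h
    hasKind-concat-right {p} kcall (ni , j , r) = noReturn-right ni , a + j , subst T (sym (concat-right a R₁ R₂ p j)) r
    hasKind-concat-right {p} kint (ni , nj) = noReturn-right ni , noCall-right nj

  module _ {n : ℕ} {R : Rel} where
    private
      vw : ∀ i j → T (enclose n R i j) → EncloseView n R i j
      vw = enclose-view n R

    noReturn-inner : ∀ {p} → p < n → NoReturnAt R p → NoReturnAt (enclose n R) (suc p)
    noReturn-inner {p} pn ni i h with vw i (suc p) h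
    ... | outer = n≮n n pn
    ... | inner x .p r = ni x r

    hasKind-enclose-open : HasKind (enclose n R) 0 kcall
    hasKind-enclose-open = noReturn0 , suc n , enclose-outer n R
      where
      noReturn0 : NoReturnAt (enclose n R) 0
      noReturn0 i h with vw i 0 h
      ... | ()

    hasKind-enclose-inner : ∀ {p} k → p < n → HasKind R p k → HasKind (enclose n R) (suc p) (shiftKind 1 k)
    hasKind-enclose-inner (kret i) pn h = h
    hasKind-enclose-inner {p} kcall pn (ni , j , r) = noReturn-inner pn ni , suc j , r
    hasKind-enclose-inner {p} kint pn (ni , nj) = noReturn-inner pn ni , noCall
      where
      noCall : NoCallAt (enclose n R) (suc p)
      noCall j h with vw (suc p) j h
      ... | inner .p y r = nj y r

    hasKind-enclose-close : HasKind (enclose n R) (suc n) (kret 0)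
    hasKind-enclose-close = enclose-outer n R

  bound-call : ∀ a b x → suc (suc a) + x < suc (a + suc b) → x < b
  bound-call a b x h = +-cancelˡ-< (suc (suc a)) x b (subst (suc (suc a) + x <_) (sym (size-call a b)) h)

  treeKind-correct : ∀ t p → p < size t → HasKind (treeRel t) p (treeKind t p)
  treeKind-correct (int t) p pl with below-or-above 1 p
  ... | inj₁ q rewrite concatKind-left 1 (λ _ → kint) (treeKind t) q =
    hasKind-concat-left {R₂ = treeRel t} (∅-nesting 1) kint q ((λ _ ()) , (λ _ ()))
  ... | inj₂ (x , refl) rewrite concatKind-right 1 (λ _ → kint) (treeKind t) x =
    hasKind-concat-right {R₁ = ∅} (∅-nesting 1) (treeKind t x) (treeKind-correct t x (≤-pred pl))
  treeKind-correct (call t u) p pl with below-or-above (suc (suc (size t))) p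
  ... | inj₁ q rewrite concatKind-left (suc (suc (size t))) (encloseKind (size t) (treeKind t)) (treeKind u) q =
    hasKind-concat-left {R₂ = treeRel u} (enclose-nesting (treeRel-nesting t)) (encloseKind (size t) (treeKind t) p) q (enclosed p q)
    where
    enclosed : ∀ p → p < suc (suc (size t)) → HasKind (enclose (size t) (treeRel t)) p (encloseKind (size t) (treeKind t) p)
    enclosed zero _ = hasKind-enclose-open
    enclosed (suc p') q' with below-or-above (size t) p'
    ... | inj₁ r rewrite <ᵇ-true r = hasKind-enclose-inner (treeKind t p') r (treeKind-correct t p' r)
    ... | inj₂ (x , refl) with ≤-pred q'
    ...   | h rewrite +-comm (size t) x with x
    ...     | zero rewrite ¬T⇒≡ (λ h' → n≮n (size t) (<ᵇ⇒< (size t) (size t) h')) = hasKind-enclose-close {n = size t} {R = treeRel t}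
    ...     | suc x' = ⊥-elim (<⇒≱ h (s≤s (m≤n+m _ _)))
  ... | inj₂ (x , refl) rewrite concatKind-right (suc (suc (size t))) (encloseKind (size t) (treeKind t)) (treeKind u) x =
    hasKind-concat-right {R₁ = enclose (size t) (treeRel t)} (enclose-nesting (treeRel-nesting t)) (treeKind u x)
      (treeKind-correct u x (bound-call (size t) (size u) x pl))

module TreeEncoding where

  open import Data.Bool.Base using (Bool; false; T)
  open import Data.Nat.Base using (ℕ; zero; suc; _+_; _<_; _≤_; z≤n; s≤s; z<s; s<s)
  open import Data.Nat.Properties
  open import Data.Nat.Tactic.RingSolver using (solve-∀)
  open import Data.Sum.Base using (_⊎_; inj₁; inj₂)
  open import Data.Product.Base using (Σ; _×_; _,_; proj₁; proj₂)
  open import Data.Empty using (⊥-elim)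
  open import Relation.Nullary using (¬_; yes; no)
  open import Relation.Nullary.Decidable using (T?)
  open import Relation.Binary.PropositionalEquality
  open import Relation.Binary.Definitions using (tri<; tri≈; tri>)
  open NestingRelations
  open Trees

  treeRel-beyond : ∀ t i j → ¬ (j < size t) → treeRel t i j ≡ false
  treeRel-beyond t i j h = ¬T⇒≡ (λ r → h (Nesting.bnd (treeRel-nesting t) r))

  treeRel-beyondˡ : ∀ t i j → ¬ (i < size t) → treeRel t i j ≡ false
  treeRel-beyondˡ t i j h = ¬T⇒≡ (λ r → h (<-trans (Nesting.lt (treeRel-nesting t) r) (Nesting.bnd (treeRel-nesting t) r)))

  offset-after : ∀ a n₁ n₂ → a + suc (suc n₁ + n₂) ≡ suc (suc a + n₁) + n₂
  offset-after = solve-∀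

  offset-shift : ∀ a n x → a + (suc (suc n) + x) ≡ suc (suc a + n) + x
  offset-shift = solve-∀

  offset-end : ∀ a n → a + suc (suc n) ≡ suc (suc (a + n))
  offset-end = solve-∀

  search : ∀ (f : ℕ → Bool) m → (Σ ℕ λ j → j < m × T (f j)) ⊎ (∀ j → j < m → ¬ T (f j))
  search f zero = inj₂ (λ j ())
  search f (suc m) with search f m
  ... | inj₁ (j , p , h) = inj₁ (j , m<n⇒m<1+n p , h)
  ... | inj₂ none with T? (f m)
  ...   | yes h = inj₁ (m , ≤-refl , h)
  ...   | no nh = inj₂ λ j jl → below-or-at j (m≤n⇒m<n∨m≡n (≤-pred jl))
    where
    below-or-at : ∀ j → (j < m) ⊎ (j ≡ m) → ¬ T (f j)
    below-or-at j (inj₁ x) = none j x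
    below-or-at j (inj₂ refl) = nh

  -- For a nesting relation R, a tree is built for every R-closed
  -- interval [a, b) (no arc of R crosses its boundary) by recursion on its length:
  -- if a has no partner the interval is int t, with t built for [a+1, b); otherwise a
  -- is matched with some j₀ and the interval is call t u, with t built for (a, j₀)
  -- and u for (j₀, b).
  module Decompose {R : Rel} {N : ℕ} (V : Nesting R N) where
    open Nesting V

    In : ℕ → ℕ → ℕ → Set
    In a b x = a ≤ x × x < b

    Closed : ℕ → ℕ → Set
    Closed a b = ∀ {i j} → T (R i j) → (In a b i → In a b j) × (In a b j → In a b i)

    Agrees : ℕ → Tree → Set
    Agrees a t = ∀ i j → i < size t → j < size t → treeRel t i j ≡ R (a + i) (a + j)

    Decomposition : ℕ → ℕ → Set
    Decomposition a n = Σ Tree (λ t → size t ≡ n × Agrees a t)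

    firstNotReturn : ∀ {a b} → Closed a b → a < b → NoReturnAt R a
    firstNotReturn cl ab x h = <⇒≱ (lt h) (proj₁ (proj₂ (cl h) (≤-refl , ab)))

    returnNotCall : ∀ {a j₀} → T (R a j₀) → NoCallAt R j₀
    returnNotCall {a} {j₀} r₀ y h with nc r₀ h (lt r₀)
    ... | inj₁ z = n≮n j₀ z
    ... | inj₂ z = <-asym z (lt h)

    closed-int : ∀ {a n} → Closed a (a + suc n) → NoCallAt R a → Closed (suc a) (suc a + n)
    closed-int {a} {n} cl noCall {i} {j} h = f , g
      where
      e : a + suc n ≡ suc a + n
      e = +-suc a n
      f : In (suc a) (suc a + n) i → In (suc a) (suc a + n) j
      f (ai , ib) with proj₁ (cl h) (≤-trans (n≤1+n a) ai , subst (i <_) (sym e) ib)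
      ... | (_ , jb) = <-trans ai (lt h) , subst (j <_) e jb
      g : In (suc a) (suc a + n) j → In (suc a) (suc a + n) i
      g (aj , jb) with proj₂ (cl h) (≤-trans (n≤1+n a) aj , subst (j <_) (sym e) jb)
      ... | (ai , ib) = ≤∧≢⇒< ai (λ { refl → noCall j h }) , subst (i <_) e ib

    agrees-int : ∀ {a n} t → Closed a (a + suc n) → NoCallAt R a → Agrees (suc a) t → Agrees a (int t)
    agrees-int {a} t cl noCall ag zero j _ _ rewrite +-identityʳ a = sym (¬T⇒≡ (noCall (a + j)))
    agrees-int {a} t cl noCall ag (suc i) zero _ _ rewrite +-identityʳ a =
      trans (concat-right-left 1 ∅ (treeRel t) i z<s) (sym (¬T⇒≡ (firstNotReturn cl (m<m+n a z<s) _)))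
    agrees-int {a} t cl noCall ag (suc i) (suc j) il jl rewrite +-suc a i | +-suc a j =
      trans (concat-right 1 ∅ (treeRel t) i j) (ag i j (≤-pred il) (≤-pred jl))

    module _ {a n₁ n₂ : ℕ} (cl : Closed a (a + suc (suc n₁ + n₂))) (r₀ : T (R a (suc a + n₁))) where
      private
        j₀ = suc a + n₁
        eb : a + suc (suc n₁ + n₂) ≡ suc j₀ + n₂
        eb = offset-after a n₁ n₂

      closed-inner : Closed (suc a) (suc a + n₁)
      closed-inner {i} {j} h = f , g
        where
        f : In (suc a) j₀ i → In (suc a) j₀ j
        f (ai , ib) with proj₁ (cl h) (≤-trans (n≤1+n a) ai , <-trans ib (<-≤-trans (n<1+n j₀) (subst (suc j₀ ≤_) (sym eb) (m≤m+n (suc j₀) n₂))))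
        ... | (_ , jb) = <-trans ai (lt h) , jj
          where
          jj : j < j₀
          jj with <-cmp j j₀
          ... | tri< x _ _ = x
          ... | tri≈ _ refl _ = ⊥-elim (<⇒≢ ai (sym (inj h r₀)))
          ... | tri> _ _ x with nc r₀ h ai
          ...   | inj₁ z = ⊥-elim (<-asym z ib)
          ...   | inj₂ z = ⊥-elim (<-asym z x)
        g : In (suc a) j₀ j → In (suc a) j₀ i
        g (aj , jb) with proj₂ (cl h) (≤-trans (n≤1+n a) aj , <-trans jb (<-≤-trans (n<1+n j₀) (subst (suc j₀ ≤_) (sym eb) (m≤m+n (suc j₀) n₂))))
        ... | (ai , _) = ≤∧≢⇒< ai (λ { refl → <⇒≢ jb (fun h r₀) }) , <-trans (lt h) jb

      closed-after : Closed (suc j₀) (suc j₀ + n₂)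
      closed-after {i} {j} h = f , g
        where
        a≤j₀ : a ≤ j₀
        a≤j₀ = ≤-trans (n≤1+n a) (m≤m+n (suc a) n₁)
        f : In (suc j₀) (suc j₀ + n₂) i → In (suc j₀) (suc j₀ + n₂) j
        f (ai , ib) with proj₁ (cl h) (≤-trans a≤j₀ (≤-trans (n≤1+n j₀) ai) , subst (i <_) (sym eb) ib)
        ... | (_ , jb) = <-trans ai (lt h) , subst (j <_) eb jb
        g : In (suc j₀) (suc j₀ + n₂) j → In (suc j₀) (suc j₀ + n₂) i
        g (aj , jb) with proj₂ (cl h) (≤-trans a≤j₀ (≤-trans (n≤1+n j₀) aj) , subst (j <_) (sym eb) jb)
        ... | (ai , ib) = ii , subst (i <_) eb ib
          where
          ii : j₀ < i
          ii with <-cmp i j₀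
          ... | tri> _ _ x = x
          ... | tri≈ _ refl _ = ⊥-elim (returnNotCall r₀ j h)
          ... | tri< x _ _ with m≤n⇒m<n∨m≡n ai
          ...   | inj₂ refl = ⊥-elim (<⇒≢ aj (sym (fun h r₀)))
          ...   | inj₁ ai' with nc r₀ h ai'
          ...     | inj₁ z = ⊥-elim (<-asym z x)
          ...     | inj₂ z = ⊥-elim (<-asym z aj)

    agrees-enclosed : ∀ {a} t → T (R a (suc a + size t)) → NoReturnAt R a → Closed (suc a) (suc a + size t) → Agrees (suc a) t →
      ∀ i j → i < suc (suc (size t)) → enclose (size t) (treeRel t) i j ≡ R (a + i) (a + j)
    agrees-enclosed {a} t r₀ noRet clt agT zero j _ rewrite +-identityʳ a with j ≟ suc (size t)
    ... | yes refl = trans (T⇒≡ (≡⇒≡ᵇ (size t) (size t) refl)) (sym (T⇒≡ (subst (λ z → T (R a z)) (sym (+-suc a (size t))) r₀)))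
    ... | no ne = trans (¬T⇒≡ (λ h → ne (≡ᵇ⇒≡ j (suc (size t)) h)))
                    (sym (¬T⇒≡ (λ h → ne (+-cancelˡ-≡ a j (suc (size t)) (trans (fun h r₀) (sym (+-suc a (size t))))))))
    agrees-enclosed {a} t r₀ noRet clt agT (suc i) zero _ rewrite +-identityʳ a = sym (¬T⇒≡ (noRet _))
    agrees-enclosed {a} t r₀ noRet clt agT (suc i) (suc j) ia with <-cmp i (size t)
    ... | tri> _ _ x = ⊥-elim (<⇒≱ (≤-pred ia) x)
    ... | tri≈ _ x _ = trans (treeRel-beyondˡ t i j (λ z → <⇒≢ z x))
          (sym (¬T⇒≡ (λ h → returnNotCall r₀ _ (subst (λ z → T (R z (a + suc j))) (trans (cong (a +_) (cong suc x)) (+-suc a (size t))) h))))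
    ... | tri< x _ _ with <-cmp j (size t)
    ...   | tri< y _ _ rewrite +-suc a i | +-suc a j = agT i j x y
    ...   | tri≈ _ y _ = trans (treeRel-beyond t i j (λ z → <⇒≢ z y)) (sym (¬T⇒≡ λ h → <-irrefl refl (subst (_< suc a + size t) (trans (+-suc a j) (cong (λ z → suc (a + z)) y)) (inner-end h))))
      where
      inner-end : T (R (a + suc i) (a + suc j)) → a + suc j < suc a + size t
      inner-end h = proj₂ (proj₁ (clt h) (subst (suc a ≤_) (sym (+-suc a i)) (s≤s (m≤m+n a i)) , subst (_< suc a + size t) (sym (+-suc a i)) (s≤s (+-monoʳ-< a x))))
    ...   | tri> _ _ y = trans (treeRel-beyond t i j (λ z → <-asym z y)) (sym (¬T⇒≡ λ h → <-asym (subst (_< suc a + size t) (+-suc a j) (inner-end h)) (s≤s (+-monoʳ-< a y))))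
      where
      inner-end : T (R (a + suc i) (a + suc j)) → a + suc j < suc a + size t
      inner-end h = proj₂ (proj₁ (clt h) (subst (suc a ≤_) (sym (+-suc a i)) (s≤s (m≤m+n a i)) , subst (_< suc a + size t) (sym (+-suc a i)) (s≤s (+-monoʳ-< a x))))

    module _ {a : ℕ} (t u : Tree) where
      private
        a₀ = suc (suc (size t))
        j₀ = suc a + size t
        shift : ∀ z → a + (a₀ + z) ≡ suc j₀ + z
        shift = offset-shift a (size t)

      agrees-after : Closed (suc j₀) (suc j₀ + size u) → Agrees (suc j₀) u →
        ∀ x j → a₀ + x < size (call t u) → j < size (call t u) → treeRel (call t u) (a₀ + x) j ≡ R (a + (a₀ + x)) (a + j)
      agrees-after clu agU x j il jl with below-or-above a₀ j
      ... | inj₁ ja = trans (concat-right-left a₀ (enclose (size t) (treeRel t)) (treeRel u) x ja) (sym (¬T⇒≡ leaves))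
        where
        leaves : ¬ T (R (a + (a₀ + x)) (a + j))
        leaves h with proj₁ (clu h) (subst (suc j₀ ≤_) (sym (shift x)) (m≤m+n (suc j₀) x)
                                    , subst (_< suc j₀ + size u) (sym (shift x)) (+-monoʳ-< (suc j₀) (bound-call (size t) (size u) x il)))
        ... | (b , _) = <⇒≱ (+-monoʳ-< a ja) (subst (_≤ a + j) (sym (offset-end a (size t))) b)
      ... | inj₂ (y , refl) = trans (concat-right a₀ (enclose (size t) (treeRel t)) (treeRel u) x y)
            (trans (agU x y (bound-call (size t) (size u) x il) (bound-call (size t) (size u) y jl)) (sym (cong₂ R (shift x) (shift y))))

    agrees-call : ∀ {a} t u → Closed a (a + suc (suc (size t) + size u)) → T (R a (suc a + size t)) →
      Agrees (suc a) t → Agrees (suc (suc a + size t)) u → Agrees a (call t u)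
    agrees-call {a} t u cl r₀ agT agU i j il jl with below-or-above (suc (suc (size t))) i
    ... | inj₁ ia rewrite concat-left (suc (suc (size t))) (enclose (size t) (treeRel t)) (treeRel u) j ia =
      agrees-enclosed t r₀ (firstNotReturn cl (m<m+n a z<s)) (closed-inner cl r₀) agT i j ia
    ... | inj₂ (x , refl) = agrees-after t u (closed-after cl r₀) agU x j il jl

    -- in a closed interval, a partner of its first position would lie inside it
    noPartner⇒noCall : ∀ {a b} → Closed a b → a < b → (∀ j → j < b → ¬ T (R a j)) → NoCallAt R a
    noPartner⇒noCall cl ab none j h = none j (proj₂ (proj₁ (cl h) (≤-refl , ab))) h

    decompose : ∀ fuel a n → n < fuel → Closed a (a + n) → Decomposition a n
    decompose (suc fuel) a zero _ cl = nil , refl , (λ i j ())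
    decompose (suc fuel) a (suc n) nf cl with search (R a) (a + suc n)
    ... | inj₂ none with decompose fuel (suc a) n (≤-pred nf) (closed-int cl (noPartner⇒noCall cl (m<m+n a z<s) none))
    ...   | t , refl , ag = int t , refl , agrees-int t cl (noPartner⇒noCall cl (m<m+n a z<s) none) ag
    decompose (suc fuel) a (suc n) nf cl | inj₁ (j₀ , j₀< , r₀) with below-or-above (suc a) j₀
    ... | inj₁ q = ⊥-elim (<⇒≱ (lt r₀) (≤-pred q))
    ... | inj₂ (n₁ , refl) with below-or-above (suc n₁) n
    ...   | inj₁ q = ⊥-elim (<⇒≱ (+-cancelˡ-< a (suc n₁) (suc n) (subst (_< a + suc n) (sym (+-suc a n₁)) j₀<)) q)
    ...   | inj₂ (n₂ , refl)
            with decompose fuel (suc a) n₁ (≤-trans (m≤m+n (suc n₁) n₂) (≤-trans (n≤1+n _) (≤-pred nf))) (closed-inner cl r₀)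
               | decompose fuel (suc (suc a + n₁)) n₂ (≤-trans (s≤s (m≤n+m n₂ (suc n₁))) (≤-pred nf)) (closed-after cl r₀)
    ...     | t , refl , agT | u , refl , agU = call t u , cong suc (+-suc (size t) (size u)) , agrees-call t u cl r₀ agT agU

  treeRel-surjective : ∀ {R N} → Nesting R N → Σ Tree (λ t → size t ≡ N × (∀ i j → i < N → j < N → treeRel t i j ≡ R i j))
  treeRel-surjective {R} {N} V with Decompose.decompose V (suc N) 0 N ≤-refl whole
    where
    open Nesting V
    whole : Decompose.Closed V 0 N
    whole h = (λ _ → z≤n , bnd h) , (λ _ → z≤n , <-trans (lt h) (bnd h))
  ... | t , refl , ag = t , refl , ag

  call-matched : ∀ t u → T (treeRel (call t u) 0 (suc (size t)))
  call-matched t u = subst T (sym (concat-left (suc (suc (size t))) (enclose (size t) (treeRel t)) (treeRel u) (suc (size t)) z<s)) (enclose-outer (size t) (treeRel t))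

  int-first : ∀ t j → treeRel (int t) 0 j ≡ false
  int-first t j = concat-left 1 ∅ (treeRel t) j z<s

  return<size : ∀ n₁ n₂ → suc n₁ < suc (n₁ + suc n₂)
  return<size n₁ n₂ = s≤s (subst (suc n₁ ≤_) (sym (+-suc n₁ n₂)) (s≤s (m≤m+n n₁ n₂)))

  treeRel-injective : ∀ t t' → size t ≡ size t' → (∀ i j → i < size t → j < size t → treeRel t i j ≡ treeRel t' i j) → t ≡ t'
  treeRel-injective nil nil e ag = refl
  treeRel-injective nil (int t') () ag
  treeRel-injective nil (call t' u') () ag
  treeRel-injective (int t) nil () ag
  treeRel-injective (call t u) nil () ag
  treeRel-injective (int t) (int t') e ag = cong int (treeRel-injective t t' (suc-injective e) λ i j il jl →
    trans (sym (concat-right 1 ∅ (treeRel t) i j)) (trans (ag (suc i) (suc j) (s<s il) (s<s jl)) (concat-right 1 ∅ (treeRel t') i j)))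
  treeRel-injective (int t) (call t' u') e ag = ⊥-elim (subst T (trans (sym (ag 0 (suc (size t')) z<s (subst (suc (size t') <_) (sym e) (return<size (size t') (size u'))))) (int-first t (suc (size t')))) (call-matched t' u'))
  treeRel-injective (call t u) (int t') e ag = ⊥-elim (subst T (trans (ag 0 (suc (size t)) z<s (return<size (size t) (size u))) (int-first t' (suc (size t)))) (call-matched t u))
  treeRel-injective (call t u) (call t' u') e ag = cong₂ call (treeRel-injective t t' same-inner agree-inner) (treeRel-injective u u' same-after agree-after)
    where
    n₁ = size t
    n₂ = size u
    V' = treeRel-nesting (call t' u')
    matched' : T (treeRel (call t' u') 0 (suc n₁))
    matched' = subst T (ag 0 (suc n₁) z<s (return<size n₁ n₂)) (call-matched t u)
    same-inner : size t ≡ size t'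
    same-inner = suc-injective (Nesting.fun V' {0} {suc n₁} {suc (size t')} matched' (call-matched t' u'))
    same-after : size u ≡ size u'
    same-after = suc-injective (+-cancelˡ-≡ n₁ _ _ (trans (suc-injective e) (cong (_+ suc (size u')) (sym same-inner))))
    agree-inner : ∀ i j → i < size t → j < size t → treeRel t i j ≡ treeRel t' i j
    agree-inner i j il jl = trans (sym (concat-left (suc (suc n₁)) (enclose n₁ (treeRel t)) (treeRel u) (suc j) (s<s (m<n⇒m<1+n il))))
      (trans (ag (suc i) (suc j) (s≤s (<-≤-trans il (m≤m+n n₁ (suc n₂)))) (s≤s (<-≤-trans jl (m≤m+n n₁ (suc n₂)))))
        (concat-left (suc (suc (size t'))) (enclose (size t') (treeRel t')) (treeRel u') (suc j) (s<s (m<n⇒m<1+n (subst (i <_) same-inner il)))))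
    agree-after : ∀ x y → x < size u → y < size u → treeRel u x y ≡ treeRel u' x y
    agree-after x y xl yl = trans (sym (concat-right (suc (suc n₁)) (enclose n₁ (treeRel t)) (treeRel u) x y))
      (trans (ag (suc (suc n₁) + x) (suc (suc n₁) + y) (bd xl) (bd yl))
        (subst (λ m → treeRel (call t' u') (suc (suc m) + x) (suc (suc m) + y) ≡ treeRel u' x y) (sym same-inner) (concat-right (suc (suc (size t'))) (enclose (size t') (treeRel t')) (treeRel u') x y)))
      where
      bd : ∀ {z} → z < n₂ → suc (suc n₁) + z < suc (n₁ + suc n₂)
      bd {z} zl = subst (suc (suc n₁) + z <_) (size-call n₁ n₂) (+-monoʳ-< (suc (suc n₁)) zl)


module BooleanMatrices where

  open import Data.Bool.Base using (Bool; true; false; T; _∧_; _∨_)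
  open import Data.Bool.Properties using (T-∧; T-∨)
  open import Data.Nat.Base using (ℕ; zero; suc; _<_; _≤_; _<ᵇ_; _≡ᵇ_; s≤s; z<s; s<s)
  open import Data.Nat.Properties
  open import Data.Fin.Base using (Fin; toℕ; fromℕ<) renaming (zero to fzero; suc to fsuc)
  open import Data.Fin.Properties using (toℕ-fromℕ<) renaming (suc-injective to fsuc-injective)
  open import Data.Vec.Base using (Vec; []; _∷_; lookup)
  open import Data.List.Base using (foldr; tabulate)
  open import Data.Maybe.Base using (just; nothing)
  open import Data.Sum.Base using (_⊎_; inj₁; inj₂)
  open import Data.Product.Base using (_×_; _,_; proj₁; proj₂)
  open import Data.Empty using (⊥-elim)
  open import Data.Unit.Base using (tt)
  open import Function.Base using (_∘_)
  open import Function.Bundles using (Equivalence)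
  open import Relation.Nullary using (yes; no)
  open import Relation.Binary.PropositionalEquality
  open import Defs
  open NestingRelations

  rowAt : ∀ {n} → Vec Bool n → ℕ → Bool
  rowAt [] _ = false
  rowAt (x ∷ v) zero = x
  rowAt (x ∷ v) (suc i) = rowAt v i

  asRel : ∀ {m n} → Vec (Vec Bool n) m → Rel
  asRel [] _ _ = false
  asRel (r ∷ ν) zero j = rowAt r j
  asRel (r ∷ ν) (suc i) j = asRel ν i j

  lookup-rowAt : ∀ {n} (v : Vec Bool n) (i : Fin n) → lookup v i ≡ rowAt v (toℕ i)
  lookup-rowAt (x ∷ v) fzero = refl
  lookup-rowAt (x ∷ v) (fsuc i) = lookup-rowAt v i

  ∋-asRel : ∀ {m n} (ν : Vec (Vec Bool n) m) (i : Fin m) (j : Fin n) → lookup (lookup ν i) j ≡ asRel ν (toℕ i) (toℕ j)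
  ∋-asRel (r ∷ ν) fzero j = lookup-rowAt r j
  ∋-asRel (r ∷ ν) (fsuc i) j = ∋-asRel ν i j

  rowAt-beyond : ∀ {n} (v : Vec Bool n) i → n ≤ i → rowAt v i ≡ false
  rowAt-beyond [] i _ = refl
  rowAt-beyond (x ∷ v) (suc i) (s≤s h) = rowAt-beyond v i h

  asRel-beyondˡ : ∀ {m n} (ν : Vec (Vec Bool n) m) i j → m ≤ i → asRel ν i j ≡ false
  asRel-beyondˡ [] i j _ = refl
  asRel-beyondˡ (r ∷ ν) (suc i) j (s≤s h) = asRel-beyondˡ ν i j h

  asRel-beyond : ∀ {m n} (ν : Vec (Vec Bool n) m) i j → n ≤ j → asRel ν i j ≡ false
  asRel-beyond [] i j _ = refl
  asRel-beyond (r ∷ ν) zero j h = rowAt-beyond r j h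
  asRel-beyond (r ∷ ν) (suc i) j h = asRel-beyond ν i j h

  tabulateRow : ∀ n → (ℕ → Bool) → Vec Bool n
  tabulateRow zero f = []
  tabulateRow (suc n) f = f 0 ∷ tabulateRow n (λ i → f (suc i))

  rowAt-tabulateRow : ∀ n f i → i < n → rowAt (tabulateRow n f) i ≡ f i
  rowAt-tabulateRow (suc n) f zero _ = refl
  rowAt-tabulateRow (suc n) f (suc i) (s≤s h) = rowAt-tabulateRow n (λ i → f (suc i)) i h

  tabulateRows : ∀ m n → Rel → Vec (Vec Bool n) m
  tabulateRows zero n R = []
  tabulateRows (suc m) n R = tabulateRow n (R 0) ∷ tabulateRows m n (λ i → R (suc i))

  asRel-tabulateRows : ∀ m n R i j → i < m → j < n → asRel (tabulateRows m n R) i j ≡ R i j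
  asRel-tabulateRows (suc m) n R zero j _ jl = rowAt-tabulateRow n (R 0) j jl
  asRel-tabulateRows (suc m) n R (suc i) j (s≤s il) jl = asRel-tabulateRows m n (λ i → R (suc i)) i j il jl

  matrixOf : ∀ N → Rel → BRel N
  matrixOf N R = tabulateRows N N R

  rowAt-ext : ∀ {n} (v v' : Vec Bool n) → (∀ i → i < n → rowAt v i ≡ rowAt v' i) → v ≡ v'
  rowAt-ext [] [] _ = refl
  rowAt-ext (x ∷ v) (x' ∷ v') h = cong₂ _∷_ (h 0 z<s) (rowAt-ext v v' (λ i il → h (suc i) (s<s il)))

  asRel-ext : ∀ {m n} (ν ν' : Vec (Vec Bool n) m) → (∀ i j → i < m → j < n → asRel ν i j ≡ asRel ν' i j) → ν ≡ ν'
  asRel-ext [] [] _ = refl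
  asRel-ext (r ∷ ν) (r' ∷ ν') h = cong₂ _∷_ (rowAt-ext r r' (λ j jl → h 0 j z<s jl)) (asRel-ext ν ν' (λ i j il jl → h (suc i) j (s<s il) jl))

  asRel-matrixOf : ∀ N R → Nesting R N → ∀ i j → asRel (matrixOf N R) i j ≡ R i j
  asRel-matrixOf N R V i j with i <? N | j <? N
  ... | yes il | yes jl = asRel-tabulateRows N N R i j il jl
  ... | no nil' | _ = trans (asRel-beyondˡ (matrixOf N R) i j (≮⇒≥ nil')) (sym (¬T⇒≡ (λ h → nil' (<-trans (Nesting.lt V h) (Nesting.bnd V h)))))
  ... | yes _ | no njl = trans (asRel-beyond (matrixOf N R) i j (≮⇒≥ njl)) (sym (¬T⇒≡ (λ h → njl (Nesting.bnd V h))))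

  Nesting-ext : ∀ {R R' N} → (∀ i j → R i j ≡ R' i j) → Nesting R N → Nesting R' N
  Nesting-ext {R} {R'} e V = record
    { bnd = λ {i} {j} h → Nesting.bnd V (c h)
    ; lt = λ {i} {j} h → Nesting.lt V (c h)
    ; fun = λ {i} {j} {j'} h h' → Nesting.fun V (c h) (c h')
    ; inj = λ {i} {i'} {j} h h' → Nesting.inj V (c h) (c h')
    ; nc = λ {i} {j} {i'} {j'} h h' l → Nesting.nc V (c h) (c h') l }
    where
    c : ∀ {i j} → T (R' i j) → T (R i j)
    c {i} {j} h = subst T (sym (e i j)) h

  T∧ : ∀ {x y} → T x → T y → T (x ∧ y)
  T∧ p q = Equivalence.from T-∧ (p , q)

  T∧₁ : ∀ {x y} → T (x ∧ y) → T x
  T∧₁ h = proj₁ (Equivalence.to T-∧ h)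

  T∧₂ : ∀ {x y} → T (x ∧ y) → T y
  T∧₂ {x} h = proj₂ (Equivalence.to (T-∧ {x}) h)

  ⇒ᵇ-intro : ∀ {x y} → (T x → T y) → T (x ⇒ᵇ y)
  ⇒ᵇ-intro {false} f = tt
  ⇒ᵇ-intro {true} f = f tt

  ⇒ᵇ-elim : ∀ {x y} → T (x ⇒ᵇ y) → T x → T y
  ⇒ᵇ-elim {true} h _ = h

  fold-intro : ∀ {n} (p : Fin n → Bool) m (g : Fin m → Fin n) → (∀ k → T (p (g k))) → T (foldr (λ i b → p i ∧ b) true (tabulate g))
  fold-intro p zero g h = tt
  fold-intro p (suc m) g h = T∧ (h fzero) (fold-intro p m (g ∘ fsuc) (h ∘ fsuc))

  fold-elim : ∀ {n} (p : Fin n → Bool) m (g : Fin m → Fin n) → T (foldr (λ i b → p i ∧ b) true (tabulate g)) → ∀ k → T (p (g k))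
  fold-elim p (suc m) g h fzero = T∧₁ h
  fold-elim p (suc m) g h (fsuc k) = fold-elim p m (g ∘ fsuc) (T∧₂ {p (g fzero)} h) k

  allᶠ-intro : ∀ {n} (p : Fin n → Bool) → (∀ i → T (p i)) → T (allᶠ p)
  allᶠ-intro {n} p h = fold-intro p n (λ i → i) h

  allᶠ-elim : ∀ {n} (p : Fin n → Bool) → T (allᶠ p) → ∀ i → T (p i)
  allᶠ-elim {n} p h = fold-elim p n (λ i → i) h

  axiomsᵇ : Bool → Bool → Bool → Bool → ℕ → ℕ → ℕ → ℕ → Bool
  axiomsᵇ bij bij' bi'j bi'j' i j i' j' =
      (bij ⇒ᵇ (i <ᵇ j))
      ∧ ((bij ∧ bij') ⇒ᵇ (j ≡ᵇ j'))
      ∧ ((bij ∧ bi'j) ⇒ᵇ (i ≡ᵇ i'))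
      ∧ ((bij ∧ bi'j' ∧ (i <ᵇ i')) ⇒ᵇ ((j <ᵇ i') ∨ (j' <ᵇ j)))

  axioms-at : ∀ {n} (ν : BRel n) (fi fj fi' fj' : Fin n) →
    (ν ∋⟨ fi , fj ⟩ ⇒ᵇ (fi <ᶠ fj))
      ∧ ((ν ∋⟨ fi , fj ⟩ ∧ ν ∋⟨ fi , fj' ⟩) ⇒ᵇ (fj =ᶠ fj'))
      ∧ ((ν ∋⟨ fi , fj ⟩ ∧ ν ∋⟨ fi' , fj ⟩) ⇒ᵇ (fi =ᶠ fi'))
      ∧ ((ν ∋⟨ fi , fj ⟩ ∧ ν ∋⟨ fi' , fj' ⟩ ∧ (fi <ᶠ fi')) ⇒ᵇ ((fj <ᶠ fi') ∨ (fj' <ᶠ fj)))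
    ≡ axiomsᵇ (asRel ν (toℕ fi) (toℕ fj)) (asRel ν (toℕ fi) (toℕ fj')) (asRel ν (toℕ fi') (toℕ fj)) (asRel ν (toℕ fi') (toℕ fj'))
            (toℕ fi) (toℕ fj) (toℕ fi') (toℕ fj')
  axioms-at ν fi fj fi' fj' rewrite ∋-asRel ν fi fj | ∋-asRel ν fi fj' | ∋-asRel ν fi' fj | ∋-asRel ν fi' fj' = refl

  axioms-hold : ∀ {n} (ν : BRel n) → T (isNesting ν) → ∀ i j i' j' → i < n → j < n → i' < n → j' < n →
    T (axiomsᵇ (asRel ν i j) (asRel ν i j') (asRel ν i' j) (asRel ν i' j') i j i' j')
  axioms-hold ν h i j i' j' il jl i'l j'l = g (toℕ-fromℕ< il) (toℕ-fromℕ< jl) (toℕ-fromℕ< i'l) (toℕ-fromℕ< j'l)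
    (subst T (axioms-at ν fi fj fi' fj')
      (allᶠ-elim _ (allᶠ-elim _ (allᶠ-elim _ (allᶠ-elim _ h fi) fj) fi') fj'))
    where
    fi = fromℕ< il
    fj = fromℕ< jl
    fi' = fromℕ< i'l
    fj' = fromℕ< j'l
    g : ∀ {a b c d a' b' c' d'} → a' ≡ a → b' ≡ b → c' ≡ c → d' ≡ d →
      T (axiomsᵇ (asRel ν a' b') (asRel ν a' d') (asRel ν c' b') (asRel ν c' d') a' b' c' d') →
      T (axiomsᵇ (asRel ν a b) (asRel ν a d) (asRel ν c b) (asRel ν c d) a b c d)
    g refl refl refl refl x = x

  axiomsᵇ-parts : ∀ a b c d i j i' j' → T (axiomsᵇ a b c d i j i' j') →
    T (a ⇒ᵇ (i <ᵇ j)) × T ((a ∧ b) ⇒ᵇ (j ≡ᵇ j')) × T ((a ∧ c) ⇒ᵇ (i ≡ᵇ i')) × T ((a ∧ d ∧ (i <ᵇ i')) ⇒ᵇ ((j <ᵇ i') ∨ (j' <ᵇ j)))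
  axiomsᵇ-parts a b c d i j i' j' h with Equivalence.to (T-∧ {a ⇒ᵇ (i <ᵇ j)}) h
  ... | h1 , r1 with Equivalence.to (T-∧ {(a ∧ b) ⇒ᵇ (j ≡ᵇ j')}) r1
  ...   | h2 , r2 with Equivalence.to (T-∧ {(a ∧ c) ⇒ᵇ (i ≡ᵇ i')}) r2
  ...     | h3 , h4 = h1 , h2 , h3 , h4

  asRel-bounded : ∀ {n} (ν : BRel n) {i j} → T (asRel ν i j) → i < n × j < n
  asRel-bounded {n} ν {i} {j} h with i <? n | j <? n
  ... | yes il | yes jl = il , jl
  ... | no ni | _ = ⊥-elim (subst T (asRel-beyondˡ ν i j (≮⇒≥ ni)) h)
  ... | yes _ | no nj = ⊥-elim (subst T (asRel-beyond ν i j (≮⇒≥ nj)) h)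

  isNesting⇒Nesting : ∀ {n} (ν : BRel n) → T (isNesting ν) → Nesting (asRel ν) n
  isNesting⇒Nesting {n} ν h = record { bnd = λ {i} {j} r → proj₂ (asRel-bounded ν r) ; lt = lt' ; fun = fun' ; inj = inj' ; nc = nc' }
    where
    R = asRel ν
    B : ∀ {i j i' j'} → T (R i j) → T (R i' j') → T (axiomsᵇ (R i j) (R i j') (R i' j) (R i' j') i j i' j')
    B r r' = axioms-hold ν h _ _ _ _ (proj₁ (asRel-bounded ν r)) (proj₂ (asRel-bounded ν r)) (proj₁ (asRel-bounded ν r')) (proj₂ (asRel-bounded ν r'))
    P : ∀ {i j i' j'} → T (R i j) → T (R i' j') → _
    P {i} {j} {i'} {j'} r r' = axiomsᵇ-parts (R i j) (R i j') (R i' j) (R i' j') i j i' j' (B {i} {j} {i'} {j'} r r')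
    lt' : ∀ {i j} → T (R i j) → i < j
    lt' {i} {j} r = <ᵇ⇒< i j (⇒ᵇ-elim (proj₁ (P {i} {j} {i} {j} r r)) r)
    fun' : ∀ {i j j'} → T (R i j) → T (R i j') → j ≡ j'
    fun' {i} {j} {j'} r r' = ≡ᵇ⇒≡ j j' (⇒ᵇ-elim (proj₁ (proj₂ (P {i} {j} {i} {j'} r r'))) (T∧ r r'))
    inj' : ∀ {i i' j} → T (R i j) → T (R i' j) → i ≡ i'
    inj' {i} {i'} {j} r r' = ≡ᵇ⇒≡ i i' (⇒ᵇ-elim (proj₁ (proj₂ (proj₂ (P {i} {j} {i'} {j} r r')))) (T∧ r r'))
    nc' : ∀ {i j i' j'} → T (R i j) → T (R i' j') → i < i' → (j < i') ⊎ (j' < j)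
    nc' {i} {j} {i'} {j'} r r' l with Equivalence.to T-∨ (⇒ᵇ-elim (proj₂ (proj₂ (proj₂ (P {i} {j} {i'} {j'} r r')))) (T∧ r (T∧ r' (<⇒<ᵇ l))))
    ... | inj₁ x = inj₁ (<ᵇ⇒< j i' x)
    ... | inj₂ x = inj₂ (<ᵇ⇒< j' j x)

  axiomsᵇ-intro : ∀ {R N} → Nesting R N → ∀ i j i' j' → T (axiomsᵇ (R i j) (R i j') (R i' j) (R i' j') i j i' j')
  axiomsᵇ-intro {R} V i j i' j' =
    T∧ (⇒ᵇ-intro (λ r → <⇒<ᵇ (Nesting.lt V r)))
    (T∧ (⇒ᵇ-intro (λ r → ≡⇒≡ᵇ j j' (Nesting.fun V (T∧₁ r) (T∧₂ r))))
    (T∧ (⇒ᵇ-intro (λ r → ≡⇒≡ᵇ i i' (Nesting.inj V (T∧₁ r) (T∧₂ {R i j} r))))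
    (⇒ᵇ-intro (λ r → Equivalence.from T-∨ (f (Nesting.nc V (T∧₁ r) (T∧₁ (T∧₂ {R i j} r)) (<ᵇ⇒< i i' (T∧₂ (T∧₂ {R i j} r)))))))))
    where
    f : (j < i') ⊎ (j' < j) → T (j <ᵇ i') ⊎ T (j' <ᵇ j)
    f (inj₁ x) = inj₁ (<⇒<ᵇ x)
    f (inj₂ x) = inj₂ (<⇒<ᵇ x)

  Nesting⇒isNesting : ∀ {n} (ν : BRel n) → Nesting (asRel ν) n → T (isNesting ν)
  Nesting⇒isNesting ν V =
    allᶠ-intro _ λ fi → allᶠ-intro _ λ fj → allᶠ-intro _ λ fi' → allᶠ-intro _ λ fj' →
      subst T (sym (axioms-at ν fi fj fi' fj')) (axiomsᵇ-intro V (toℕ fi) (toℕ fj) (toℕ fi') (toℕ fj'))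

  findᵇ-nothing : ∀ {n} (p : Fin n → Bool) → (∀ i → p i ≡ false) → findᵇ p ≡ nothing
  findᵇ-nothing {zero} p h = refl
  findᵇ-nothing {suc n} p h rewrite h fzero | findᵇ-nothing (λ i → p (fsuc i)) (λ i → h (fsuc i)) = refl

  findᵇ-just : ∀ {n} (p : Fin n → Bool) (i : Fin n) → p i ≡ true → (∀ i' → p i' ≡ true → i' ≡ i) → findᵇ p ≡ just i
  findᵇ-just {suc n} p fzero e u rewrite e = refl
  findᵇ-just {suc n} p (fsuc i) e u with p fzero in eq
  ... | true with u fzero eq
  ...   | ()
  findᵇ-just {suc n} p (fsuc i) e u | false
    rewrite findᵇ-just (λ i → p (fsuc i)) i e (λ i' e' → fsuc-injective (u (fsuc i') e')) = refl

  allᶠ-true : ∀ {n} (p : Fin n → Bool) → (∀ i → p i ≡ true) → allᶠ p ≡ true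
  allᶠ-true p h = T⇒≡ (allᶠ-intro p (λ i → subst T (sym (h i)) tt))

  allᶠ-false : ∀ {n} (p : Fin n → Bool) (i : Fin n) → p i ≡ false → allᶠ p ≡ false
  allᶠ-false p i e = ¬T⇒≡ (λ h → subst T e (allᶠ-elim p h i))


module TreeMatrices where

  open import Data.Bool.Base using (true; false; T; not)
  open import Data.Nat.Base using (_<_)
  open import Data.Nat.Properties using (<-trans)
  open import Data.Fin.Base using (Fin; toℕ; fromℕ<)
  open import Data.Fin.Properties using (toℕ-fromℕ<; toℕ<n; toℕ-injective)
  open import Data.Maybe.Base using (just; nothing)
  open import Data.Product.Base using (_,_)
  open import Data.Unit.Base using (tt)
  open import Relation.Binary.PropositionalEquality
  open import Defs
  open NestingRelations
  open Trees
  open TreeEncoding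
  open BooleanMatrices

  ∋-tree : ∀ t N → size t ≡ N → ∀ (i j : Fin N) → matrixOf N (treeRel t) ∋⟨ i , j ⟩ ≡ treeRel t (toℕ i) (toℕ j)
  ∋-tree t N e i j = trans (∋-asRel (matrixOf N (treeRel t)) i j) (asRel-matrixOf N (treeRel t) (subst (Nesting (treeRel t)) e (treeRel-nesting t)) (toℕ i) (toℕ j))

  matrixOf-tree-nesting : ∀ N t → size t ≡ N → T (isNesting (matrixOf N (treeRel t)))
  matrixOf-tree-nesting N t e = Nesting⇒isNesting (matrixOf N (treeRel t)) (Nesting-ext (λ i j → sym (asRel-matrixOf N (treeRel t) V i j)) V)
    where V = subst (Nesting (treeRel t)) e (treeRel-nesting t)

  matrixOf-tree-injective : ∀ N t t₀ → size t ≡ N → size t₀ ≡ N → matrixOf N (treeRel t) ≡ matrixOf N (treeRel t₀) → t ≡ t₀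
  matrixOf-tree-injective N t t₀ e e₀ eq = treeRel-injective t t₀ (trans e (sym e₀)) (λ i j il jl →
    trans (sym (asRel-tabulateRows N N (treeRel t) i j (subst (i <_) e il) (subst (j <_) e jl)))
     (trans (cong (λ z → asRel z i j) eq) (asRel-tabulateRows N N (treeRel t₀) i j (subst (i <_) e il) (subst (j <_) e jl))))

  data StepCase {N} (ν : BRel N) (t : Tree) (p : Fin N) : Set where
    cRet : (i : Fin N) → findᵇ (λ i' → ν ∋⟨ i' , p ⟩) ≡ just i → treeKind t (toℕ p) ≡ kret (toℕ i) → StepCase ν t p
    cCall : findᵇ (λ i' → ν ∋⟨ i' , p ⟩) ≡ nothing → allᶠ (λ j → not (ν ∋⟨ p , j ⟩)) ≡ false → treeKind t (toℕ p) ≡ kcall → StepCase ν t p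
    cInt : findᵇ (λ i' → ν ∋⟨ i' , p ⟩) ≡ nothing → allᶠ (λ j → not (ν ∋⟨ p , j ⟩)) ≡ true → treeKind t (toℕ p) ≡ kint → StepCase ν t p

  stepCase : ∀ t N (e : size t ≡ N) (p : Fin N) → StepCase (matrixOf N (treeRel t)) t p
  stepCase t N e p with treeKind t (toℕ p) in eqk | treeKind-correct t (toℕ p) (subst (toℕ p <_) (sym e) (toℕ<n p))
  ... | kret i | h = cRet fi (findᵇ-just _ fi marked unique) (trans eqk (cong kret (sym (toℕ-fromℕ< il))))
    where
    V = subst (Nesting (treeRel t)) e (treeRel-nesting t)
    il : i < N
    il = <-trans (Nesting.lt V h) (toℕ<n p)
    fi = fromℕ< il
    marked : matrixOf N (treeRel t) ∋⟨ fi , p ⟩ ≡ true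
    marked = trans (∋-tree t N e fi p) (trans (cong (λ z → treeRel t z (toℕ p)) (toℕ-fromℕ< il)) (T⇒≡ h))
    unique : ∀ i' → matrixOf N (treeRel t) ∋⟨ i' , p ⟩ ≡ true → i' ≡ fi
    unique i' e' = toℕ-injective (trans (Nesting.inj V (subst T (sym (trans (sym (∋-tree t N e i' p)) e')) tt) h) (sym (toℕ-fromℕ< il)))
  ... | kcall | (ni , j , r) = cCall (findᵇ-nothing _ (λ i' → trans (∋-tree t N e i' p) (¬T⇒≡ (ni (toℕ i')))))
      (allᶠ-false _ fj (cong not (trans (∋-tree t N e p fj) (trans (cong (treeRel t (toℕ p)) (toℕ-fromℕ< jl)) (T⇒≡ r))))) eqk
    where
    jl : j < N
    jl = Nesting.bnd (subst (Nesting (treeRel t)) e (treeRel-nesting t)) r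
    fj = fromℕ< jl
  ... | kint | (ni , nj) = cInt (findᵇ-nothing _ (λ i' → trans (∋-tree t N e i' p) (¬T⇒≡ (ni (toℕ i')))))
      (allᶠ-true _ (λ j' → cong not (trans (∋-tree t N e p j') (¬T⇒≡ (nj (toℕ j')))))) eqk

-- By definition runWeight is a product of
-- one transition weight per position; on the matrix of a tree t that factor is the
-- transition prescribed by treeKind t, and the product regroups along the tree into
-- treeWeight t.  Words and state sequences are handled as functions on ℕ.
module TreeRuns {c ℓ} (K : CommutativeSemiring c ℓ) {k : ℕ} (A : Series.WNWA K k) where

  open import Data.Bool.Base using (true; false; not; if_then_else_)
  open import Data.Nat.Base using (zero; suc; _<_; z<s; s<s) renaming (_+_ to _+ℕ_)
  open import Data.Nat.Properties using (m<n⇒m<1+n; ≤-refl; n≮n; <ᵇ⇒<) renaming (+-suc to ℕ+-suc; +-identityʳ to ℕ+-identityʳ)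
  open import Data.Fin.Base using (Fin; toℕ; inject₁) renaming (zero to fzero; suc to fsuc)
  open import Data.Fin.Properties using (toℕ-inject₁)
  open import Data.Vec.Base using (Vec; lookup)
  open import Data.List.Base using (map; tabulate; allFin)
  import Data.List.Properties as LP
  open import Data.Maybe.Base using (just; nothing)
  open import Data.Product.Base using (Σ; proj₁)
  open import Function.Base using (_∘_)
  import Relation.Binary.PropositionalEquality as P
  open P using (_≡_)
  open CommutativeSemiring K
  open Series K
  open WNWA A
  open NestingRelations
  open Trees
  open BooleanMatrices
  open TreeMatrices
  open import Relation.Binary.Reasoning.Setoid setoid

  runWeight-factors : ∀ {N} (w : Vec (Fin k) N) (ν : BRel N) (qs : Vec (Fin q) (suc N)) →
    Σ (Fin N → Carrier) (λ g → runWeight A w ν qs ≡ Πᴸ (map g (allFin N)))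
  runWeight-factors w ν qs = _ , P.refl

  stepWeight : ∀ {N} → Vec (Fin k) N → BRel N → Vec (Fin q) (suc N) → Fin N → Carrier
  stepWeight w ν qs = proj₁ (runWeight-factors w ν qs)

  module _ {N} (w : Vec (Fin k) N) (ν : BRel N) (qs : Vec (Fin q) (suc N)) (p : Fin N) where

    stepWeight-ret : ∀ i → findᵇ (λ i' → ν ∋⟨ i' , p ⟩) ≡ just i →
      stepWeight w ν qs p ≡ δret (lookup qs (inject₁ p)) (lookup qs (inject₁ i)) (lookup w p) (lookup qs (fsuc p))
    stepWeight-ret i e rewrite e = P.refl

    stepWeight-call : findᵇ (λ i' → ν ∋⟨ i' , p ⟩) ≡ nothing → allᶠ (λ j → not (ν ∋⟨ p , j ⟩)) ≡ false →
      stepWeight w ν qs p ≡ δcall (lookup qs (inject₁ p)) (lookup w p) (lookup qs (fsuc p))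
    stepWeight-call e e' rewrite e | e' = P.refl

    stepWeight-int : findᵇ (λ i' → ν ∋⟨ i' , p ⟩) ≡ nothing → allᶠ (λ j → not (ν ∋⟨ p , j ⟩)) ≡ true →
      stepWeight w ν qs p ≡ δint (lookup qs (inject₁ p)) (lookup w p) (lookup qs (fsuc p))
    stepWeight-int e e' rewrite e | e' = P.refl

  prodBelow : ℕ → (ℕ → Carrier) → Carrier
  prodBelow zero f = 1#
  prodBelow (suc n) f = f 0 * prodBelow n (λ i → f (suc i))

  prodBelow-cong : ∀ n {f g : ℕ → Carrier} → (∀ i → i < n → f i ≈ g i) → prodBelow n f ≈ prodBelow n g
  prodBelow-cong zero e = refl
  prodBelow-cong (suc n) e = *-cong (e 0 z<s) (prodBelow-cong n (λ i il → e (suc i) (s<s il)))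

  prodBelow-+ : ∀ m n (f : ℕ → Carrier) → prodBelow (m +ℕ n) f ≈ prodBelow m f * prodBelow n (λ i → f (m +ℕ i))
  prodBelow-+ zero n f = sym (*-identityˡ _)
  prodBelow-+ (suc m) n f = trans (*-congˡ (prodBelow-+ m n (λ i → f (suc i)))) (sym (*-assoc _ _ _))

  prod-tabulate : ∀ n (F : Fin n → Carrier) (h : ℕ → Carrier) → (∀ p → F p ≈ h (toℕ p)) → Πᴸ (tabulate F) ≈ prodBelow n h
  prod-tabulate zero F h e = refl
  prod-tabulate (suc n) F h e = *-cong (e fzero) (prod-tabulate n (F ∘ fsuc) (λ i → h (suc i)) (λ p → e (fsuc p)))

  prod-allFin : ∀ n (g : Fin n → Carrier) (h : ℕ → Carrier) → (∀ p → g p ≈ h (toℕ p)) → Πᴸ (map g (allFin n)) ≈ prodBelow n h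
  prod-allFin n g h e = trans (reflexive (P.cong Πᴸ (LP.map-tabulate (λ i → i) g))) (prod-tabulate n g h e)

  transitionAt : (ℕ → Fin k) → (ℕ → Fin q) → Kind → ℕ → Carrier
  transitionAt W Q kint p = δint (Q p) (W p) (Q (suc p))
  transitionAt W Q kcall p = δcall (Q p) (W p) (Q (suc p))
  transitionAt W Q (kret i) p = δret (Q p) (Q i) (W p) (Q (suc p))

  transitionAt-shift : ∀ a W Q kd p → transitionAt W Q (shiftKind a kd) (a +ℕ p) ≡ transitionAt (λ i → W (a +ℕ i)) (λ i → Q (a +ℕ i)) kd p
  transitionAt-shift a W Q kint p = P.cong (δint (Q (a +ℕ p)) (W (a +ℕ p))) (P.cong Q (P.sym (ℕ+-suc a p)))
  transitionAt-shift a W Q kcall p = P.cong (δcall (Q (a +ℕ p)) (W (a +ℕ p))) (P.cong Q (P.sym (ℕ+-suc a p)))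
  transitionAt-shift a W Q (kret i) p = P.cong (δret (Q (a +ℕ p)) (Q (a +ℕ i)) (W (a +ℕ p))) (P.cong Q (P.sym (ℕ+-suc a p)))

  treeWeight : Tree → (ℕ → Fin k) → (ℕ → Fin q) → Carrier
  treeWeight nil W Q = 1#
  treeWeight (int t) W Q = δint (Q 0) (W 0) (Q 1) * treeWeight t (λ i → W (suc i)) (λ i → Q (suc i))
  treeWeight (call t u) W Q =
    ((δcall (Q 0) (W 0) (Q 1) * treeWeight t (λ i → W (suc i)) (λ i → Q (suc i)))
      * δret (Q (suc (size t))) (Q 0) (W (suc (size t))) (Q (suc (suc (size t)))))
      * treeWeight u (λ i → W (suc (suc (size t)) +ℕ i)) (λ i → Q (suc (suc (size t)) +ℕ i))

  prodBelow-treeKind : ∀ t W Q → prodBelow (size t) (λ p → transitionAt W Q (treeKind t p) p) ≈ treeWeight t W Q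
  prodBelow-treeKind nil W Q = refl
  prodBelow-treeKind (int t) W Q = *-congˡ (trans (prodBelow-cong (size t) (λ i _ → reflexive (P.trans
      (P.cong (λ z → transitionAt W Q z (suc i)) (concatKind-right 1 (λ _ → kint) (treeKind t) i))
      (transitionAt-shift 1 W Q (treeKind t i) i))))
    (prodBelow-treeKind t (λ i → W (suc i)) (λ i → Q (suc i))))
  prodBelow-treeKind (call t u) W Q = begin
    step 0 * prodBelow (n₁ +ℕ suc n₂) (λ i → step (suc i)) ≈⟨ *-congˡ (prodBelow-+ n₁ (suc n₂) (λ i → step (suc i))) ⟩
    step 0 * (prodBelow n₁ (λ i → step (suc i)) * (step (suc (n₁ +ℕ 0)) * prodBelow n₂ (λ i → step (suc (n₁ +ℕ suc i)))))
      ≈⟨ *-cong (reflexive callStep) (*-cong innerPart (*-cong (reflexive atReturn) afterPart)) ⟩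
    δcall (Q 0) (W 0) (Q 1) * (treeWeight t (λ i → W (suc i)) (λ i → Q (suc i)) * (returnStep * treeWeight u (λ i → W (a₀ +ℕ i)) (λ i → Q (a₀ +ℕ i))))
      ≈⟨ sym (trans (*-assoc _ _ _) (*-assoc _ _ _)) ⟩
    treeWeight (call t u) W Q ∎
    where
    n₁ = size t
    n₂ = size u
    a₀ = suc (suc n₁)
    step : ℕ → Carrier
    step p = transitionAt W Q (treeKind (call t u) p) p
    returnStep = δret (Q (suc n₁)) (Q 0) (W (suc n₁)) (Q (suc (suc n₁)))
    callStep : step 0 ≡ δcall (Q 0) (W 0) (Q 1)
    callStep = P.cong (λ z → transitionAt W Q z 0) (concatKind-left a₀ (encloseKind n₁ (treeKind t)) (treeKind u) {0} z<s)
    innerPart : prodBelow n₁ (λ i → step (suc i)) ≈ treeWeight t (λ i → W (suc i)) (λ i → Q (suc i))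
    innerPart = trans (prodBelow-cong n₁ (λ i il → reflexive (P.trans
        (P.cong (λ z → transitionAt W Q z (suc i)) (P.trans (concatKind-left a₀ (encloseKind n₁ (treeKind t)) (treeKind u) {suc i} (s<s (m<n⇒m<1+n il)))
            (P.cong (λ b → if b then shiftKind 1 (treeKind t i) else kret 0) (<ᵇ-true il))))
        (transitionAt-shift 1 W Q (treeKind t i) i))))
      (prodBelow-treeKind t (λ i → W (suc i)) (λ i → Q (suc i)))
    atReturn : step (suc (n₁ +ℕ 0)) ≡ returnStep
    atReturn rewrite ℕ+-identityʳ n₁ = P.cong (λ z → transitionAt W Q z (suc n₁))
      (P.trans (concatKind-left a₀ (encloseKind n₁ (treeKind t)) (treeKind u) {suc n₁} ≤-refl)
        (P.cong (λ b → if b then shiftKind 1 (treeKind t n₁) else kret 0) (¬T⇒≡ (λ h → n≮n n₁ (<ᵇ⇒< n₁ n₁ h)))))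
    afterPart : prodBelow n₂ (λ i → step (suc (n₁ +ℕ suc i))) ≈ treeWeight u (λ i → W (a₀ +ℕ i)) (λ i → Q (a₀ +ℕ i))
    afterPart = trans (prodBelow-cong n₂ (λ i il → reflexive (P.trans
        (P.cong step (P.cong suc (ℕ+-suc n₁ i)))
        (P.trans (P.cong (λ z → transitionAt W Q z (a₀ +ℕ i)) (concatKind-right a₀ (encloseKind n₁ (treeKind t)) (treeKind u) i))
          (transitionAt-shift a₀ W Q (treeKind u i) i)))))
      (prodBelow-treeKind u (λ i → W (a₀ +ℕ i)) (λ i → Q (a₀ +ℕ i)))

  runWeight-tree : ∀ t {N} (w : Vec (Fin k) N) (qs : Vec (Fin q) (suc N)) (W : ℕ → Fin k) (Q : ℕ → Fin q) →
    (e : size t ≡ N) → (∀ p → lookup w p ≡ W (toℕ p)) → (∀ i → lookup qs i ≡ Q (toℕ i)) →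
    runWeight A w (matrixOf N (treeRel t)) qs ≈ prodBelow N (λ p → transitionAt W Q (treeKind t p) p)
  runWeight-tree t {N} w qs W Q e hw hq = begin
    runWeight A w ν qs ≡⟨ P.cong Πᴸ (LP.map-cong step (allFin N)) ⟩
    Πᴸ (map (λ p → transitionAt W Q (treeKind t (toℕ p)) (toℕ p)) (allFin N)) ≈⟨ prod-allFin N _ _ (λ p → refl) ⟩
    prodBelow N (λ p → transitionAt W Q (treeKind t p) p) ∎
    where
    ν = matrixOf N (treeRel t)
    hqi : ∀ (i : Fin N) → lookup qs (inject₁ i) ≡ Q (toℕ i)
    hqi i = P.trans (hq (inject₁ i)) (P.cong Q (toℕ-inject₁ i))
    step : ∀ p → stepWeight w ν qs p ≡ transitionAt W Q (treeKind t (toℕ p)) (toℕ p)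
    step p with stepCase t N e p
    ... | cRet i e₁ ek rewrite stepWeight-ret w ν qs p i e₁ | ek | hqi p | hqi i | hw p | hq (fsuc p) = P.refl
    ... | cCall e₁ e₂ ek rewrite stepWeight-call w ν qs p e₁ e₂ | ek | hqi p | hw p | hq (fsuc p) = P.refl
    ... | cInt e₁ e₂ ek rewrite stepWeight-int w ν qs p e₁ e₂ | ek | hqi p | hw p | hq (fsuc p) = P.refl

-- Lookup in a vector by a natural-number index, with a default value beyond its end;
-- this turns a state sequence into a function ℕ → Fin q.
module VecLookup where

  open import Data.Nat.Base using (ℕ; zero; suc; _<_; s≤s) renaming (_+_ to _+ℕ_)
  open import Data.Fin.Base using (Fin; toℕ) renaming (zero to fzero; suc to fsuc)
  open import Data.Vec.Base using (Vec; []; _∷_; lookup; last) renaming (_++_ to _++ᵛ_)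
  import Relation.Binary.PropositionalEquality as P
  open P using (_≡_)

  lookupD : ∀ {a} {A : Set a} {n} → A → Vec A n → ℕ → A
  lookupD d [] i = d
  lookupD d (x ∷ v) zero = x
  lookupD d (x ∷ v) (suc i) = lookupD d v i

  lookup-lookupD : ∀ {a} {A : Set a} {n} d (v : Vec A n) (i : Fin n) → lookup v i ≡ lookupD d v (toℕ i)
  lookup-lookupD d (x ∷ v) fzero = P.refl
  lookup-lookupD d (x ∷ v) (fsuc i) = lookup-lookupD d v i

  lookupD-default : ∀ {a} {A : Set a} {n} d d' (v : Vec A n) i → i < n → lookupD d v i ≡ lookupD d' v i
  lookupD-default d d' (x ∷ v) zero _ = P.refl
  lookupD-default d d' (x ∷ v) (suc i) (s≤s h) = lookupD-default d d' v i h

  lookupD-++ˡ : ∀ {a} {A : Set a} {m n} d d' (xs : Vec A m) (ys : Vec A n) i → i < m → lookupD d (xs ++ᵛ ys) i ≡ lookupD d' xs i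
  lookupD-++ˡ d d' (x ∷ xs) ys zero _ = P.refl
  lookupD-++ˡ d d' (x ∷ xs) ys (suc i) (s≤s h) = lookupD-++ˡ d d' xs ys i h

  lookupD-++ʳ : ∀ {a} {A : Set a} {m n} d (xs : Vec A m) (ys : Vec A n) i → lookupD d (xs ++ᵛ ys) (m +ℕ i) ≡ lookupD d ys i
  lookupD-++ʳ d [] ys i = P.refl
  lookupD-++ʳ d (x ∷ xs) ys i = lookupD-++ʳ d xs ys i

  last-lookupD : ∀ {a} {A : Set a} {n} d (v : Vec A (suc n)) → last v ≡ lookupD d v n
  last-lookupD d (x ∷ []) = P.refl
  last-lookupD d (x ∷ y ∷ v) = last-lookupD d (y ∷ v)

  last-++ : ∀ {a} {A : Set a} {m n} (x : A) (xs : Vec A m) (ys : Vec A (suc n)) → last (x ∷ (xs ++ᵛ ys)) ≡ last ys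
  last-++ x [] (y ∷ ys) = P.refl
  last-++ x (x' ∷ xs) ys = last-++ x' xs ys

-- Sums over runs along a tree.  runSum t w p F is the total weight of the runs of A
-- that start in p and read w along the tree t, each weighted by F of its final state;
-- it is defined by recursion on t, and equals the sum over all state sequences of
-- treeWeight (sum-treeWeight).  returnSum u v p x F continues a run that is in state x
-- at the return matching a call taken in state p.
module RunSums {c ℓ} (K : CommutativeSemiring c ℓ) {k : ℕ} (A : Series.WNWA K k) where

  open import Level using (_⊔_)
  open import Data.Nat.Base using (zero; suc; _<_; _≤_; z≤n; s≤s; z<s; s<s) renaming (_+_ to _+ℕ_)
  open import Data.Nat.Properties using (≤-trans; ≤-refl; m≤m+n; +-monoʳ-<; +-monoʳ-≤; suc-injective; <⇒≤)
    renaming (+-suc to ℕ+-suc; +-identityʳ to ℕ+-identityʳ)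
  open import Data.Fin.Base using (Fin)
  open import Data.Vec.Base using (Vec; []; _∷_; last) renaming (_++_ to _++ᵛ_)
  open import Data.List.Base using (List; []; _∷_; allFin; take; drop; length)
  open import Data.Product.Base using (_×_; _,_)
  open import Data.Unit.Base using (⊤; tt)
  import Relation.Binary.PropositionalEquality as P
  open P using (_≡_)
  open CommutativeSemiring K
  open Series K
  open WNWA A
  open FiniteSums K
  open Trees
  open TreeRuns K A
  open VecLookup
  open import Relation.Binary.Reasoning.Setoid setoid

  mutual
    runSum : Tree → List (Fin k) → Fin q → (Fin q → Carrier) → Carrier
    runSum nil w p F = F p
    runSum (int t) [] p F = 0#
    runSum (int t) (a ∷ w) p F = sumFin q (λ s → δint p a s * runSum t w s F)
    runSum (call t u) [] p F = 0#
    runSum (call t u) (a ∷ w) p F = sumFin q (λ s → δcall p a s * runSum t (take (size t) w) s (λ x → returnSum u (drop (size t) w) p x F))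

    returnSum : Tree → List (Fin k) → Fin q → Fin q → (Fin q → Carrier) → Carrier
    returnSum u [] p x F = 0#
    returnSum u (b ∷ v) p x F = sumFin q (λ r → δret x p b r * runSum u v r F)

  Spells : List (Fin k) → (ℕ → Fin k) → Set
  Spells [] W = ⊤
  Spells (a ∷ w) W = (W 0 ≡ a) × Spells w (λ i → W (suc i))

  Spells-cong : ∀ w {W W'} → (∀ i → W i ≡ W' i) → Spells w W → Spells w W'
  Spells-cong [] e ag = tt
  Spells-cong (a ∷ w) e (h , ag) = P.trans (P.sym (e 0)) h , Spells-cong w (λ i → e (suc i)) ag

  Spells-take : ∀ n w {W} → Spells w W → Spells (take n w) W
  Spells-take zero w ag = tt
  Spells-take (suc n) [] ag = tt
  Spells-take (suc n) (a ∷ w) (h , ag) = h , Spells-take n w ag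

  Spells-drop : ∀ n w {W} → Spells w W → Spells (drop n w) (λ i → W (n +ℕ i))
  Spells-drop zero w ag = ag
  Spells-drop (suc n) [] ag = tt
  Spells-drop (suc n) (a ∷ w) (h , ag) = Spells-drop n w ag

  len-take : ∀ {a} {A : Set a} n m (w : List A) → length w ≡ n +ℕ m → length (take n w) ≡ n
  len-take zero m w e = P.refl
  len-take (suc n) m (x ∷ w) e = P.cong suc (len-take n m w (suc-injective e))

  len-drop : ∀ {a} {A : Set a} n m (w : List A) → length w ≡ n +ℕ m → length (drop n w) ≡ m
  len-drop zero m w e = e
  len-drop (suc n) m (x ∷ w) e = len-drop n m w (suc-injective e)

  treeWeight-cong : ∀ t {W W' Q Q'} → (∀ i → i < size t → W i ≡ W' i) → (∀ i → i ≤ size t → Q i ≡ Q' i) → treeWeight t W Q ≈ treeWeight t W' Q'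
  treeWeight-cong nil ew eq = refl
  treeWeight-cong (int t) ew eq = *-cong (reflexive (P.trans (P.cong₂ (λ x y → δint x y _) (eq 0 z≤n) (ew 0 z<s)) (P.cong (δint _ _) (eq 1 (s≤s z≤n)))))
    (treeWeight-cong t (λ i il → ew (suc i) (s<s il)) (λ i il → eq (suc i) (s≤s il)))
  treeWeight-cong (call t u) {W} {W'} {Q} {Q'} ew eq =
    *-cong (*-cong (*-cong (reflexive (P.trans (P.cong₂ (λ x y → δcall x y _) (eq 0 z≤n) (ew 0 z<s)) (P.cong (δcall _ _) (eq 1 (s≤s z≤n)))))
                           (treeWeight-cong t (λ i il → ew (suc i) (inner< il)) (λ i il → eq (suc i) (inner≤ il))))
                   (reflexive (P.trans (P.cong₂ (λ x y → δret x y (W (suc n₁)) (Q (suc (suc n₁)))) (eq (suc n₁) (<⇒≤ return<)) (eq 0 z≤n))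
                     (P.cong₂ (λ x y → δret (Q' (suc n₁)) (Q' 0) x y) (ew (suc n₁) return<) (eq (suc (suc n₁)) return<)))))
           (treeWeight-cong u (λ i il → ew (suc (suc n₁) +ℕ i) (after< il)) (λ i il → eq (suc (suc n₁) +ℕ i) (after≤ il)))
    where
    n₁ = size t
    n₂ = size u
    inner< : ∀ {i} → i < n₁ → suc i < suc (n₁ +ℕ suc n₂)
    inner< il = s≤s (≤-trans il (m≤m+n n₁ (suc n₂)))
    inner≤ : ∀ {i} → i ≤ n₁ → suc i ≤ suc (n₁ +ℕ suc n₂)
    inner≤ il = s≤s (≤-trans il (m≤m+n n₁ (suc n₂)))
    return< : suc n₁ < suc (n₁ +ℕ suc n₂)
    return< = s≤s (P.subst (suc n₁ ≤_) (P.sym (ℕ+-suc n₁ n₂)) (s≤s (m≤m+n n₁ n₂)))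
    after< : ∀ {i} → i < n₂ → suc (suc n₁) +ℕ i < suc (n₁ +ℕ suc n₂)
    after< {i} il = P.subst (suc (suc n₁) +ℕ i <_) (size-call n₁ n₂) (+-monoʳ-< (suc (suc n₁)) il)
    after≤ : ∀ {i} → i ≤ n₂ → suc (suc n₁) +ℕ i ≤ suc (n₁ +ℕ suc n₂)
    after≤ {i} il = P.subst (suc (suc n₁) +ℕ i ≤_) (size-call n₁ n₂) (+-monoʳ-≤ (suc (suc n₁)) il)

  treeWeight-call-split : ∀ t u (W : ℕ → Fin k) p s (ys : Vec (Fin q) (size t)) r (zs : Vec (Fin q) (size u)) →
    treeWeight (call t u) W (lookupD p (p ∷ (s ∷ (ys ++ᵛ (r ∷ zs)))))
      ≈ ((δcall p (W 0) s * treeWeight t (λ i → W (suc i)) (lookupD s (s ∷ ys)))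
          * δret (last (s ∷ ys)) p (W (suc (size t))) r)
        * treeWeight u (λ i → W (suc (suc (size t)) +ℕ i)) (lookupD r (r ∷ zs))
  treeWeight-call-split t u W p s ys r zs = *-cong (*-cong (*-congˡ inner) (reflexive ret)) after
    where
    n₁ = size t
    Q = lookupD p (p ∷ (s ∷ (ys ++ᵛ (r ∷ zs))))
    inner : treeWeight t (λ i → W (suc i)) (λ i → Q (suc i)) ≈ treeWeight t (λ i → W (suc i)) (lookupD s (s ∷ ys))
    inner = treeWeight-cong t (λ i _ → P.refl) (λ i il → lookupD-++ˡ p s (s ∷ ys) (r ∷ zs) i (s≤s il))
    returnState : Q (suc n₁) ≡ last (s ∷ ys)
    returnState = P.trans (lookupD-++ˡ p s (s ∷ ys) (r ∷ zs) n₁ ≤-refl) (P.sym (last-lookupD s (s ∷ ys)))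
    afterState : Q (suc (suc n₁)) ≡ r
    afterState = P.trans (P.cong (lookupD p ((s ∷ ys) ++ᵛ (r ∷ zs))) (P.sym (ℕ+-identityʳ (suc n₁)))) (lookupD-++ʳ p (s ∷ ys) (r ∷ zs) 0)
    ret : δret (Q (suc n₁)) p (W (suc n₁)) (Q (suc (suc n₁))) ≡ δret (last (s ∷ ys)) p (W (suc n₁)) r
    ret = P.cong₂ (λ x y → δret x p (W (suc n₁)) y) returnState afterState
    after : treeWeight u (λ i → W (suc (suc n₁) +ℕ i)) (λ i → Q (suc (suc n₁) +ℕ i)) ≈ treeWeight u (λ i → W (suc (suc n₁) +ℕ i)) (lookupD r (r ∷ zs))
    after = treeWeight-cong u (λ i _ → P.refl) (λ i il → P.trans (lookupD-++ʳ p ys (r ∷ zs) i) (lookupD-default p r (r ∷ zs) i (s≤s il)))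

  SumsRuns : Tree → Set (c ⊔ ℓ)
  SumsRuns t = ∀ (w : List (Fin k)) (W : ℕ → Fin k) → Spells w W → length w ≡ size t → ∀ p (F : Fin q → Carrier) →
    sumL (λ xs → treeWeight t W (lookupD p (p ∷ xs)) * F (last (p ∷ xs))) (allVecs (size t) (allFin q)) ≈ runSum t w p F

  sumsRuns-int : ∀ t → SumsRuns t → SumsRuns (int t)
  sumsRuns-int t ih (a ∷ w') W (wa , ag) e p F = begin
    sumL G (allVecs (suc n) L) ≈⟨ allVecs-suc n L G ⟩
    sumL (λ s → sumL (λ xs → G (s ∷ xs)) (allVecs n L)) L ≈⟨ sum-cong L inner ⟩
    sumL (λ s → δint p a s * runSum t w' s F) L ∎
    where
    n = size t
    L = allFin q
    G : Vec (Fin q) (suc n) → Carrier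
    G xs = treeWeight (int t) W (lookupD p (p ∷ xs)) * F (last (p ∷ xs))
    factor : ∀ s xs → G (s ∷ xs) ≈ δint p a s * (treeWeight t (λ i → W (suc i)) (lookupD s (s ∷ xs)) * F (last (s ∷ xs)))
    factor s xs = trans (*-assoc _ _ _) (*-cong (reflexive (P.cong (λ x → δint p x s) wa))
      (*-congʳ (treeWeight-cong t (λ i _ → P.refl) (λ i il → lookupD-default p s (s ∷ xs) i (s≤s il)))))
    inner : ∀ s → sumL (λ xs → G (s ∷ xs)) (allVecs n L) ≈ δint p a s * runSum t w' s F
    inner s = trans (sum-cong (allVecs n L) (factor s)) (trans (sum-*ˡ (δint p a s) _ (allVecs n L))
      (*-congˡ (ih w' (λ i → W (suc i)) ag (suc-injective e) s F)))

  sumsRuns-call : ∀ t u → SumsRuns t → SumsRuns u → SumsRuns (call t u)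
  sumsRuns-call t u iht ihu (a ∷ w₁) W (wa , ag₁) e p F
    with drop (size t) w₁ | len-drop (size t) (suc (size u)) w₁ (suc-injective e) | Spells-drop (size t) w₁ ag₁
  ... | b ∷ v | lenv | (wb , agv) = begin
    sumL G (allVecs (suc (n₁ +ℕ suc n₂)) L) ≈⟨ allVecs-suc (n₁ +ℕ suc n₂) L G ⟩
    sumL (λ s → sumL (λ xs → G (s ∷ xs)) (allVecs (n₁ +ℕ suc n₂) L)) L
      ≈⟨ sum-cong L (λ s → allVecs-++ n₁ (suc n₂) L (λ xs → G (s ∷ xs))) ⟩
    sumL (λ s → sumL (λ ys → sumL (λ zs → G (s ∷ (ys ++ᵛ zs))) (allVecs (suc n₂) L)) (allVecs n₁ L)) L
      ≈⟨ sum-cong L (λ s → sum-cong (allVecs n₁ L) (λ ys → allVecs-suc n₂ L (λ zs → G (s ∷ (ys ++ᵛ zs))))) ⟩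
    sumL (λ s → sumL (λ ys → sumL (λ r → sumL (λ zs → G (s ∷ (ys ++ᵛ (r ∷ zs)))) (allVecs n₂ L)) L) (allVecs n₁ L)) L
      ≈⟨ sum-cong L (λ s → sum-cong (allVecs n₁ L) (λ ys → sum-cong L (λ r → sum-cong (allVecs n₂ L) (λ zs → factor s ys r zs)))) ⟩
    sumL (λ s → sumL (λ ys → sumL (λ r → sumL (λ zs → δcall p a s * (Wt s ys * (δr s ys r * (Wu r zs * F (last (r ∷ zs)))))) (allVecs n₂ L)) L) (allVecs n₁ L)) L
      ≈⟨ sum-cong L (λ s → trans (sum-cong (allVecs n₁ L) (λ ys → trans (sum-cong L (λ r → sum-after s ys r)) (sum-return s ys))) (sum-inner s)) ⟩
    sumL (λ s → δcall p a s * runSum t (take n₁ w₁) s afterReturn) L ∎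
    where
    n₁ = size t
    n₂ = size u
    L = allFin q
    afterReturn : Fin q → Carrier
    afterReturn x = returnSum u (b ∷ v) p x F
    Wu' : ℕ → Fin k
    Wu' i = W (suc (suc n₁) +ℕ i)
    G : Vec (Fin q) (suc (n₁ +ℕ suc n₂)) → Carrier
    G xs = treeWeight (call t u) W (lookupD p (p ∷ xs)) * F (last (p ∷ xs))
    Wt : Fin q → Vec (Fin q) n₁ → Carrier
    Wt s ys = treeWeight t (λ i → W (suc i)) (lookupD s (s ∷ ys))
    δr : Fin q → Vec (Fin q) n₁ → Fin q → Carrier
    δr s ys r = δret (last (s ∷ ys)) p b r
    Wu : Fin q → Vec (Fin q) n₂ → Carrier
    Wu r zs = treeWeight u Wu' (lookupD r (r ∷ zs))
    wb' : W (suc n₁) ≡ b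
    wb' = P.trans (P.cong (λ z → W (suc z)) (P.sym (ℕ+-identityʳ n₁))) wb
    factor : ∀ s ys r zs → G (s ∷ (ys ++ᵛ (r ∷ zs))) ≈ δcall p a s * (Wt s ys * (δr s ys r * (Wu r zs * F (last (r ∷ zs)))))
    factor s ys r zs = begin
      G (s ∷ (ys ++ᵛ (r ∷ zs))) ≈⟨ *-cong (treeWeight-call-split t u W p s ys r zs) (reflexive (P.cong F (last-++ s ys (r ∷ zs)))) ⟩
      ((δcall p (W 0) s * Wt s ys) * δret (last (s ∷ ys)) p (W (suc n₁)) r) * Wu r zs * F (last (r ∷ zs))
        ≡⟨ P.cong₂ (λ x y → ((δcall p x s * Wt s ys) * δret (last (s ∷ ys)) p y r) * Wu r zs * F (last (r ∷ zs))) wa wb' ⟩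
      ((δcall p a s * Wt s ys) * δr s ys r) * Wu r zs * F (last (r ∷ zs)) ≈⟨ trans (*-assoc _ _ _) (trans (*-assoc _ _ _) (*-assoc _ _ _)) ⟩
      δcall p a s * (Wt s ys * (δr s ys r * (Wu r zs * F (last (r ∷ zs))))) ∎
    sum-after : ∀ s ys r → sumL (λ zs → δcall p a s * (Wt s ys * (δr s ys r * (Wu r zs * F (last (r ∷ zs)))))) (allVecs n₂ L)
                         ≈ δcall p a s * (Wt s ys * (δr s ys r * runSum u v r F))
    sum-after s ys r = trans (sum-*ˡ _ _ (allVecs n₂ L)) (*-congˡ (trans (sum-*ˡ _ _ (allVecs n₂ L))
      (*-congˡ (trans (sum-*ˡ _ _ (allVecs n₂ L))
        (*-congˡ (ihu v Wu' (Spells-cong v (λ i → P.cong (λ z → W (suc z)) (ℕ+-suc n₁ i)) agv) (suc-injective lenv) r F))))))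
    sum-return : ∀ s ys → sumL (λ r → δcall p a s * (Wt s ys * (δr s ys r * runSum u v r F))) L ≈ δcall p a s * (Wt s ys * afterReturn (last (s ∷ ys)))
    sum-return s ys = trans (sum-*ˡ _ _ L) (*-congˡ (sum-*ˡ _ _ L))
    sum-inner : ∀ s → sumL (λ ys → δcall p a s * (Wt s ys * afterReturn (last (s ∷ ys)))) (allVecs n₁ L) ≈ δcall p a s * runSum t (take n₁ w₁) s afterReturn
    sum-inner s = trans (sum-*ˡ _ _ (allVecs n₁ L)) (*-congˡ (iht (take n₁ w₁) (λ i → W (suc i)) (Spells-take n₁ w₁ ag₁)
      (len-take n₁ (suc n₂) w₁ (suc-injective e)) s afterReturn))

  sum-treeWeight : ∀ t → SumsRuns t
  sum-treeWeight nil w W ag e p F = trans (+-identityʳ _) (*-identityˡ _)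
  sum-treeWeight (int t) = sumsRuns-int t (sum-treeWeight t)
  sum-treeWeight (call t u) = sumsRuns-call t u (sum-treeWeight t) (sum-treeWeight u)

-- Sums over all trees of a given size.  splitSum m H sums H a b over all a + 1 + b = m
-- (the sizes of the two subtrees of a call), and treeSum n G sums G over all trees of
-- size n; the recursion is on a fuel bound, shown irrelevant by treeSumFuel-fuel.
module TreeSums {c ℓ} (K : CommutativeSemiring c ℓ) where

  open import Data.Bool.Base using (_∧_)
  open import Data.Nat.Base using (zero; suc; _<_; _≤_; s≤s) renaming (_+_ to _+ℕ_)
  open import Data.Nat.Properties using (≤-trans; ≤-refl; m≤m+n; m≤n+m; suc-injective; n≤1+n)
  open import Data.List.Base using ([]; _∷_)
  open import Data.Product.Base using (_×_; _,_)
  import Relation.Binary.PropositionalEquality as P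
  open P using (_≡_; _≢_)
  open import Relation.Nullary using (does; yes; no)
  open import Relation.Nullary.Decidable using (dec-false; map′; _×-dec_)
  open import Relation.Binary.Definitions using (DecidableEquality)
  open CommutativeSemiring K
  open Series K
  open FiniteSums K
  open Trees
  open import Algebra.Properties.CommutativeSemigroup +-commutativeSemigroup using (interchange)
  open import Relation.Binary.Reasoning.Setoid setoid

  _≟ᵗ_ : DecidableEquality Tree
  nil ≟ᵗ nil = yes P.refl
  int t ≟ᵗ int t' = map′ (P.cong int) int-injective (t ≟ᵗ t')
    where
    int-injective : int t ≡ int t' → t ≡ t'
    int-injective P.refl = P.refl
  call t u ≟ᵗ call t' u' = map′ (λ { (P.refl , P.refl) → P.refl }) call-injective ((t ≟ᵗ t') ×-dec (u ≟ᵗ u'))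
    where
    call-injective : call t u ≡ call t' u' → (t ≡ t') × (u ≡ u')
    call-injective P.refl = P.refl , P.refl
  nil ≟ᵗ int _ = no (λ ())
  nil ≟ᵗ call _ _ = no (λ ())
  int _ ≟ᵗ nil = no (λ ())
  int _ ≟ᵗ call _ _ = no (λ ())
  call _ _ ≟ᵗ nil = no (λ ())
  call _ _ ≟ᵗ int _ = no (λ ())

  -- Σ_{a + 1 + b = m} H a b
  splitSum : ℕ → (ℕ → ℕ → Carrier) → Carrier
  splitSum zero H = 0#
  splitSum (suc m) H = H 0 m + splitSum m (λ a b → H (suc a) b)

  splitSum-cong : ∀ m {H H'} → (∀ a b → a +ℕ suc b ≡ m → H a b ≈ H' a b) → splitSum m H ≈ splitSum m H'
  splitSum-cong zero e = refl
  splitSum-cong (suc m) e = +-cong (e 0 m P.refl) (splitSum-cong m (λ a b eab → e (suc a) b (P.cong suc eab)))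

  splitSum-zero : ∀ m {H} → (∀ a b → a +ℕ suc b ≡ m → H a b ≈ 0#) → splitSum m H ≈ 0#
  splitSum-zero zero e = refl
  splitSum-zero (suc m) e = trans (+-cong (e 0 m P.refl) (splitSum-zero m (λ a b eab → e (suc a) b (P.cong suc eab)))) (+-identityˡ _)

  splitSum-single : ∀ m {H} a₀ b₀ → a₀ +ℕ suc b₀ ≡ m → (∀ a b → a +ℕ suc b ≡ m → a ≢ a₀ → H a b ≈ 0#) → splitSum m H ≈ H a₀ b₀
  splitSum-single (suc m) zero b₀ e h with suc-injective e
  ... | P.refl = trans (+-congˡ (splitSum-zero m (λ a b eab → h (suc a) b (P.cong suc eab) (λ ())))) (+-identityʳ _)
  splitSum-single (suc m) (suc a₀) b₀ e h =
    trans (+-congʳ (h 0 m P.refl (λ ()))) (trans (+-identityˡ _)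
      (splitSum-single m a₀ b₀ (suc-injective e) (λ a b eab ne → h (suc a) b (P.cong suc eab) (λ x → ne (suc-injective x)))))

  splitSum-+ : ∀ m (H H' : ℕ → ℕ → Carrier) → splitSum m (λ a b → H a b + H' a b) ≈ splitSum m H + splitSum m H'
  splitSum-+ zero H H' = sym (+-identityˡ _)
  splitSum-+ (suc m) H H' = trans (+-congˡ (splitSum-+ m _ _)) (interchange _ _ _ _)

  splitSum-*ˡ : ∀ m k (H : ℕ → ℕ → Carrier) → splitSum m (λ a b → k * H a b) ≈ k * splitSum m H
  splitSum-*ˡ zero k H = sym (zeroʳ k)
  splitSum-*ˡ (suc m) k H = trans (+-congˡ (splitSum-*ˡ m k _)) (sym (distribˡ k _ _))

  -- the sum of G over the trees of size n, for any fuel f > n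
  treeSumFuel : ℕ → ℕ → (Tree → Carrier) → Carrier
  treeSumFuel zero n G = 0#
  treeSumFuel (suc f) zero G = G nil
  treeSumFuel (suc f) (suc m) G = treeSumFuel f m (λ t → G (int t)) + splitSum m (λ a b → treeSumFuel f a (λ t₁ → treeSumFuel f b (λ t₂ → G (call t₁ t₂))))

  treeSum : ℕ → (Tree → Carrier) → Carrier
  treeSum n G = treeSumFuel (suc n) n G

  size-call-eq : ∀ t₁ t₂ {a b m} → size t₁ ≡ a → size t₂ ≡ b → a +ℕ suc b ≡ m → size (call t₁ t₂) ≡ suc m
  size-call-eq t₁ t₂ P.refl P.refl e = P.cong suc e

  treeSumFuel-cong : ∀ f n {G G'} → (∀ t → size t ≡ n → G t ≈ G' t) → treeSumFuel f n G ≈ treeSumFuel f n G'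
  treeSumFuel-cong zero n h = refl
  treeSumFuel-cong (suc f) zero h = h nil P.refl
  treeSumFuel-cong (suc f) (suc m) h = +-cong (treeSumFuel-cong f m (λ t e → h (int t) (P.cong suc e)))
    (splitSum-cong m (λ a b eab → treeSumFuel-cong f a (λ t₁ e₁ → treeSumFuel-cong f b (λ t₂ e₂ → h (call t₁ t₂) (size-call-eq t₁ t₂ e₁ e₂ eab)))))

  treeSumFuel-zero : ∀ f n {G} → (∀ t → size t ≡ n → G t ≈ 0#) → treeSumFuel f n G ≈ 0#
  treeSumFuel-zero zero n h = refl
  treeSumFuel-zero (suc f) zero h = h nil P.refl
  treeSumFuel-zero (suc f) (suc m) h = trans (+-cong (treeSumFuel-zero f m (λ t e → h (int t) (P.cong suc e)))
    (splitSum-zero m (λ a b eab → treeSumFuel-zero f a (λ t₁ e₁ → treeSumFuel-zero f b (λ t₂ e₂ → h (call t₁ t₂) (size-call-eq t₁ t₂ e₁ e₂ eab)))))) (+-identityʳ _)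

  treeSumFuel-+ : ∀ f n (G G' : Tree → Carrier) → treeSumFuel f n (λ t → G t + G' t) ≈ treeSumFuel f n G + treeSumFuel f n G'
  treeSumFuel-+ zero n G G' = sym (+-identityʳ _)
  treeSumFuel-+ (suc f) zero G G' = refl
  treeSumFuel-+ (suc f) (suc m) G G' = trans (+-cong (treeSumFuel-+ f m _ _)
      (trans (splitSum-cong m (λ a b _ → trans (treeSumFuel-cong f a (λ t₁ _ → treeSumFuel-+ f b _ _)) (treeSumFuel-+ f a _ _))) (splitSum-+ m _ _)))
    (interchange _ _ _ _)

  treeSumFuel-*ˡ : ∀ f n k (G : Tree → Carrier) → treeSumFuel f n (λ t → k * G t) ≈ k * treeSumFuel f n G
  treeSumFuel-*ˡ zero n k G = sym (zeroʳ k)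
  treeSumFuel-*ˡ (suc f) zero k G = refl
  treeSumFuel-*ˡ (suc f) (suc m) k G = trans (+-cong (treeSumFuel-*ˡ f m k _)
      (trans (splitSum-cong m (λ a b _ → trans (treeSumFuel-cong f a (λ t₁ _ → treeSumFuel-*ˡ f b k _)) (treeSumFuel-*ˡ f a k _))) (splitSum-*ˡ m k _)))
    (sym (distribˡ k _ _))

  treeSumFuel-*ʳ : ∀ f n k (G : Tree → Carrier) → treeSumFuel f n (λ t → G t * k) ≈ treeSumFuel f n G * k
  treeSumFuel-*ʳ f n k G = trans (treeSumFuel-cong f n (λ t _ → *-comm _ _)) (trans (treeSumFuel-*ˡ f n k G) (*-comm _ _))

  treeSumFuel-sum : ∀ f n {a} {A : Set a} (H : A → Tree → Carrier) xs → treeSumFuel f n (λ t → sumL (λ x → H x t) xs) ≈ sumL (λ x → treeSumFuel f n (H x)) xs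
  treeSumFuel-sum f n H [] = treeSumFuel-zero f n (λ _ _ → refl)
  treeSumFuel-sum f n H (x ∷ xs) = trans (treeSumFuel-+ f n _ _) (+-congˡ (treeSumFuel-sum f n H xs))

  treeSumFuel-fuel : ∀ f f' n G → n < f → n < f' → treeSumFuel f n G ≈ treeSumFuel f' n G
  treeSumFuel-fuel (suc f) (suc f') zero G _ _ = refl
  treeSumFuel-fuel (suc f) (suc f') (suc m) G (s≤s h) (s≤s h') =
    +-cong (treeSumFuel-fuel f f' m _ h h')
      (splitSum-cong m (λ a b eab → trans (treeSumFuel-fuel f f' a _ (la h eab) (la h' eab))
        (treeSumFuel-cong f' a (λ t₁ _ → treeSumFuel-fuel f f' b _ (lb h eab) (lb h' eab)))))
    where
    la : ∀ {a b m g} → suc m ≤ g → a +ℕ suc b ≡ m → a < g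
    la {a} {b} h P.refl = ≤-trans (s≤s (m≤m+n a (suc b))) h
    lb : ∀ {a b m g} → suc m ≤ g → a +ℕ suc b ≡ m → b < g
    lb {a} {b} h P.refl = ≤-trans (s≤s (≤-trans (n≤1+n b) (m≤n+m (suc b) a))) h

  treeSum-cong : ∀ n {G G'} → (∀ t → size t ≡ n → G t ≈ G' t) → treeSum n G ≈ treeSum n G'
  treeSum-cong n = treeSumFuel-cong (suc n) n

  treeSum-zero : ∀ n {G} → (∀ t → size t ≡ n → G t ≈ 0#) → treeSum n G ≈ 0#
  treeSum-zero n = treeSumFuel-zero (suc n) n

  treeSum-*ˡ : ∀ n k (G : Tree → Carrier) → treeSum n (λ t → k * G t) ≈ k * treeSum n G
  treeSum-*ˡ n = treeSumFuel-*ˡ (suc n) n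

  treeSum-*ʳ : ∀ n k (G : Tree → Carrier) → treeSum n (λ t → G t * k) ≈ treeSum n G * k
  treeSum-*ʳ n = treeSumFuel-*ʳ (suc n) n

  treeSum-sum : ∀ n {a} {A : Set a} (H : A → Tree → Carrier) xs → treeSum n (λ t → sumL (λ x → H x t) xs) ≈ sumL (λ x → treeSum n (H x)) xs
  treeSum-sum n = treeSumFuel-sum (suc n) n

  treeSum-unfold : ∀ m G → treeSum (suc m) G ≈ treeSum m (λ t → G (int t)) + splitSum m (λ a b → treeSum a (λ t₁ → treeSum b (λ t₂ → G (call t₁ t₂))))
  treeSum-unfold m G = +-congˡ (splitSum-cong m (λ a b eab → trans (treeSumFuel-fuel (suc m) (suc a) a _ (la eab) ≤-refl)
      (treeSumFuel-cong (suc a) a (λ t₁ _ → treeSumFuel-fuel (suc m) (suc b) b _ (lb eab) ≤-refl))))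
    where
    la : ∀ {a b} → a +ℕ suc b ≡ m → a < suc m
    la {a} {b} P.refl = s≤s (m≤m+n a (suc b))
    lb : ∀ {a b} → a +ℕ suc b ≡ m → b < suc m
    lb {a} {b} P.refl = s≤s (≤-trans (n≤1+n b) (m≤n+m (suc b) a))

  treeSumFuel-count : ∀ f t₀ → size t₀ < f → treeSumFuel f (size t₀) (λ t → 𝟙 (does (t ≟ᵗ t₀))) ≈ 1#
  treeSumFuel-count (suc f) nil _ = refl
  treeSumFuel-count (suc f) (int t₀) (s≤s h) = trans (+-cong (treeSumFuel-count f t₀ h)
      (splitSum-zero (size t₀) (λ a b _ → treeSumFuel-zero f a (λ t₁ _ → treeSumFuel-zero f b (λ t₂ _ → refl))))) (+-identityʳ _)
  treeSumFuel-count (suc f) (call t₀ u₀) (s≤s h) = trans (+-cong (treeSumFuel-zero f _ (λ t _ → refl))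
      (splitSum-single (size t₀ +ℕ suc (size u₀)) (size t₀) (size u₀) P.refl offDiagonal)) (trans (+-identityˡ _) diagonal)
    where
    n₁ = size t₀
    n₂ = size u₀
    pairSum : ℕ → ℕ → Carrier
    pairSum a b = treeSumFuel f a (λ t₁ → treeSumFuel f b (λ t₂ → 𝟙 (does (t₁ ≟ᵗ t₀) ∧ does (t₂ ≟ᵗ u₀))))
    split : ∀ a b → pairSum a b ≈ treeSumFuel f a (λ t₁ → 𝟙 (does (t₁ ≟ᵗ t₀))) * treeSumFuel f b (λ t₂ → 𝟙 (does (t₂ ≟ᵗ u₀)))
    split a b = trans (treeSumFuel-cong f a (λ t₁ _ → trans (treeSumFuel-cong f b (λ t₂ _ → 𝟙-∧ _ _)) (treeSumFuel-*ˡ f b _ _))) (treeSumFuel-*ʳ f a _ _)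
    offDiagonal : ∀ a b → a +ℕ suc b ≡ n₁ +ℕ suc n₂ → a ≢ n₁ → pairSum a b ≈ 0#
    offDiagonal a b _ ne = trans (split a b) (trans (*-congʳ (treeSumFuel-zero f a (λ t₁ e → reflexive (P.cong 𝟙 (dec-false (t₁ ≟ᵗ t₀) (λ x → ne (P.trans (P.sym e) (P.cong size x)))))))) (zeroˡ _))
    la : n₁ < f
    la = ≤-trans (s≤s (m≤m+n n₁ (suc n₂))) h
    lb : n₂ < f
    lb = ≤-trans (s≤s (≤-trans (n≤1+n n₂) (m≤n+m (suc n₂) n₁))) h
    diagonal : pairSum n₁ n₂ ≈ 1#
    diagonal = trans (split n₁ n₂) (trans (*-cong (treeSumFuel-count f t₀ la) (treeSumFuel-count f u₀ lb)) (*-identityˡ _))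

  treeSum-count : ∀ t₀ → treeSum (size t₀) (λ t → 𝟙 (does (t ≟ᵗ t₀))) ≈ 1#
  treeSum-count t₀ = treeSumFuel-count (suc (size t₀)) t₀ ≤-refl

-- Summing ‖A‖(w, ν) over the nesting matrices ν of width N
-- is the same as summing over the trees t of size N the value at the matrix of t,
-- since every nesting matrix is the matrix of exactly one tree; at the matrix of t the
-- automaton sum is Σ_p ι(p) · runSum t w p κ.
module ProjectionAsTreeSum {c ℓ} (K : CommutativeSemiring c ℓ) {k : ℕ} (A : Series.WNWA K k) where

  open import Data.Bool.Base using (true; false; T)
  import Data.Bool.Properties as BoolP
  open import Data.Nat.Base using (suc)
  open import Data.Fin.Base using (Fin; toℕ)
  open import Data.Vec.Base using (Vec; []; _∷_; lookup; last; head; fromList)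
  import Data.Vec.Properties as VecP
  open import Data.List.Base using (List; []; _∷_; map; allFin; length)
  open import Data.Product.Base using (_,_; proj₁; proj₂)
  open import Data.Unit.Base using (tt)
  import Relation.Binary.PropositionalEquality as P
  open P using (_≡_; _≢_)
  open import Relation.Nullary using (does)
  open import Relation.Nullary.Decidable using (dec-false; does-⇔)
  open import Relation.Binary.Definitions using (DecidableEquality)
  open import Function.Bundles using (_⇔_; mk⇔)
  open CommutativeSemiring K
  open Series K
  open WNWA A
  open FiniteSums K
  open NestingRelations
  open Trees
  open TreeEncoding
  open BooleanMatrices
  open TreeMatrices
  open TreeRuns K A
  open VecLookup
  open RunSums K A
  open TreeSums K
  open import Relation.Binary.Reasoning.Setoid setoid

  _≟ᴹ_ : ∀ {N} → DecidableEquality (BRel N)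
  _≟ᴹ_ = VecP.≡-dec (VecP.≡-dec BoolP._≟_)

  allBRel-selects : ∀ N → Selects _≟ᴹ_ (allBRel N)
  allBRel-selects N = allVecs-selects (VecP.≡-dec BoolP._≟_) (allVecs N bits) (allVecs-selects BoolP._≟_ bits bits-selects N) N

  nesting-count : ∀ N (ν : BRel N) → 𝟙 (isNesting ν) ≈ treeSum N (λ t → 𝟙 (does (ν ≟ᴹ matrixOf N (treeRel t))))
  nesting-count N ν with isNesting ν in e
  ... | true = sym (trans (treeSum-cong N (λ t st → reflexive (P.cong 𝟙 (does-⇔ (same t st) (ν ≟ᴹ matrixOf N (treeRel t)) (t ≟ᵗ t₀))))) (count s₀))
    where
    V = isNesting⇒Nesting ν (P.subst T (P.sym e) tt)
    decomposition = treeRel-surjective V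
    t₀ = proj₁ decomposition
    s₀ : size t₀ ≡ N
    s₀ = proj₁ (proj₂ decomposition)
    ν≡ : ν ≡ matrixOf N (treeRel t₀)
    ν≡ = asRel-ext ν (matrixOf N (treeRel t₀)) (λ i j il jl →
      P.trans (P.sym (proj₂ (proj₂ decomposition) i j il jl)) (P.sym (asRel-tabulateRows N N (treeRel t₀) i j il jl)))
    same : ∀ t → size t ≡ N → (ν ≡ matrixOf N (treeRel t)) ⇔ (t ≡ t₀)
    same t st = mk⇔ (λ eq → matrixOf-tree-injective N t t₀ st s₀ (P.trans (P.sym eq) ν≡)) (λ { P.refl → ν≡ })
    count : ∀ {n} → size t₀ ≡ n → treeSum n (λ t → 𝟙 (does (t ≟ᵗ t₀))) ≈ 1#
    count P.refl = treeSum-count t₀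
  ... | false = sym (treeSum-zero N (λ t st → reflexive (P.cong 𝟙 (dec-false (ν ≟ᴹ _) (λ eq → notMatrix t st eq)))))
    where
    notMatrix : ∀ t → size t ≡ N → ν ≢ matrixOf N (treeRel t)
    notMatrix t st eq = P.subst T (P.trans (P.cong isNesting (P.sym eq)) e) (matrixOf-tree-nesting N t st)

  automatonSum : ∀ {N} → Vec (Fin k) N → BRel N → Carrier
  automatonSum {N} w ν = Σᴸ (map (λ qs → ι (head qs) * runWeight A w ν qs * κ (last qs)) (allVecs (suc N) (allFin q)))

  Spells-fromList : ∀ d (l : List (Fin k)) → Spells l (lookupD d (fromList l))
  Spells-fromList d [] = tt
  Spells-fromList d (x ∷ l) = P.refl , Spells-fromList d l

  automatonSum-tree : ∀ t {N} (w : Vec (Fin k) N) (wl : List (Fin k)) (W : ℕ → Fin k) → size t ≡ N → length wl ≡ N → Spells wl W →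
    (∀ p → lookup w p ≡ W (toℕ p)) → automatonSum w (matrixOf N (treeRel t)) ≈ sumFin q (λ p → ι p * runSum t wl p κ)
  automatonSum-tree t w wl W P.refl len ag hw = begin
    sumL (λ qs → ι (head qs) * runWeight A w ν qs * κ (last qs)) (allVecs (suc n) L) ≈⟨ allVecs-suc n L _ ⟩
    sumL (λ p → sumL (λ xs → ι p * runWeight A w ν (p ∷ xs) * κ (last (p ∷ xs))) (allVecs n L)) L
      ≈⟨ sum-cong L (λ p → trans (sum-cong (allVecs n L) (λ xs → factor p xs)) (trans (sum-*ˡ (ι p) _ (allVecs n L)) (*-congˡ (sum-treeWeight t wl W ag len p κ)))) ⟩
    sumFin q (λ p → ι p * runSum t wl p κ) ∎
    where
    n = size t
    ν = matrixOf n (treeRel t)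
    L = allFin q
    factor : ∀ p xs → ι p * runWeight A w ν (p ∷ xs) * κ (last (p ∷ xs)) ≈ ι p * (treeWeight t W (lookupD p (p ∷ xs)) * κ (last (p ∷ xs)))
    factor p xs = trans (*-assoc _ _ _) (*-congˡ (*-congʳ (trans (runWeight-tree t w (p ∷ xs) W (lookupD p (p ∷ xs)) P.refl hw (λ i → lookup-lookupD p (p ∷ xs) i)) (prodBelow-treeKind t W _))))

  guard-𝟙 : ∀ b (f : T b → Carrier) (F : Carrier) → (∀ pr → f pr ≈ F) → guard b f ≈ 𝟙 b * F
  guard-𝟙 true f F h = trans (h tt) (sym (*-identityˡ _))
  guard-𝟙 false f F h = sym (zeroˡ _)

  π-as-treeSum : ∀ (S : NW k → Carrier) → (∀ x → S x ≈ ‖ A ‖ x) → ∀ a as →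
    π S (a ∷ as) ≈ treeSum (suc (length as)) (λ t → sumFin q (λ p → ι p * runSum t (a ∷ as) p κ))
  π-as-treeSum S reg a as = begin
    π S (a ∷ as) ≈⟨ sum-cong (allBRel N) (λ ν → guard-𝟙 (isNesting ν) _ (automatonSum w ν) (λ pr → reg _)) ⟩
    sumL (λ ν → 𝟙 (isNesting ν) * automatonSum w ν) (allBRel N) ≈⟨ sum-cong (allBRel N) (λ ν → *-congʳ (nesting-count N ν)) ⟩
    sumL (λ ν → treeSum N (λ t → isMatrix t ν) * automatonSum w ν) (allBRel N)
      ≈⟨ sum-cong (allBRel N) (λ ν → sym (treeSum-*ʳ N (automatonSum w ν) (λ t → isMatrix t ν))) ⟩
    sumL (λ ν → treeSum N (λ t → isMatrix t ν * automatonSum w ν)) (allBRel N)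
      ≈⟨ sym (treeSum-sum N (λ ν t → isMatrix t ν * automatonSum w ν) (allBRel N)) ⟩
    treeSum N (λ t → sumL (λ ν → isMatrix t ν * automatonSum w ν) (allBRel N)) ≈⟨ treeSum-cong N (λ t _ → select t) ⟩
    treeSum N (λ t → automatonSum w (matrixOf N (treeRel t)))
      ≈⟨ treeSum-cong N (λ t st → automatonSum-tree t w (a ∷ as) (lookupD a w) st P.refl (Spells-fromList a (a ∷ as)) (λ p → lookup-lookupD a w p)) ⟩
    treeSum N (λ t → sumFin q (λ p → ι p * runSum t (a ∷ as) p κ)) ∎
    where
    N = suc (length as)
    w = fromList (a ∷ as)
    isMatrix : Tree → BRel N → Carrier
    isMatrix t ν = 𝟙 (does (ν ≟ᴹ matrixOf N (treeRel t)))
    select : ∀ t → sumL (λ ν → isMatrix t ν * automatonSum w ν) (allBRel N) ≈ automatonSum w (matrixOf N (treeRel t))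
    select t = trans (sum-cong (allBRel N) (λ ν → 𝟙-* _ (automatonSum w ν))) (allBRel-selects N (matrixOf N (treeRel t)) (automatonSum w))

module CauchyProduct {c ℓ} (K : CommutativeSemiring c ℓ) {k : ℕ} where

  open import Data.Bool.Base using (true; false)
  open import Data.Nat.Base using (suc) renaming (_+_ to _+ℕ_)
  open import Data.Fin.Base using (Fin)
  import Data.Fin.Properties as FinP
  open import Data.List.Base using (List; []; _∷_; [_]; take; drop; length)
  import Data.List.Properties as ListP
  open import Data.Product.Base using (_×_; _,_)
  import Relation.Binary.PropositionalEquality as P
  open P using (_≡_)
  open import Relation.Nullary using (does)
  open CommutativeSemiring K
  open Series K
  open FiniteSums K
  open TreeSums K
  open import Relation.Binary.Reasoning.Setoid setoid

  W* : Set
  W* = List (Fin k)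

  splitTerm : (W* → Carrier) → (W* → Carrier) → W* × W* → Carrier
  splitTerm S T (u , v) = S u * T v

  cauchy-def : ∀ (S T : FPS k) w → (S · T) w ≡ sumL (splitTerm S T) (splits w)
  cauchy-def S T w = P.cong Σᴸ (ListP.map-cong (λ { (u , v) → P.refl }) (splits w))

  ·-cons : ∀ (S T : FPS k) c w → (S · T) (c ∷ w) ≈ S [] * T (c ∷ w) + ((λ u → S (c ∷ u)) · T) w
  ·-cons S T c w = reflexive (P.trans (cauchy-def S T (c ∷ w)) (P.cong (S [] * T (c ∷ w) +_)
    (P.trans (sum-map (splitTerm S T) _ (splits w)) (P.trans (P.cong Σᴸ (ListP.map-cong (λ { (u , v) → P.refl }) (splits w))) (P.sym (cauchy-def (λ u → S (c ∷ u)) T w))))))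

  ·-nil : ∀ (S T : FPS k) → (S · T) [] ≈ S [] * T []
  ·-nil S T = +-identityʳ _

  ·-cong : ∀ {S S' T T' : FPS k} → (∀ u → S u ≈ S' u) → (∀ v → T v ≈ T' v) → ∀ w → (S · T) w ≈ (S' · T') w
  ·-cong {S} {S'} {T} {T'} es et w = trans (reflexive (cauchy-def S T w)) (trans (sum-cong (splits w) (λ { (u , v) → *-cong (es u) (et v) })) (reflexive (P.sym (cauchy-def S' T' w))))

  ·-+ˡ : ∀ (S S' T : FPS k) w → ((λ u → S u + S' u) · T) w ≈ (S · T) w + (S' · T) w
  ·-+ˡ S S' T w = trans (reflexive (cauchy-def _ T w)) (trans (trans (sum-cong (splits w) (λ { (u , v) → distribʳ (T v) (S u) (S' u) })) (sum-+ (splitTerm S T) (splitTerm S' T) (splits w)))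
    (+-cong (reflexive (P.sym (cauchy-def S T w))) (reflexive (P.sym (cauchy-def S' T w)))))

  ·-+ʳ : ∀ (S T T' : FPS k) w → (S · (λ v → T v + T' v)) w ≈ (S · T) w + (S · T') w
  ·-+ʳ S T T' w = trans (reflexive (cauchy-def S _ w)) (trans (trans (sum-cong (splits w) (λ { (u , v) → distribˡ (S u) (T v) (T' v) })) (sum-+ (splitTerm S T) (splitTerm S T') (splits w)))
    (+-cong (reflexive (P.sym (cauchy-def S T w))) (reflexive (P.sym (cauchy-def S T' w)))))

  ·-*ˡ : ∀ (x : Carrier) (S T : FPS k) w → ((λ u → x * S u) · T) w ≈ x * (S · T) w
  ·-*ˡ x S T w = trans (reflexive (cauchy-def _ T w)) (trans (trans (sum-cong (splits w) (λ { (u , v) → *-assoc x (S u) (T v) })) (sum-*ˡ x (splitTerm S T) (splits w)))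
    (*-congˡ (reflexive (P.sym (cauchy-def S T w)))))

  ·-*ʳ : ∀ (x : Carrier) (S T : FPS k) w → (S · (λ v → x * T v)) w ≈ x * (S · T) w
  ·-*ʳ x S T w = trans (reflexive (cauchy-def S _ w))
    (trans (trans (sum-cong (splits w) (λ { (u , v) → trans (sym (*-assoc (S u) x (T v))) (trans (*-congʳ (*-comm (S u) x)) (*-assoc x (S u) (T v))) })) (sum-*ˡ x (splitTerm S T) (splits w)))
    (*-congˡ (reflexive (P.sym (cauchy-def S T w)))))

  χa-cons : ∀ (a b : Fin k) w → χ [ a ] (b ∷ w) ≈ 𝟙 (does (a FinP.≟ b)) * χ [] w
  χa-cons a b w with does (a FinP.≟ b)
  ... | true = sym (*-identityˡ _)
  ... | false = sym (zeroˡ _)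

  χε· : ∀ (T : FPS k) w → (χ [] · T) w ≈ T w
  χε· T [] = trans (·-nil (χ []) T) (*-identityˡ _)
  χε· T (c ∷ w) = trans (·-cons (χ []) T c w) (trans (+-cong (*-identityˡ _) (trans (reflexive (cauchy-def _ T w)) (sum-zero (splits w) (λ { (u , v) → zeroˡ _ })))) (+-identityʳ _))

  ·χε : ∀ (T : FPS k) w → (T · χ []) w ≈ T w
  ·χε T [] = trans (·-nil T (χ [])) (*-identityʳ _)
  ·χε T (c ∷ w) = trans (·-cons T (χ []) c w) (trans (+-cong (zeroʳ _) (·χε (λ u → T (c ∷ u)) w)) (+-identityˡ _))

  χa·-nil : ∀ (a : Fin k) (T : FPS k) → (χ [ a ] · T) [] ≈ 0#
  χa·-nil a T = trans (·-nil (χ [ a ]) T) (zeroˡ _)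

  χa·-cons : ∀ (a b : Fin k) (T : FPS k) w → (χ [ a ] · T) (b ∷ w) ≈ 𝟙 (does (a FinP.≟ b)) * T w
  χa·-cons a b T w = begin
    (χ [ a ] · T) (b ∷ w) ≈⟨ ·-cons (χ [ a ]) T b w ⟩
    0# * T (b ∷ w) + ((λ u → χ [ a ] (b ∷ u)) · T) w ≈⟨ +-cong (zeroˡ _) (·-cong (χa-cons a b) (λ v → refl) w) ⟩
    0# + ((λ u → 𝟙 (does (a FinP.≟ b)) * χ [] u) · T) w ≈⟨ +-identityˡ _ ⟩
    ((λ u → 𝟙 (does (a FinP.≟ b)) * χ [] u) · T) w ≈⟨ ·-*ˡ _ (χ []) T w ⟩
    𝟙 (does (a FinP.≟ b)) * (χ [] · T) w ≈⟨ *-congˡ (χε· T w) ⟩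
    𝟙 (does (a FinP.≟ b)) * T w ∎

  splitSum-splits : ∀ (w : W*) (H : ℕ → ℕ → Carrier) (F : W* → W* → Carrier) →
    (∀ n₁ n₂ → n₁ +ℕ suc n₂ ≡ length w → H n₁ n₂ ≈ F (take n₁ w) (drop n₁ w)) → (∀ u → F u [] ≈ 0#) →
    splitSum (length w) H ≈ sumL (λ { (u , v) → F u v }) (splits w)
  splitSum-splits [] H F h h0 = sym (trans (+-identityʳ _) (h0 []))
  splitSum-splits (c ∷ w) H F h h0 = +-cong (h 0 (length w) P.refl)
    (trans (splitSum-splits w (λ a b → H (suc a) b) (λ u v → F (c ∷ u) v) (λ n₁ n₂ e → h (suc n₁) n₂ (P.cong suc e)) (λ u → h0 (c ∷ u)))
      (reflexive (P.sym (sum-map (λ { (u , v) → F u v }) (λ { (u , v) → (c ∷ u , v) }) (splits w)))))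


-- Splitting off the first
-- position of a nonempty word (an internal letter, or a call together with its matching
-- return) expresses Y⁺ in terms of Y (Y-first-letter).  runSum is linear in its
-- final weight F (runSum-linear), which lets the final states be summed out.
module TreeGrammar {c ℓ} (K : CommutativeSemiring c ℓ) {k : ℕ} (A : Series.WNWA K k) where

  open import Data.Nat.Base using (suc) renaming (_+_ to _+ℕ_)
  open import Data.Nat.Properties using (suc-injective)
  open import Data.Fin.Base using (Fin)
  import Data.Fin.Properties as FinP
  open import Data.List.Base using (List; []; _∷_; take; drop; length; allFin)
  open import Data.Product.Base using (_,_)
  import Relation.Binary.PropositionalEquality as P
  open P using (_≡_)
  open import Relation.Nullary using (does)
  open import Relation.Nullary.Decidable using (does-⇔)
  open import Function.Bundles using (mk⇔)
  open CommutativeSemiring K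
  open Series K
  open WNWA A
  open FiniteSums K
  open Trees
  open TreeSums K
  open RunSums K A
  open CauchyProduct K {k}
  open import Relation.Binary.Reasoning.Setoid setoid

  kron : Fin q → Fin q → Carrier
  kron r x = 𝟙 (does (x FinP.≟ r))

  kron-select : ∀ (x₀ : Fin q) (g : Fin q → Carrier) → sumFin q (λ x → kron x x₀ * g x) ≈ g x₀
  kron-select x₀ g = trans (sum-cong (allFin q) (λ x → reflexive (P.cong (λ b → 𝟙 b * g x) (does-⇔ (mk⇔ P.sym P.sym) (x₀ FinP.≟ x) (x FinP.≟ x₀)))))
    (sumFin-𝟙 q x₀ g)

  sum-matrix : ∀ (c : Fin q → Carrier) (G : Fin q → Fin q → Carrier) (F : Fin q → Carrier) →
    sumFin q (λ s → c s * sumFin q (λ x → G s x * F x)) ≈ sumFin q (λ x → sumFin q (λ s → c s * G s x) * F x)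
  sum-matrix c G F = begin
    sumFin q (λ s → c s * sumFin q (λ x → G s x * F x)) ≈⟨ sum-cong L (λ s → sym (sum-*ˡ (c s) _ L)) ⟩
    sumFin q (λ s → sumFin q (λ x → c s * (G s x * F x))) ≈⟨ sum-swap (λ s x → c s * (G s x * F x)) L L ⟩
    sumFin q (λ x → sumFin q (λ s → c s * (G s x * F x))) ≈⟨ sum-cong L (λ x → trans (sum-cong L (λ s → sym (*-assoc _ _ _))) (sum-*ʳ (F x) _ L)) ⟩
    sumFin q (λ x → sumFin q (λ s → c s * G s x) * F x) ∎
    where L = allFin q

  mutual
    runSum-linear : ∀ t w p (F : Fin q → Carrier) → runSum t w p F ≈ sumFin q (λ x → runSum t w p (kron x) * F x)
    runSum-linear nil w p F = sym (kron-select p F)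
    runSum-linear (int t) [] p F = sym (sum-zero (allFin q) (λ x → zeroˡ _))
    runSum-linear (int t) (a ∷ w) p F = trans (sum-cong (allFin q) (λ s → *-congˡ (runSum-linear t w s F))) (sum-matrix (λ s → δint p a s) (λ s x → runSum t w s (kron x)) F)
    runSum-linear (call t u) [] p F = sym (sum-zero (allFin q) (λ x → zeroˡ _))
    runSum-linear (call t u) (a ∷ w) p F = begin
      sumFin q (λ s → δcall p a s * runSum t u₁ s (λ y → returnSum u rest p y F))
        ≈⟨ sum-cong L (λ s → *-congˡ (trans (runSum-linear t u₁ s _) (sum-cong L (λ y → *-congˡ (returnSum-linear u rest p y F))))) ⟩
      sumFin q (λ s → δcall p a s * sumFin q (λ y → runSum t u₁ s (kron y) * sumFin q (λ x → returnSum u rest p y (kron x) * F x)))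
        ≈⟨ sum-cong L (λ s → *-congˡ (sum-matrix (λ y → runSum t u₁ s (kron y)) (λ y x → returnSum u rest p y (kron x)) F)) ⟩
      sumFin q (λ s → δcall p a s * sumFin q (λ x → sumFin q (λ y → runSum t u₁ s (kron y) * returnSum u rest p y (kron x)) * F x))
        ≈⟨ sum-matrix (λ s → δcall p a s) (λ s x → sumFin q (λ y → runSum t u₁ s (kron y) * returnSum u rest p y (kron x))) F ⟩
      sumFin q (λ x → sumFin q (λ s → δcall p a s * sumFin q (λ y → runSum t u₁ s (kron y) * returnSum u rest p y (kron x))) * F x)
        ≈⟨ sum-cong L (λ x → *-congʳ (sum-cong L (λ s → *-congˡ (sym (runSum-linear t u₁ s (λ y → returnSum u rest p y (kron x))))))) ⟩
      sumFin q (λ x → runSum (call t u) (a ∷ w) p (kron x) * F x) ∎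
      where
      L = allFin q
      u₁ = take (size t) w
      rest = drop (size t) w

    returnSum-linear : ∀ u rest p y (F : Fin q → Carrier) → returnSum u rest p y F ≈ sumFin q (λ x → returnSum u rest p y (kron x) * F x)
    returnSum-linear u [] p y F = sym (sum-zero (allFin q) (λ x → zeroˡ _))
    returnSum-linear u (b ∷ v) p y F = trans (sum-cong (allFin q) (λ r → *-congˡ (runSum-linear u v r F))) (sum-matrix (λ r → δret y p b r) (λ r x → runSum u v r (kron x)) F)

  Y : Fin q → Fin q → List (Fin k) → Carrier
  Y s y w = treeSum (length w) (λ t → runSum t w s (kron y))

  -- Y restricted to nonempty words: the quasiregular series that are the variables
  Y⁺ : Fin q → Fin q → FPS k
  Y⁺ s y [] = 0#
  Y⁺ s y (c ∷ w) = Y s y (c ∷ w)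

  -- Y = Y⁺ + [s = y]·χ [], since the only tree of size 0 is nil
  Y-Y⁺ : ∀ s y w → Y s y w ≈ Y⁺ s y w + kron y s * χ [] w
  Y-Y⁺ s y [] = sym (trans (+-identityˡ _) (*-identityʳ _))
  Y-Y⁺ s y (c ∷ w) = sym (trans (+-congˡ (zeroʳ _)) (+-identityʳ _))

  Y-lin : ∀ s w (F : Fin q → Carrier) → treeSum (length w) (λ t → runSum t w s F) ≈ sumFin q (λ y → Y s y w * F y)
  Y-lin s w F = trans (treeSum-cong (length w) (λ t _ → runSum-linear t w s F))
    (trans (treeSum-sum (length w) (λ x t → runSum t w s (kron x) * F x) (allFin q))
      (sum-cong (allFin q) (λ y → treeSum-*ʳ (length w) (F y) _)))

  Φ : Fin q → Fin q → Fin k → List (Fin k) → List (Fin k) → Carrier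
  Φ p r a₀ u [] = 0#
  Φ p r a₀ u (b ∷ v) = sumFin q (λ s → δcall p a₀ s * sumFin q (λ y → Y s y u * sumFin q (λ r' → δret y p b r' * Y r' r v)))

  treeSum-pull-right : ∀ n (cc : Fin q → Carrier) (M : Fin q → Fin q → Carrier) (X : Tree → Fin q → Carrier) →
    treeSum n (λ u → sumFin q (λ s → cc s * sumFin q (λ y → M s y * X u y))) ≈ sumFin q (λ s → cc s * sumFin q (λ y → M s y * treeSum n (λ u → X u y)))
  treeSum-pull-right n cc M X = trans (treeSum-sum n (λ s u → cc s * sumFin q (λ y → M s y * X u y)) L)
    (sum-cong L (λ s → trans (treeSum-*ˡ n (cc s) _) (*-congˡ (trans (treeSum-sum n (λ y u → M s y * X u y) L)
      (sum-cong L (λ y → treeSum-*ˡ n (M s y) _))))))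
    where L = allFin q

  treeSum-pull-left : ∀ n (cc : Fin q → Carrier) (M : Tree → Fin q → Fin q → Carrier) (Z : Fin q → Carrier) →
    treeSum n (λ t → sumFin q (λ s → cc s * sumFin q (λ y → M t s y * Z y))) ≈ sumFin q (λ s → cc s * sumFin q (λ y → treeSum n (λ t → M t s y) * Z y))
  treeSum-pull-left n cc M Z = trans (treeSum-sum n (λ s t → cc s * sumFin q (λ y → M t s y * Z y)) L)
    (sum-cong L (λ s → trans (treeSum-*ˡ n (cc s) _) (*-congˡ (trans (treeSum-sum n (λ y t → M t s y * Z y) L)
      (sum-cong L (λ y → treeSum-*ʳ n (Z y) (λ t → M t s y)))))))
    where L = allFin q

  call-contribution : ∀ p r a₀ w' n₁ n₂ → n₁ +ℕ suc n₂ ≡ length w' →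
    treeSum n₁ (λ t → treeSum n₂ (λ u → runSum (call t u) (a₀ ∷ w') p (kron r))) ≈ Φ p r a₀ (take n₁ w') (drop n₁ w')
  call-contribution p r a₀ w' n₁ n₂ e with drop n₁ w' in deq | len-drop n₁ (suc n₂) w' (P.sym e)
  ... | b ∷ v | lenv = begin
    treeSum n₁ (λ t → treeSum n₂ (λ u → runSum (call t u) (a₀ ∷ w') p (kron r)))
      ≈⟨ treeSum-cong n₁ (λ t st → treeSum-cong n₂ (λ u _ → reflexive (P.trans
             (P.cong (λ z → sumFin q (λ s → δcall p a₀ s * runSum t (take z w') s (λ x → returnSum u (drop z w') p x (kron r)))) st)
             (P.cong (λ z → sumFin q (λ s → δcall p a₀ s * runSum t u₁ s (λ x → returnSum u z p x (kron r)))) deq)))) ⟩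
    treeSum n₁ (λ t → treeSum n₂ (λ u → sumFin q (λ s → δcall p a₀ s * runSum t u₁ s (λ x → returnSum u (b ∷ v) p x (kron r)))))
      ≈⟨ treeSum-cong n₁ (λ t _ → treeSum-cong n₂ (λ u _ → sum-cong L (λ s → *-congˡ (runSum-linear t u₁ s _)))) ⟩
    treeSum n₁ (λ t → treeSum n₂ (λ u → sumFin q (λ s → δcall p a₀ s * sumFin q (λ y → runSum t u₁ s (kron y) * returnSum u (b ∷ v) p y (kron r)))))
      ≈⟨ treeSum-cong n₁ (λ t _ → treeSum-pull-right n₂ (λ s → δcall p a₀ s) (λ s y → runSum t u₁ s (kron y)) (λ u y → returnSum u (b ∷ v) p y (kron r))) ⟩
    treeSum n₁ (λ t → sumFin q (λ s → δcall p a₀ s * sumFin q (λ y → runSum t u₁ s (kron y) * treeSum n₂ (λ u → returnSum u (b ∷ v) p y (kron r)))))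
      ≈⟨ treeSum-pull-left n₁ (λ s → δcall p a₀ s) (λ t s y → runSum t u₁ s (kron y)) (λ y → treeSum n₂ (λ u → returnSum u (b ∷ v) p y (kron r))) ⟩
    sumFin q (λ s → δcall p a₀ s * sumFin q (λ y → treeSum n₁ (λ t → runSum t u₁ s (kron y)) * treeSum n₂ (λ u → returnSum u (b ∷ v) p y (kron r))))
      ≈⟨ sum-cong L (λ s → *-congˡ (sum-cong L (λ y → *-cong (reflexive (P.cong (λ n → treeSum n (λ t → runSum t u₁ s (kron y))) (P.sym lt))) (afterReturn y)))) ⟩
    Φ p r a₀ u₁ (b ∷ v) ∎
    where
    L = allFin q
    u₁ = take n₁ w'
    lt : length u₁ ≡ n₁
    lt = len-take n₁ (suc n₂) w' (P.sym e)
    afterReturn : ∀ y → treeSum n₂ (λ u → returnSum u (b ∷ v) p y (kron r)) ≈ sumFin q (λ r' → δret y p b r' * Y r' r v)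
    afterReturn y = trans (treeSum-sum n₂ (λ r' u → δret y p b r' * runSum u v r' (kron r)) L)
      (sum-cong L (λ r' → trans (treeSum-*ˡ n₂ _ _) (*-congˡ (reflexive (P.cong (λ n → treeSum n (λ u → runSum u v r' (kron r))) (suc-injective (P.sym lenv)))))))

  Y-first-letter : ∀ p r a₀ w' → Y p r (a₀ ∷ w') ≈ sumFin q (λ s → δint p a₀ s * Y s r w') + sumL (λ { (u , v₀) → Φ p r a₀ u v₀ }) (splits w')
  Y-first-letter p r a₀ w' = trans (treeSum-unfold (length w') (λ t → runSum t (a₀ ∷ w') p (kron r))) (+-cong internal calls)
    where
    L = allFin q
    internal : treeSum (length w') (λ t → runSum (int t) (a₀ ∷ w') p (kron r)) ≈ sumFin q (λ s → δint p a₀ s * Y s r w')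
    internal = trans (treeSum-sum (length w') (λ s t → δint p a₀ s * runSum t w' s (kron r)) L) (sum-cong L (λ s → treeSum-*ˡ (length w') _ _))
    calls : splitSum (length w') (λ n₁ n₂ → treeSum n₁ (λ t → treeSum n₂ (λ u → runSum (call t u) (a₀ ∷ w') p (kron r))))
            ≈ sumL (λ { (u , v₀) → Φ p r a₀ u v₀ }) (splits w')
    calls = splitSum-splits w' _ (Φ p r a₀) (call-contribution p r a₀ w') (λ u → refl)
-- Every monomial starts with a letter, so the system is proper; its right-hand sides
-- are built from LetterMonomials (coefficient, first letter, rest).  The equation for
-- Y⁺ p r transcribes Y-first-letter, with Ŷ s y = Y⁺ s y + [s = y]·χ [] expanded into
-- monomials, and Z = Σ ι(p) κ(r) Y⁺ p r.
module AlgebraicSystem {c ℓ} (K : CommutativeSemiring c ℓ) {k : ℕ} (A : Series.WNWA K k) where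

  open import Data.Nat.Base using (suc; _*_)
  open import Data.Fin.Base using (Fin; combine; remQuot) renaming (zero to fzero; suc to fsuc)
  import Data.Fin.Properties as FinP
  open import Data.List.Base using (List; []; _∷_; [_]; map; length; allFin; concatMap; _++_)
  open import Data.Sum.Base using (inj₁; inj₂)
  open import Data.Product.Base using (_×_; _,_; proj₁; proj₂)
  open import Data.Maybe.Base using (nothing)
  import Relation.Binary.PropositionalEquality as P
  open P using (_≡_)
  open import Relation.Nullary using (does)
  open CommutativeSemiring K renaming (_*_ to _⊗_)
  open Series K
  open WNWA A
  open FiniteSums K
  open TreeSums K
  open RunSums K A
  open CauchyProduct K {k}
  open TreeGrammar K A
  open ProjectionAsTreeSum K A using (π-as-treeSum)
  open import Relation.Binary.Reasoning.Setoid setoid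
  open import Algebra.Solver.Ring.NaturalCoefficients K (λ _ _ → nothing)

  L : List (Fin q)
  L = allFin q

  La : List (Fin k)
  La = allFin k

  -- the variables: fzero stands for Z and fsuc (combine s r) for Y⁺ s r
  varCount : ℕ
  varCount = suc (q * q)

  varY : Fin q → Fin q → Fin varCount
  varY s r = fsuc (combine s r)

  Z : FPS k
  Z w = sumFin q (λ p → sumFin q (λ r → (ι p ⊗ κ r) ⊗ Y⁺ p r w))

  solution : Fin varCount → FPS k
  solution fzero = Z
  solution (fsuc x) = Y⁺ (proj₁ (remQuot {q} q x)) (proj₂ (remQuot {q} q x))

  solution-varY : ∀ s r w → solution (varY s r) w ≡ Y⁺ s r w
  solution-varY s r w = P.cong (λ sr → Y⁺ (proj₁ sr) (proj₂ sr) w) (FinP.remQuot-combine {q} {q} s r)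

  LetterMonomial : Set c
  LetterMonomial = Carrier × Fin k × List (Sym k varCount)

  evalLM : LetterMonomial → FPS k
  evalLM (x , a , u) w = x ⊗ (χ [ a ] · evalMono solution u) w

  evalLMs : List LetterMonomial → FPS k
  evalLMs E w = sumL (λ e → evalLM e w) E

  toPoly : List LetterMonomial → Poly k varCount
  toPoly = map (λ e → (proj₁ e , inj₁ (proj₁ (proj₂ e)) ∷ proj₂ (proj₂ e)))

  toPoly-eval : ∀ w (f : Carrier × List (Sym k varCount) → Carrier) → (∀ x u → f (x , u) ≡ x ⊗ evalMono solution u w) → ∀ E → Σᴸ (map f (toPoly E)) ≈ evalLMs E w
  toPoly-eval w f h [] = refl
  toPoly-eval w f h ((x , a , u) ∷ E) = +-cong (reflexive (h x (inj₁ a ∷ u))) (toPoly-eval w f h E)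

  evalLMs-++ : ∀ E E' w → evalLMs (E ++ E') w ≈ evalLMs E w + evalLMs E' w
  evalLMs-++ E E' w = sum-++ (λ e → evalLM e w) E E'

  evalLMs-concatMap : ∀ {a} {B : Set a} (f : B → List LetterMonomial) xs w → evalLMs (concatMap f xs) w ≈ sumL (λ x → evalLMs (f x) w) xs
  evalLMs-concatMap f xs w = sum-concatMap (λ e → evalLM e w) f xs

  evalLM-nil : ∀ e → evalLM e [] ≈ 0#
  evalLM-nil (x , a , u) = trans (*-congˡ (χa·-nil a (evalMono solution u))) (zeroʳ x)

  evalLMs-nil : ∀ E → evalLMs E [] ≈ 0#
  evalLMs-nil E = sum-zero E evalLM-nil

  evalLM-cons : ∀ x a u a₀ w' → evalLM (x , a , u) (a₀ ∷ w') ≈ 𝟙 (does (a FinP.≟ a₀)) ⊗ (x ⊗ evalMono solution u w')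
  evalLM-cons x a u a₀ w' = trans (*-congˡ (χa·-cons a a₀ (evalMono solution u) w')) (trans (sym (*-assoc _ _ _)) (trans (*-congʳ (*-comm _ _)) (*-assoc _ _ _)))

  module _ (p r : Fin q) where

    -- δint(p,a,r) · a  +  Σ_s δint(p,a,s) · a · Y⁺ s r, i.e. Σ_s δint(p,a,s) · a · Ŷ s r
    internalMonomials : List LetterMonomial
    internalMonomials = concatMap (λ a → (δint p a r , a , []) ∷ map (λ s → (δint p a s , a , inj₂ (varY s r) ∷ [])) L) La

    callCoeff : Fin k → Fin q → Fin q → Fin k → Fin q → Carrier
    callCoeff a s y b r' = δcall p a s ⊗ δret y p b r'

    -- the four monomials of δcall(p,a,s) δret(y,p,b,r') · a · Ŷ s y · b · Ŷ r' r
    callMonomials4 : Fin k → Fin q → Fin q → Fin k → Fin q → List LetterMonomial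
    callMonomials4 a s y b r' =
      (callCoeff a s y b r' , a , inj₂ (varY s y) ∷ inj₁ b ∷ inj₂ (varY r' r) ∷ [])
      ∷ (callCoeff a s y b r' ⊗ kron r r' , a , inj₂ (varY s y) ∷ inj₁ b ∷ [])
      ∷ (callCoeff a s y b r' ⊗ kron y s , a , inj₁ b ∷ inj₂ (varY r' r) ∷ [])
      ∷ (callCoeff a s y b r' ⊗ (kron y s ⊗ kron r r') , a , inj₁ b ∷ [])
      ∷ []

    callMonomials : List LetterMonomial
    callMonomials = concatMap (λ a → concatMap (λ s → concatMap (λ y → concatMap (λ b → concatMap (λ r' → callMonomials4 a s y b r') L) La) L) L) La

    equationY : List LetterMonomial
    equationY = internalMonomials ++ callMonomials

    internalMonomials-eval : ∀ a₀ w' → evalLMs internalMonomials (a₀ ∷ w') ≈ sumFin q (λ s → δint p a₀ s ⊗ Y s r w')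
    internalMonomials-eval a₀ w' = begin
      evalLMs internalMonomials (a₀ ∷ w') ≈⟨ evalLMs-concatMap _ La (a₀ ∷ w') ⟩
      sumL (λ a → evalLM (δint p a r , a , []) (a₀ ∷ w') + evalLMs (map (λ s → (δint p a s , a , inj₂ (varY s r) ∷ [])) L) (a₀ ∷ w')) La
        ≈⟨ sum-cong La (λ a → +-cong (evalLM-cons _ a [] a₀ w') (trans (reflexive (sum-map (λ e → evalLM e (a₀ ∷ w')) _ L))
             (trans (sum-cong L (λ s → trans (evalLM-cons (δint p a s) a (inj₂ (varY s r) ∷ []) a₀ w') (*-congˡ (*-congˡ (trans (·χε (solution (varY s r)) w') (reflexive (solution-varY s r w'))))))) (sum-*ˡ _ _ L)))) ⟩
      sumL (λ a → 𝟙 (does (a FinP.≟ a₀)) ⊗ (δint p a r ⊗ χ [] w') + 𝟙 (does (a FinP.≟ a₀)) ⊗ sumFin q (λ s → δint p a s ⊗ Y⁺ s r w')) La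
        ≈⟨ sum-cong La (λ a → sym (distribˡ _ _ _)) ⟩
      sumL (λ a → 𝟙 (does (a FinP.≟ a₀)) ⊗ (δint p a r ⊗ χ [] w' + sumFin q (λ s → δint p a s ⊗ Y⁺ s r w'))) La ≈⟨ sumFin-𝟙 k a₀ _ ⟩
      δint p a₀ r ⊗ χ [] w' + sumFin q (λ s → δint p a₀ s ⊗ Y⁺ s r w') ≈⟨ +-comm _ _ ⟩
      sumFin q (λ s → δint p a₀ s ⊗ Y⁺ s r w') + δint p a₀ r ⊗ χ [] w' ≈⟨ +-congˡ (sym (sumFin-𝟙 q r (λ s → δint p a₀ s ⊗ χ [] w'))) ⟩
      sumFin q (λ s → δint p a₀ s ⊗ Y⁺ s r w') + sumFin q (λ s → kron r s ⊗ (δint p a₀ s ⊗ χ [] w')) ≈⟨ sym (sum-+ _ _ L) ⟩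
      sumFin q (λ s → δint p a₀ s ⊗ Y⁺ s r w' + kron r s ⊗ (δint p a₀ s ⊗ χ [] w'))
        ≈⟨ sum-cong L (λ s → trans (+-congˡ (trans (sym (*-assoc _ _ _)) (trans (*-congʳ (*-comm _ _)) (*-assoc _ _ _)))) (trans (sym (distribˡ _ _ _)) (*-congˡ (sym (Y-Y⁺ s r w'))))) ⟩
      sumFin q (λ s → δint p a₀ s ⊗ Y s r w') ∎

    -- Ŷ x y = Y⁺ x y + [x = y]·χ [], i.e. Y x y written with the variables
    Ŷ : Fin q → Fin q → FPS k
    Ŷ x y u = Y⁺ x y u + kron y x ⊗ χ [] u

    callValue : List (Fin k) → Fin q → Fin q → Fin k → Fin q → Carrier
    callValue w' s y b r' = (Ŷ s y · (χ [ b ] · Ŷ r' r)) w'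

    callValue-expand : ∀ w' s y b r' → callValue w' s y b r' ≈
      ((Y⁺ s y · (χ [ b ] · Y⁺ r' r)) w' + kron r r' ⊗ (Y⁺ s y · (χ [ b ] · χ [])) w')
      + kron y s ⊗ ((χ [ b ] · Y⁺ r' r) w' + kron r r' ⊗ (χ [ b ] · χ []) w')
    callValue-expand w' s y b r' = begin
      (Ŷ s y · V) w' ≈⟨ ·-+ˡ (Y⁺ s y) (λ u → d₁ ⊗ χ [] u) V w' ⟩
      (Y⁺ s y · V) w' + ((λ u → d₁ ⊗ χ [] u) · V) w' ≈⟨ +-congˡ (trans (·-*ˡ d₁ (χ []) V w') (*-congˡ (χε· V w'))) ⟩
      (Y⁺ s y · V) w' + d₁ ⊗ V w' ≈⟨ +-cong (trans (·-cong (λ u → refl) Vexp w') (trans (·-+ʳ (Y⁺ s y) (χ [ b ] · Y⁺ r' r) (λ v → d₂ ⊗ (χ [ b ] · χ []) v) w') (+-congˡ (·-*ʳ d₂ (Y⁺ s y) (χ [ b ] · χ []) w')))) (*-congˡ (Vexp w')) ⟩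
      ((Y⁺ s y · (χ [ b ] · Y⁺ r' r)) w' + d₂ ⊗ (Y⁺ s y · (χ [ b ] · χ [])) w') + d₁ ⊗ ((χ [ b ] · Y⁺ r' r) w' + d₂ ⊗ (χ [ b ] · χ []) w') ∎
      where
      d₁ = kron y s
      d₂ = kron r r'
      V : FPS k
      V = χ [ b ] · Ŷ r' r
      Vexp : ∀ v → V v ≈ (χ [ b ] · Y⁺ r' r) v + d₂ ⊗ (χ [ b ] · χ []) v
      Vexp v = trans (·-+ʳ (χ [ b ]) (Y⁺ r' r) (λ v → d₂ ⊗ χ [] v) v) (+-congˡ (·-*ʳ d₂ (χ [ b ]) (χ []) v))

    callMonomials4-eval : ∀ a₀ w' a s y b r' → evalLMs (callMonomials4 a s y b r') (a₀ ∷ w') ≈ 𝟙 (does (a FinP.≟ a₀)) ⊗ (callCoeff a s y b r' ⊗ callValue w' s y b r')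
    callMonomials4-eval a₀ w' a s y b r' = begin
      value₁ + (value₂ + (value₃ + (value₄ + 0#))) ≈⟨ +-cong eval₁ (+-cong eval₂ (+-cong eval₃ (trans (+-identityʳ _) eval₄))) ⟩
      I ⊗ (cf ⊗ E₁) + (I ⊗ ((cf ⊗ d₂) ⊗ E₂) + (I ⊗ ((cf ⊗ d₁) ⊗ E₃) + I ⊗ ((cf ⊗ (d₁ ⊗ d₂)) ⊗ E₄)))
        ≈⟨ solve 8 (λ I cf d₁ d₂ E₁ E₂ E₃ E₄ → I :* (cf :* E₁) :+ (I :* ((cf :* d₂) :* E₂) :+ (I :* ((cf :* d₁) :* E₃) :+ I :* ((cf :* (d₁ :* d₂)) :* E₄)))
                    := I :* (cf :* (((E₁ :+ d₂ :* E₂) :+ d₁ :* (E₃ :+ d₂ :* E₄))))) refl I cf d₁ d₂ E₁ E₂ E₃ E₄ ⟩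
      I ⊗ (cf ⊗ (((E₁ + d₂ ⊗ E₂) + d₁ ⊗ (E₃ + d₂ ⊗ E₄)))) ≈⟨ *-congˡ (*-congˡ (sym (callValue-expand w' s y b r'))) ⟩
      I ⊗ (cf ⊗ callValue w' s y b r') ∎
      where
      I = 𝟙 (does (a FinP.≟ a₀))
      cf = callCoeff a s y b r'
      d₁ = kron y s
      d₂ = kron r r'
      E₁ = (Y⁺ s y · (χ [ b ] · Y⁺ r' r)) w'
      E₂ = (Y⁺ s y · (χ [ b ] · χ [])) w'
      E₃ = (χ [ b ] · Y⁺ r' r) w'
      E₄ = (χ [ b ] · χ []) w'
      rest₁ rest₂ rest₃ rest₄ : List (Sym k varCount)
      rest₁ = inj₂ (varY s y) ∷ inj₁ b ∷ inj₂ (varY r' r) ∷ []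
      rest₂ = inj₂ (varY s y) ∷ inj₁ b ∷ []
      rest₃ = inj₁ b ∷ inj₂ (varY r' r) ∷ []
      rest₄ = inj₁ b ∷ []
      value₁ = evalLM (cf , a , rest₁) (a₀ ∷ w')
      value₂ = evalLM (cf ⊗ d₂ , a , rest₂) (a₀ ∷ w')
      value₃ = evalLM (cf ⊗ d₁ , a , rest₃) (a₀ ∷ w')
      value₄ = evalLM (cf ⊗ (d₁ ⊗ d₂) , a , rest₄) (a₀ ∷ w')
      solution-Y⁺ : ∀ v → (solution (varY r' r) · χ []) v ≈ Y⁺ r' r v
      solution-Y⁺ v = trans (·χε (solution (varY r' r)) v) (reflexive (solution-varY r' r v))
      eval₁ : value₁ ≈ I ⊗ (cf ⊗ E₁)
      eval₁ = trans (evalLM-cons cf a rest₁ a₀ w') (*-congˡ (*-congˡ (·-cong (λ u → reflexive (solution-varY s y u)) (λ v → ·-cong (λ _ → refl) solution-Y⁺ v) w')))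
      eval₂ : value₂ ≈ I ⊗ ((cf ⊗ d₂) ⊗ E₂)
      eval₂ = trans (evalLM-cons (cf ⊗ d₂) a rest₂ a₀ w') (*-congˡ (*-congˡ (·-cong (λ u → reflexive (solution-varY s y u)) (λ v → refl) w')))
      eval₃ : value₃ ≈ I ⊗ ((cf ⊗ d₁) ⊗ E₃)
      eval₃ = trans (evalLM-cons (cf ⊗ d₁) a rest₃ a₀ w') (*-congˡ (*-congˡ (·-cong (λ _ → refl) solution-Y⁺ w')))
      eval₄ : value₄ ≈ I ⊗ ((cf ⊗ (d₁ ⊗ d₂)) ⊗ E₄)
      eval₄ = evalLM-cons (cf ⊗ (d₁ ⊗ d₂)) a rest₄ a₀ w'

    sum4 : (Fin q → Fin q → Fin k → Fin q → Carrier) → Carrier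
    sum4 f = sumL (λ s → sumL (λ y → sumL (λ b → sumL (λ r' → f s y b r') L) La) L) L

    sum4-cong : ∀ {f g} → (∀ s y b r' → f s y b r' ≈ g s y b r') → sum4 f ≈ sum4 g
    sum4-cong h = sum-cong L (λ s → sum-cong L (λ y → sum-cong La (λ b → sum-cong L (λ r' → h s y b r'))))

    sum4-*ˡ : ∀ x f → sum4 (λ s y b r' → x ⊗ f s y b r') ≈ x ⊗ sum4 f
    sum4-*ˡ x f = trans (sum-cong L (λ s → trans (sum-cong L (λ y → trans (sum-cong La (λ b → sum-*ˡ x _ L)) (sum-*ˡ x _ La))) (sum-*ˡ x _ L))) (sum-*ˡ x _ L)

    sum4-pull : ∀ {a} {X : Set a} (xs : List X) (cf : Fin q → Fin q → Fin k → Fin q → Carrier) (g : Fin q → Fin q → Fin k → Fin q → X → Carrier) →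
      sum4 (λ s y b r' → cf s y b r' ⊗ sumL (g s y b r') xs) ≈ sumL (λ x → sum4 (λ s y b r' → cf s y b r' ⊗ g s y b r' x)) xs
    sum4-pull xs cf g =
      trans (sum-cong L (λ s → trans (sum-cong L (λ y → trans (sum-cong La (λ b →
          trans (sum-cong L (λ r' → sym (sum-*ˡ (cf s y b r') (g s y b r') xs))) (sum-swap (λ r' x → cf s y b r' ⊗ g s y b r' x) L xs)))
        (sum-swap _ La xs))) (sum-swap _ L xs))) (sum-swap _ L xs)

    sum4-at-split : ∀ a₀ u v₀ → sum4 (λ s y b r' → callCoeff a₀ s y b r' ⊗ (Ŷ s y u ⊗ (χ [ b ] · Ŷ r' r) v₀)) ≈ Φ p r a₀ u v₀
    sum4-at-split a₀ u [] = trans (sum4-cong (λ s y b r' → trans (*-congˡ (trans (*-congˡ (χa·-nil b (Ŷ r' r))) (zeroʳ _))) (zeroʳ _)))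
      (sum-zero L (λ s → sum-zero L (λ y → sum-zero La (λ b → sum-zero L (λ _ → refl)))))
    sum4-at-split a₀ u (b' ∷ v) = sum-cong L (λ s → trans (sum-cong L (λ y → inner s y)) (sum-*ˡ _ _ L))
      where
      inner : ∀ s y → sumL (λ b → sumL (λ r' → callCoeff a₀ s y b r' ⊗ (Ŷ s y u ⊗ (χ [ b ] · Ŷ r' r) (b' ∷ v))) L) La
                    ≈ δcall p a₀ s ⊗ (Y s y u ⊗ sumFin q (λ r' → δret y p b' r' ⊗ Y r' r v))
      inner s y = begin
        sumL (λ b → sumL (λ r' → callCoeff a₀ s y b r' ⊗ (Ŷ s y u ⊗ (χ [ b ] · Ŷ r' r) (b' ∷ v))) L) La
          ≈⟨ sum-cong La (λ b → sum-cong L (λ r' → *-congˡ (*-congˡ (χa·-cons b b' (Ŷ r' r) v)))) ⟩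
        sumL (λ b → sumL (λ r' → (δcall p a₀ s ⊗ δret y p b r') ⊗ (Ŷ s y u ⊗ (𝟙 (does (b FinP.≟ b')) ⊗ Ŷ r' r v))) L) La
          ≈⟨ sum-cong La (λ b → trans (sum-cong L (λ r' → solve 5 (λ D E Yh I Yr → (D :* E) :* (Yh :* (I :* Yr)) := I :* (D :* (Yh :* (E :* Yr)))) refl
                (δcall p a₀ s) (δret y p b r') (Ŷ s y u) (𝟙 (does (b FinP.≟ b'))) (Ŷ r' r v))) (sum-*ˡ _ _ L)) ⟩
        sumL (λ b → 𝟙 (does (b FinP.≟ b')) ⊗ sumFin q (λ r' → δcall p a₀ s ⊗ (Ŷ s y u ⊗ (δret y p b r' ⊗ Ŷ r' r v)))) La ≈⟨ sumFin-𝟙 k b' _ ⟩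
        sumFin q (λ r' → δcall p a₀ s ⊗ (Ŷ s y u ⊗ (δret y p b' r' ⊗ Ŷ r' r v)))
          ≈⟨ trans (sum-*ˡ _ _ L) (*-congˡ (sum-*ˡ _ _ L)) ⟩
        δcall p a₀ s ⊗ (Ŷ s y u ⊗ sumFin q (λ r' → δret y p b' r' ⊗ Ŷ r' r v))
          ≈⟨ *-congˡ (*-cong (sym (Y-Y⁺ s y u)) (sum-cong L (λ r' → *-congˡ (sym (Y-Y⁺ r' r v))))) ⟩
        δcall p a₀ s ⊗ (Y s y u ⊗ sumFin q (λ r' → δret y p b' r' ⊗ Y r' r v)) ∎

    callMonomials-eval : ∀ a₀ w' → evalLMs callMonomials (a₀ ∷ w') ≈ sumL (λ { (u , v₀) → Φ p r a₀ u v₀ }) (splits w')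
    callMonomials-eval a₀ w' = begin
      evalLMs callMonomials (a₀ ∷ w') ≈⟨ unfold ⟩
      sumL (λ a → sum4 (λ s y b r' → evalLMs (callMonomials4 a s y b r') (a₀ ∷ w'))) La ≈⟨ sum-cong La (λ a → sum4-cong (callMonomials4-eval a₀ w' a)) ⟩
      sumL (λ a → sum4 (λ s y b r' → 𝟙 (does (a FinP.≟ a₀)) ⊗ (callCoeff a s y b r' ⊗ callValue w' s y b r'))) La
        ≈⟨ sum-cong La (λ a → sum4-*ˡ _ _) ⟩
      sumL (λ a → 𝟙 (does (a FinP.≟ a₀)) ⊗ sum4 (λ s y b r' → callCoeff a s y b r' ⊗ callValue w' s y b r')) La ≈⟨ sumFin-𝟙 k a₀ _ ⟩
      sum4 (λ s y b r' → callCoeff a₀ s y b r' ⊗ callValue w' s y b r')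
        ≈⟨ sum4-cong (λ s y b r' → *-congˡ (reflexive (cauchy-def (Ŷ s y) (χ [ b ] · Ŷ r' r) w'))) ⟩
      sum4 (λ s y b r' → callCoeff a₀ s y b r' ⊗ sumL (splitTerm (Ŷ s y) (χ [ b ] · Ŷ r' r)) (splits w'))
        ≈⟨ sum4-pull (splits w') (callCoeff a₀) (λ s y b r' → splitTerm (Ŷ s y) (χ [ b ] · Ŷ r' r)) ⟩
      sumL (λ sp → sum4 (λ s y b r' → callCoeff a₀ s y b r' ⊗ splitTerm (Ŷ s y) (χ [ b ] · Ŷ r' r) sp)) (splits w')
        ≈⟨ sum-cong (splits w') (λ { (u , v₀) → sum4-at-split a₀ u v₀ }) ⟩
      sumL (λ { (u , v₀) → Φ p r a₀ u v₀ }) (splits w') ∎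
      where
      unfold : evalLMs callMonomials (a₀ ∷ w') ≈ sumL (λ a → sum4 (λ s y b r' → evalLMs (callMonomials4 a s y b r') (a₀ ∷ w'))) La
      unfold = trans (evalLMs-concatMap (λ a → concatMap (λ s → concatMap (λ y → concatMap (λ b → concatMap (λ r' → callMonomials4 a s y b r') L) La) L) L) La (a₀ ∷ w'))
        (sum-cong La (λ a → trans (evalLMs-concatMap (λ s → concatMap (λ y → concatMap (λ b → concatMap (λ r' → callMonomials4 a s y b r') L) La) L) L (a₀ ∷ w'))
        (sum-cong L (λ s → trans (evalLMs-concatMap (λ y → concatMap (λ b → concatMap (λ r' → callMonomials4 a s y b r') L) La) L (a₀ ∷ w'))
        (sum-cong L (λ y → trans (evalLMs-concatMap (λ b → concatMap (λ r' → callMonomials4 a s y b r') L) La (a₀ ∷ w'))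
        (sum-cong La (λ b → evalLMs-concatMap (λ r' → callMonomials4 a s y b r') L (a₀ ∷ w')))))))))

    Y⁺-solves : ∀ w → Y⁺ p r w ≈ evalLMs equationY w
    Y⁺-solves [] = sym (evalLMs-nil equationY)
    Y⁺-solves (a₀ ∷ w') = trans (Y-first-letter p r a₀ w') (sym (trans (evalLMs-++ internalMonomials callMonomials (a₀ ∷ w')) (+-cong (internalMonomials-eval a₀ w') (callMonomials-eval a₀ w'))))


  scaleLM : Carrier → LetterMonomial → LetterMonomial
  scaleLM x (c' , a , u) = (x ⊗ c' , a , u)

  evalLMs-scale : ∀ x E w → evalLMs (map (scaleLM x) E) w ≈ x ⊗ evalLMs E w
  evalLMs-scale x E w = trans (reflexive (sum-map (λ e → evalLM e w) (scaleLM x) E))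
    (trans (sum-cong E (λ { (c' , a , u) → *-assoc x c' _ })) (sum-*ˡ x (λ e → evalLM e w) E))

  equationZ : List LetterMonomial
  equationZ = concatMap (λ p → concatMap (λ r → map (scaleLM (ι p ⊗ κ r)) (equationY p r)) L) L

  Z-solves : ∀ w → Z w ≈ evalLMs equationZ w
  Z-solves w = begin
    sumFin q (λ p → sumFin q (λ r → (ι p ⊗ κ r) ⊗ Y⁺ p r w)) ≈⟨ sum-cong L (λ p → sum-cong L (λ r → *-congˡ (Y⁺-solves p r w))) ⟩
    sumFin q (λ p → sumFin q (λ r → (ι p ⊗ κ r) ⊗ evalLMs (equationY p r) w)) ≈⟨ sum-cong L (λ p → sum-cong L (λ r → sym (evalLMs-scale (ι p ⊗ κ r) (equationY p r) w))) ⟩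
    sumFin q (λ p → sumFin q (λ r → evalLMs (map (scaleLM (ι p ⊗ κ r)) (equationY p r)) w))
      ≈⟨ sym (trans (evalLMs-concatMap (λ p → concatMap (λ r → map (scaleLM (ι p ⊗ κ r)) (equationY p r)) L) L w) (sum-cong L (λ p → evalLMs-concatMap (λ r → map (scaleLM (ι p ⊗ κ r)) (equationY p r)) L w))) ⟩
    evalLMs equationZ w ∎

  equation : Fin varCount → List LetterMonomial
  equation fzero = equationZ
  equation (fsuc x) = equationY (proj₁ (remQuot {q} q x)) (proj₂ (remQuot {q} q x))

  system : Fin varCount → Poly k varCount
  system X = toPoly (equation X)

  solution-equation : ∀ X w → solution X w ≈ evalLMs (equation X) w
  solution-equation fzero = Z-solves
  solution-equation (fsuc x) = Y⁺-solves (proj₁ (remQuot {q} q x)) (proj₂ (remQuot {q} q x))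

  solves : IsSolution system solution
  solves X w = trans (solution-equation X w) (sym (toPoly-eval w _ (λ x u → P.refl) (equation X)))

  quasiregular : Quasiregular solution
  quasiregular fzero = sum-zero L (λ p → sum-zero L (λ r → zeroʳ _))
  quasiregular (fsuc x) = refl

  letters-only : ∀ (f : Carrier × List (Sym k varCount) → Carrier) → (∀ c' a u → f (c' , inj₁ a ∷ u) ≈ 0#) → ∀ E → Σᴸ (map f (toPoly E)) ≈ 0#
  letters-only f h [] = refl
  letters-only f h ((c' , a , u) ∷ E) = trans (+-cong (h c' a u) (letters-only f h E)) (+-identityˡ _)

  proper : Proper system
  proper X = letters-only _ (λ _ _ _ → refl) (equation X) , (λ Y → letters-only _ (λ _ _ _ → refl) (equation X))

  π-is-Z : ∀ (S : NW k → Carrier) → (∀ x → S x ≈ ‖ A ‖ x) → ∀ w → π S w ≈ solution fzero w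
  π-is-Z S S≈A [] = sym (quasiregular fzero)
  π-is-Z S S≈A (a ∷ as) = begin
    π S (a ∷ as) ≈⟨ π-as-treeSum S S≈A a as ⟩
    treeSum N (λ t → sumFin q (λ p → ι p ⊗ runSum t (a ∷ as) p κ)) ≈⟨ treeSum-sum N (λ p t → ι p ⊗ runSum t (a ∷ as) p κ) L ⟩
    sumFin q (λ p → treeSum N (λ t → ι p ⊗ runSum t (a ∷ as) p κ)) ≈⟨ sum-cong L (λ p → trans (treeSum-*ˡ N (ι p) (λ t → runSum t (a ∷ as) p κ)) (*-congˡ (Y-lin p (a ∷ as) κ))) ⟩
    sumFin q (λ p → ι p ⊗ sumFin q (λ r → Y p r (a ∷ as) ⊗ κ r)) ≈⟨ sum-cong L (λ p → trans (sym (sum-*ˡ (ι p) _ L))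
         (sum-cong L (λ r → solve 3 (λ I Yv Kv → I :* (Yv :* Kv) := (I :* Kv) :* Yv) refl (ι p) (Y p r (a ∷ as)) (κ r)))) ⟩
    Z (a ∷ as) ∎
    where N = suc (length as)

proposition6p3 : ∀ {c ℓ} (K : CommutativeSemiring c ℓ) →
    ¬ (CommutativeSemiring._≈_ K (CommutativeSemiring.0# K) (CommutativeSemiring.1# K)) →
    (k : ℕ) (S : NW k → CommutativeSemiring.Carrier K) →
    Series.IsRegular K S → Series.IsAlgebraic K (Series.π K S)
proposition6p3 K _ k S (A , S≈A) =
  varCount , system , proper , solution , solves , quasiregular , fzero , π-is-Z S S≈A
  where open AlgebraicSystem K A
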